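{- There is an absolute constant $c>0$ and an algorithm that, given a binary matrix $M\in\{0,1\}^{n\times n}$, runs in time $\mathcal{O}(n^2)$ and outputs a rectangle-decomposition $\mathcal{R}'$ of $M$ with $|\mathcal{R}'|\le c\,|\mathcal{R}|$, where $\mathcal{R}$ is a rectangle-decomposition of $M$ of minimum cardinality.
   Context: A $1$-rectangle of a binary matrix is a contiguous submatrix (the intersection of a set of consecutive rows and a set of consecutive columns) all of whose entries are $1$. A rectangle-decomposition of $M$ is a collection of pairwise disjoint $1$-rectangles whose union is exactly the set of $1$-entries of $M$. Running times are measured in a word-RAM/unit-cost model where operations on integers in $[n]$ take constant time. -}

module Defs where

open import Data.Nat using (ℕ; zero; suc; _+_; _*_; _∸_; _^_; _≤_; _<_; _<ᵇ_; _≡ᵇ_)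
open import Data.Bool using (Bool; true; false; if_then_else_)
open import Data.Fin using (Fin; toℕ; fromℕ<)
open import Data.Nat using (_<?_)
open import Data.Nat.DivMod using (_/_; _%_)
open import Relation.Nullary using (yes; no)
open import Data.List using (List; []; _∷_; length; lookup; applyUpTo)
open import Data.Maybe using (Maybe; just; nothing)
open import Data.Product using (_×_; ∃; ∃-syntax; _,_)
open import Relation.Binary.PropositionalEquality using (_≡_; _≢_)
open import Relation.Nullary using (¬_)
open import Function.Bundles using (_⇔_)

Matrix : ℕ → Set
Matrix n = Fin n → Fin n → Bool

-- A rectangle: rows top ≤ i < bot, columns left ≤ j < right (half-open).
record Rect : Set where
  constructor rect
  field
    top bot left right : ℕ
open Rect public

_∈R_ : ℕ × ℕ → Rect → Set
(i , j) ∈R r = (top r ≤ i × i < bot r) × (left r ≤ j × j < right r)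

Is1Rect : ∀ {n} → Matrix n → Rect → Set
Is1Rect {n} M r =
  (top r < bot r × bot r ≤ n) × (left r < right r × right r ≤ n) ×
  (∀ (i j : Fin n) → (toℕ i , toℕ j) ∈R r → M i j ≡ true)

IsDecomposition : ∀ {n} → Matrix n → List Rect → Set
IsDecomposition {n} M R =
  (∀ (p : Fin (length R)) → Is1Rect M (lookup R p)) ×
  (∀ (p q : Fin (length R)) → p ≢ q → ∀ i j →
     ¬ ((i , j) ∈R lookup R p × (i , j) ∈R lookup R q)) ×
  (∀ (i j : Fin n) →
     (M i j ≡ true) ⇔ (∃[ p ] ((toℕ i , toℕ j) ∈R lookup R p)))

Memory : Set
Memory = ℕ → ℕ

update : Memory → ℕ → ℕ → Memory
update m a v x = if x ≡ᵇ a then v else m x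

-- Instructions; arguments are register (memory cell) addresses,
-- except the constant of `const` and jump targets.
data Instr : Set where
  const : (r k : ℕ) → Instr
  add   : (r a b : ℕ) → Instr
  sub   : (r a b : ℕ) → Instr
  mul   : (r a b : ℕ) → Instr
  load  : (r a : ℕ) → Instr
  store : (a b : ℕ) → Instr
  jlt   : (a b l : ℕ) → Instr
  jmp   : (l : ℕ) → Instr
  halt  : Instr

Program : Set
Program = List Instr

record Config : Set where
  constructor config
  field
    pc  : ℕ
    mem : Memory
open Config public

fetch : Program → ℕ → Instr
fetch []       _       = halt
fetch (i ∷ _)  zero    = i
fetch (_ ∷ is) (suc k) = fetch is k

exec : Instr → Config → Maybe Config
exec (const r k) (config p m) = just (config (suc p) (update m r k))
exec (add r a b) (config p m) = just (config (suc p) (update m r (m a + m b)))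
exec (sub r a b) (config p m) = just (config (suc p) (update m r (m a ∸ m b)))
exec (mul r a b) (config p m) = just (config (suc p) (update m r (m a * m b)))
exec (load r a)  (config p m) = just (config (suc p) (update m r (m (m a))))
exec (store a b) (config p m) = just (config (suc p) (update m (m a) (m b)))
exec (jlt a b l) (config p m) = just (config (if m a <ᵇ m b then l else suc p) m)
exec (jmp l)     (config p m) = just (config l m)
exec halt        _            = nothing

-- one step; nothing means the machine has halted (halt instruction or pc
-- outside the program)
step : Program → Config → Maybe Config
step P c = exec (fetch P (pc c)) c

run : Program → ℕ → Config → Config
run P zero    c = c
run P (suc t) c with step P c
... | nothing = c
... | just c' = run P t c'

Halted : Program → Config → Set
Halted P c = step P c ≡ nothing

-- Input: m[0] = n, m[1 + i*n + j] = M i j (1 for true, 0 for false), all else 0.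
bit : Bool → ℕ
bit true  = 1
bit false = 0

-- entry of M at natural-number coordinates (false when out of range)
entry : ∀ {n} → Matrix n → ℕ → ℕ → Bool
entry {n} M i j with i <? n | j <? n
... | yes i<n | yes j<n = M (fromℕ< i<n) (fromℕ< j<n)
... | _       | _       = false

initMemory : ∀ {n} → Matrix n → Memory
initMemory {n}     M zero    = n
initMemory {zero}  M (suc a) = 0
initMemory {suc k} M (suc a) = bit (entry M (a / suc k) (a % suc k))

initConfig : ∀ {n} → Matrix n → Config
initConfig M = config 0 (initMemory M)

-- Output: on halting, m[0] = number k of rectangles, and rectangle t < k is
-- stored as (top, bot, left, right) in m[1+4t], m[2+4t], m[3+4t], m[4+4t].
decodeRect : Memory → ℕ → Rect
decodeRect m t = rect (m (1 + 4 * t)) (m (2 + 4 * t)) (m (3 + 4 * t)) (m (4 + 4 * t))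

decodeOutput : Memory → List Rect
decodeOutput m = applyUpTo (decodeRect m) (m 0)

-- P computes, on input M, an output list O within T steps using words of
-- w·log(n+2) bits (all memory contents stay below (n+2)^w).
RunsWithin : Program → (w T : ℕ) → ∀ {n} → Matrix n → (List Rect → Set) → Set
RunsWithin P w T {n} M Good =
  ∃[ t ] (t ≤ T × Halted P (run P t (initConfig M)) ×
          (∀ s → s ≤ t → ∀ a → mem (run P s (initConfig M)) a < (2 + n) ^ w) ×
          Good (decodeOutput (mem (run P t (initConfig M)))))

-- The greedy decomposition stacks maximal runs: for every maximal run of ones [l, r) in a row i,
-- the rows i ≤ a < d carrying exactly the same run at column l form a block [i, d) × [l, r), and
-- these blocks partition the ones of M. Against any decomposition R, each block is charged to a
-- corner (i , c) of a rectangle of R, where c = l, or c = min r r′ when the row above has a run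
-- [l, r′) with r′ ≢ r. Since the runs of row i are disjoint, c determines the block, so there are
-- at most 4 |R| blocks. The machine computes the run ends by a right-to-left scan of every row and
-- the block ends by a bottom-up scan, with O(1) steps per cell and all words below (n + 2) ^ 10.

module Submission where

open import Defs
open import Data.Bool using (Bool; true; false; if_then_else_; _∧_; not; T)
open import Data.Bool.Properties using (∧-zeroʳ)
open import Data.Empty using (⊥; ⊥-elim)
open import Data.Fin using (Fin; toℕ; fromℕ<; combine)
import Data.Fin as F
open import Data.Fin.Properties using (toℕ<n; fromℕ<-toℕ; toℕ-fromℕ<; combine-injective; injective⇒≤)
open import Data.List using (List; []; _∷_; _++_; length; lookup; applyUpTo)
open import Data.List.Properties using (length-++; ++-assoc; ++-identityʳ)
open import Data.List.Membership.Propositional using (_∈_)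
open import Data.List.Membership.Propositional.Properties using (∈-++⁺ˡ; ∈-++⁺ʳ; ∈-++⁻; ∈-lookup)
open import Data.List.Relation.Unary.All as All using ([]; _∷_)
open import Data.List.Relation.Unary.AllPairs using ([]; _∷_)
open import Data.List.Relation.Unary.Any using (here; index)
open import Data.List.Relation.Unary.Any.Properties using (lookup-index)
open import Data.List.Relation.Unary.Unique.Propositional using (Unique)
import Data.List.Relation.Unary.Unique.Propositional.Properties as Unique
open import Data.Maybe using (just; nothing)
open import Data.Nat
open import Data.Nat.DivMod
open import Data.Nat.Divisibility using (n∣m*n)
open import Data.Nat.Properties
open import Data.Nat.Solver using (module +-*-Solver)
open +-*-Solver using (solve; _:+_; _:*_; _:^_; _:=_; con)
open import Data.Product
open import Data.Sum using (inj₁; inj₂)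
open import Function.Base using (case_of_)
open import Function.Bundles using (_⇔_; mk⇔; Equivalence)
open import Relation.Binary using (tri<; tri≈; tri>)
open import Relation.Binary.PropositionalEquality
open import Relation.Nullary

true≢false : true ≢ false
true≢false ()

≡ᵇ-true : ∀ {a b} → (a ≡ᵇ b) ≡ true → a ≡ b
≡ᵇ-true {a} {b} e = ≡ᵇ⇒≡ a b (subst T (sym e) _)

≡ᵇ-false : ∀ {a b} → (a ≡ᵇ b) ≡ false → a ≢ b
≡ᵇ-false {a} {b} e a≡b = subst T e (≡⇒≡ᵇ a b a≡b)

≢⇒≡ᵇ-false : ∀ {a b} → a ≢ b → (a ≡ᵇ b) ≡ false
≢⇒≡ᵇ-false {a} {b} a≢b with a ≡ᵇ b in e
... | false = refl
... | true  = ⊥-elim (a≢b (≡ᵇ-true e))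

≡⇒≡ᵇ-true : ∀ {a b} → a ≡ b → (a ≡ᵇ b) ≡ true
≡⇒≡ᵇ-true {a} {b} a≡b with a ≡ᵇ b in e
... | true  = refl
... | false = ⊥-elim (≡ᵇ-false e a≡b)

<⇒<ᵇ-true : ∀ {a b} → a < b → (a <ᵇ b) ≡ true
<⇒<ᵇ-true {a} {b} a<b with a <ᵇ b in e
... | true  = refl
... | false = ⊥-elim (subst T e (<⇒<ᵇ a<b))

≮⇒<ᵇ-false : ∀ {a b} → ¬ (a < b) → (a <ᵇ b) ≡ false
≮⇒<ᵇ-false {a} {b} a≮b with a <ᵇ b in e
... | false = refl
... | true  = ⊥-elim (a≮b (<ᵇ⇒< a b (subst T (sym e) _)))

∸-suc-inverse : ∀ {i x n} → suc i + x ≡ n → n ∸ suc x ≡ i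
∸-suc-inverse {i} {x} refl = m+n∸n≡m i x

<∸⇒+< : ∀ {x a} b → x < a ∸ b → b + x < a
<∸⇒+< {x} {a} b x<a∸b with b ≤? a
... | yes b≤a = subst (λ y → suc y ≤ a) (+-comm x b) (m≤o∸n⇒m+n≤o (suc x) b≤a x<a∸b)
... | no b≰a  = ⊥-elim (n≮0 (subst (x <_) (m≤n⇒m∸n≡0 (<⇒≤ (≰⇒> b≰a))) x<a∸b))

Unique-lookup-injective : ∀ {A : Set} {xs : List A} → Unique xs → ∀ p q → lookup xs p ≡ lookup xs q → p ≡ q
Unique-lookup-injective (_ ∷ _) F.zero F.zero _ = refl
Unique-lookup-injective (x∉ ∷ _) F.zero (F.suc q) eq = ⊥-elim (All.lookup x∉ (∈-lookup q) eq)
Unique-lookup-injective (x∉ ∷ _) (F.suc p) F.zero eq = ⊥-elim (All.lookup x∉ (∈-lookup p) (sym eq))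
Unique-lookup-injective (_ ∷ u) (F.suc p) (F.suc q) eq = cong F.suc (Unique-lookup-injective u p q eq)

module Greedy {n : ℕ} (M : Matrix n) where

  cell : ℕ → ℕ → Bool
  cell = entry M

  cell-inRange : ∀ i j → cell i j ≡ true → i < n × j < n
  cell-inRange i j eq with i <? n | j <? n
  ... | yes i<n | yes j<n = i<n , j<n
  ... | yes _   | no _    = ⊥-elim (true≢false (sym eq))
  ... | no _    | _       = ⊥-elim (true≢false (sym eq))

  cell-fromℕ< : ∀ i j (i<n : i < n) (j<n : j < n) → cell i j ≡ M (fromℕ< i<n) (fromℕ< j<n)
  cell-fromℕ< i j i<n j<n with i <? n | j <? n
  ... | yes _ | yes _   = refl
  ... | yes _ | no j≮n  = ⊥-elim (j≮n j<n)
  ... | no i≮n | _      = ⊥-elim (i≮n i<n)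

  cell-toℕ : ∀ (i j : Fin n) → cell (toℕ i) (toℕ j) ≡ M i j
  cell-toℕ i j = trans (cell-fromℕ< _ _ (toℕ<n i) (toℕ<n j))
                       (cong₂ M (fromℕ<-toℕ i (toℕ<n i)) (fromℕ<-toℕ j (toℕ<n j)))

  -- zeroScan i x is the first column ≥ n ∸ x of row i holding a 0 (n if there is none); it
  -- counts the columns already scanned because the machine scans every row from right to left.
  zeroScan : ℕ → ℕ → ℕ
  zeroScan i zero    = n
  zeroScan i (suc x) = if cell i (n ∸ suc x) then zeroScan i x else n ∸ suc x

  zeroScan-spec : ∀ i x → x ≤ n →
    n ∸ x ≤ zeroScan i x × zeroScan i x ≤ n ×
    (∀ b → n ∸ x ≤ b → b < zeroScan i x → cell i b ≡ true) × (zeroScan i x < n → cell i (zeroScan i x) ≡ false)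
  zeroScan-spec i zero _ =
    ≤-refl , ≤-refl , (λ b n≤b b<n → ⊥-elim (<-irrefl refl (≤-<-trans n≤b b<n))) , (λ n<n → ⊥-elim (<-irrefl refl n<n))
  zeroScan-spec i (suc x) x<n with cell i (n ∸ suc x) in eq
  ... | false = ≤-refl , m∸n≤m n (suc x) , (λ b p q → ⊥-elim (<-irrefl refl (≤-<-trans p q))) , (λ _ → eq)
  ... | true with zeroScan-spec i x (<⇒≤ x<n)
  ... | start≤ , ≤n , ones , zeroAt = ≤-trans (n≤1+n _) (subst (_≤ zeroScan i x) n∸x≡ start≤) , ≤n , ones′ , zeroAt
    where
      n∸x≡ : n ∸ x ≡ suc (n ∸ suc x)
      n∸x≡ = +-∸-assoc 1 x<n
      ones′ : ∀ b → n ∸ suc x ≤ b → b < zeroScan i x → cell i b ≡ true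
      ones′ b p q with m≤n⇒m<n∨m≡n p
      ... | inj₂ refl = eq
      ... | inj₁ r    = ones b (subst (_≤ b) (sym n∸x≡) r) q

  runStart : ℕ → ℕ → Bool
  runStart i zero    = cell i zero
  runStart i (suc j) = cell i (suc j) ∧ not (cell i j)

  runStart⇒one : ∀ i j → runStart i j ≡ true → cell i j ≡ true
  runStart⇒one i zero    eq = eq
  runStart⇒one i (suc j) eq with cell i (suc j)
  ... | true  = refl
  ... | false = eq

  runStart⇒zeroBefore : ∀ i j → runStart i (suc j) ≡ true → cell i j ≡ false
  runStart⇒zeroBefore i j eq with cell i (suc j) | cell i j
  ... | true  | false = refl
  ... | true  | true  = ⊥-elim (true≢false (sym eq))
  ... | false | _     = ⊥-elim (true≢false (sym eq))

  runStart-intro : ∀ i j → cell i (suc j) ≡ true → cell i j ≡ false → runStart i (suc j) ≡ true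
  runStart-intro i j one off rewrite one | off = refl

  runStart-of-zero : ∀ i j → cell i j ≡ false → runStart i j ≡ false
  runStart-of-zero i j off with runStart i j in st
  ... | false = refl
  ... | true  = ⊥-elim (true≢false (trans (sym (runStart⇒one i j st)) off))

  runEnd : ℕ → ℕ → ℕ
  runEnd i j = if runStart i j then zeroScan i (n ∸ j) else 0

  record Run (i l r : ℕ) : Set where
    field
      l<r    : l < r
      r≤n    : r ≤ n
      ones   : ∀ b → l ≤ b → b < r → cell i b ≡ true
      zeroAt : r < n → cell i r ≡ false
  open Run public

  runEnd-run : ∀ i l → runStart i l ≡ true → Run i l (runEnd i l)
  runEnd-run i l st rewrite st with zeroScan-spec i (n ∸ l) (m∸n≤m n l)
  ... | start≤ , ≤n , ones , zeroAt = record { l<r = l<end ; r≤n = ≤n ; ones = ones′ ; zeroAt = zeroAt }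
    where
      l<n : l < n
      l<n = proj₂ (cell-inRange i l (runStart⇒one i l st))
      n∸[n∸l]≡l : n ∸ (n ∸ l) ≡ l
      n∸[n∸l]≡l = m∸[m∸n]≡n (<⇒≤ l<n)
      ones′ : ∀ b → l ≤ b → b < zeroScan i (n ∸ l) → cell i b ≡ true
      ones′ b p = ones b (subst (_≤ b) (sym n∸[n∸l]≡l) p)
      l<end : l < zeroScan i (n ∸ l)
      l<end with m≤n⇒m<n∨m≡n (subst (_≤ zeroScan i (n ∸ l)) n∸[n∸l]≡l start≤)
      ... | inj₁ l<r = l<r
      ... | inj₂ l≡r = ⊥-elim (true≢false (trans (sym (runStart⇒one i l st))
                                                 (trans (cong (cell i) l≡r) (zeroAt (subst (_< n) l≡r l<n)))))

  -- Row r of the table describes row r ∸ 1 of M; rows 0 and n + 1 are sentinel rows of zeros.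
  endTable : ℕ → ℕ → ℕ
  endTable zero    l = 0
  endTable (suc i) l = if i <ᵇ n then runEnd i l else 0

  endTable-row : ∀ i l → i < n → endTable (suc i) l ≡ runEnd i l
  endTable-row i l i<n rewrite <⇒<ᵇ-true i<n = refl

  endTable-lastSentinel : ∀ l → endTable (suc n) l ≡ 0
  endTable-lastSentinel l rewrite ≮⇒<ᵇ-false (<-irrefl {n} refl) = refl

  endTable-nonzero : ∀ i l → endTable (suc i) l ≢ 0 →
                     i < n × runStart i l ≡ true × endTable (suc i) l ≡ runEnd i l
  endTable-nonzero i l nz with i <ᵇ n in i<ᵇn
  ... | false = ⊥-elim (nz refl)
  ... | true with runStart i l in st
  ... | false = ⊥-elim (nz refl)
  ... | true  = <ᵇ⇒< i n (subst T (sym i<ᵇn) _) , refl , refl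

  runStart⇒endTable≢0 : ∀ i l → i < n → runStart i l ≡ true → endTable (suc i) l ≢ 0
  runStart⇒endTable≢0 i l i<n st eq =
    <-irrefl (sym (trans (sym (endTable-row i l i<n)) eq)) (≤-<-trans z≤n (l<r (runEnd-run i l st)))

  endTable-run : ∀ i l → endTable (suc i) l ≢ 0 → Run i l (endTable (suc i) l)
  endTable-run i l nz with endTable-nonzero i l nz
  ... | _ , st , eq = subst (Run i l) (sym eq) (runEnd-run i l st)

  record Block (i l d : ℕ) : Set where
    field
      i<d     : i < d
      d≤n     : d ≤ n
      same    : ∀ a → i ≤ a → a < d → endTable (suc a) l ≡ endTable (suc i) l
      differs : endTable (suc d) l ≢ endTable (suc i) l
  open Block public

  -- bottomScan (suc x) l is the end of the block starting in row n ∸ suc x; like zeroScan it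
  -- counts the rows already scanned, since the machine fills this table from the bottom up.
  bottomScan : ℕ → ℕ → ℕ
  bottomScan zero    l = 0
  bottomScan (suc x) l =
    if endTable (suc (n ∸ suc x)) l ≡ᵇ endTable (suc (suc (n ∸ suc x))) l then bottomScan x l else suc (n ∸ suc x)

  blockEnd : ℕ → ℕ → ℕ
  blockEnd i l = bottomScan (n ∸ i) l

  bottomScan-block : ∀ x i l → suc i + x ≡ n → endTable (suc i) l ≢ 0 → Block i l (bottomScan (suc x) l)
  bottomScan-block x i l i+x≡n nz rewrite ∸-suc-inverse {i} {x} {n} i+x≡n
    with endTable (suc i) l ≡ᵇ endTable (suc (suc i)) l in eq
  ... | false = record { i<d = ≤-refl ; d≤n = ≤-trans (m≤m+n (suc i) x) (≤-reflexive i+x≡n)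
                       ; same = λ a i≤a a<1+i → cong (λ a → endTable (suc a) l) (≤-antisym (s≤s⁻¹ a<1+i) i≤a)
                       ; differs = λ e → ≡ᵇ-false eq (sym e) }
  ... | true with x
  ... | zero = ⊥-elim (nz (trans (≡ᵇ-true eq) (subst (λ d → endTable (suc d) l ≡ 0) (sym 1+i≡n) (endTable-lastSentinel l))))
    where
      1+i≡n : suc i ≡ n
      1+i≡n = trans (sym (+-identityʳ (suc i))) i+x≡n
  ... | suc x′ = record { i<d = <-trans ≤-refl (i<d below) ; d≤n = d≤n below ; same = same′
                        ; differs = λ e → differs below (trans e sameNext) }
    where
      sameNext : endTable (suc i) l ≡ endTable (suc (suc i)) l
      sameNext = ≡ᵇ-true eq
      below : Block (suc i) l (bottomScan (suc x′) l)
      below = bottomScan-block x′ (suc i) l (trans (sym (+-suc (suc i) x′)) i+x≡n) (λ z → nz (trans sameNext z))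
      same′ : ∀ a → i ≤ a → a < bottomScan (suc x′) l → endTable (suc a) l ≡ endTable (suc i) l
      same′ a i≤a a<d with m≤n⇒m<n∨m≡n i≤a
      ... | inj₂ refl = refl
      ... | inj₁ i<a  = trans (same below a i<a a<d) (sym sameNext)

  blockEnd-block : ∀ i l → i < n → endTable (suc i) l ≢ 0 → Block i l (blockEnd i l)
  blockEnd-block i l i<n nz rewrite +-∸-assoc 1 i<n = bottomScan-block (n ∸ suc i) i l (m+[n∸m]≡n i<n) nz

  isBlockTop : ℕ → ℕ → Bool
  isBlockTop i l = not (endTable (suc i) l ≡ᵇ 0) ∧ not (endTable i l ≡ᵇ endTable (suc i) l)

  record BlockTop (i l : ℕ) : Set where
    field
      nonzero : endTable (suc i) l ≢ 0
      fresh   : endTable i l ≢ endTable (suc i) l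
  open BlockTop public

  endTable≡0⇒¬isBlockTop : ∀ i l → endTable (suc i) l ≡ 0 → isBlockTop i l ≡ false
  endTable≡0⇒¬isBlockTop i l z = cong (λ r → not (r ≡ᵇ 0) ∧ not (endTable i l ≡ᵇ r)) z

  sameAbove⇒¬isBlockTop : ∀ i l → endTable i l ≡ endTable (suc i) l → isBlockTop i l ≡ false
  sameAbove⇒¬isBlockTop i l eq =
    trans (cong (λ b → not (endTable (suc i) l ≡ᵇ 0) ∧ not b) (≡⇒≡ᵇ-true eq)) (∧-zeroʳ _)

  isBlockTop⇒BlockTop : ∀ i l → isBlockTop i l ≡ true → BlockTop i l
  isBlockTop⇒BlockTop i l eq with endTable (suc i) l ≡ᵇ 0 in e₁ | endTable i l ≡ᵇ endTable (suc i) l in e₂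
  ... | false | false = record { nonzero = ≡ᵇ-false e₁ ; fresh = ≡ᵇ-false e₂ }
  ... | true  | _     = ⊥-elim (true≢false (sym eq))
  ... | false | true  = ⊥-elim (true≢false (sym eq))

  BlockTop⇒isBlockTop : ∀ i l → BlockTop i l → isBlockTop i l ≡ true
  BlockTop⇒isBlockTop i l op rewrite ≢⇒≡ᵇ-false (nonzero op) | ≢⇒≡ᵇ-false (fresh op) = refl

  BlockTop⇒row<n : ∀ {i l} → BlockTop i l → i < n
  BlockTop⇒row<n {i} {l} op = proj₁ (endTable-nonzero i l (nonzero op))

  BlockTop⇒runStart : ∀ {i l} → BlockTop i l → runStart i l ≡ true
  BlockTop⇒runStart {i} {l} op = proj₁ (proj₂ (endTable-nonzero i l (nonzero op)))

  BlockTop⇒run : ∀ {i l} → BlockTop i l → Run i l (endTable (suc i) l)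
  BlockTop⇒run {i} {l} op = endTable-run i l (nonzero op)

  BlockTop⇒block : ∀ {i l} → BlockTop i l → Block i l (blockEnd i l)
  BlockTop⇒block {i} {l} op = blockEnd-block i l (BlockTop⇒row<n op) (nonzero op)

  blockRect : ℕ → ℕ → Rect
  blockRect i l = rect i (blockEnd i l) l (endTable (suc i) l)

  blockRow : ∀ i l a → BlockTop i l → i ≤ a → a < blockEnd i l →
             runStart a l ≡ true × runEnd a l ≡ endTable (suc i) l
  blockRow i l a op i≤a a<d = proj₁ (proj₂ rowFacts) , trans (sym (proj₂ (proj₂ rowFacts))) sameRun
    where
      sameRun : endTable (suc a) l ≡ endTable (suc i) l
      sameRun = same (BlockTop⇒block op) a i≤a a<d
      rowFacts : a < n × runStart a l ≡ true × endTable (suc a) l ≡ runEnd a l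
      rowFacts = endTable-nonzero a l (λ z → nonzero op (trans (sym sameRun) z))

  blockRect-ones : ∀ i l → BlockTop i l → ∀ a b → (a , b) ∈R blockRect i l → cell a b ≡ true
  blockRect-ones i l op a b ((i≤a , a<d) , (l≤b , b<r)) with blockRow i l a op i≤a a<d
  ... | st , eq = ones (runEnd-run a l st) b l≤b (subst (b <_) (sym eq) b<r)

  blockRect-is1Rect : ∀ i l → BlockTop i l → Is1Rect M (blockRect i l)
  blockRect-is1Rect i l op =
    (i<d bl , d≤n bl) , (l<r rn , r≤n rn) ,
    λ a b a,b∈ → trans (sym (cell-toℕ a b)) (blockRect-ones i l op (toℕ a) (toℕ b) a,b∈)
    where
      bl : Block i l (blockEnd i l)
      bl = BlockTop⇒block op
      rn : Run i l (endTable (suc i) l)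
      rn = BlockTop⇒run op

  run-noStartInside : ∀ {a l r l′} → Run a l r → runStart a l′ ≡ true → l < l′ → l′ < r → ⊥
  run-noStartInside {a} {l′ = suc j} rn st (s≤s l≤j) 1+j<r =
    true≢false (trans (sym (ones rn j l≤j (<-trans (n<1+n j) 1+j<r))) (runStart⇒zeroBefore a j st))

  runStart-unique : ∀ {a l l′ r r′ b} → runStart a l ≡ true → runStart a l′ ≡ true → Run a l r → Run a l′ r′ →
                    l ≤ b → b < r → l′ ≤ b → b < r′ → l ≡ l′
  runStart-unique {l = l} {l′} st st′ rn rn′ l≤b b<r l′≤b b<r′ with <-cmp l l′
  ... | tri≈ _ eq _   = eq
  ... | tri< l<l′ _ _ = ⊥-elim (run-noStartInside rn st′ l<l′ (≤-<-trans l′≤b b<r))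
  ... | tri> _ _ l′<l = ⊥-elim (run-noStartInside rn′ st l′<l (≤-<-trans l≤b b<r′))

  blockTop-notInside : ∀ i i′ l a → BlockTop i l → BlockTop i′ l → i′ ≤ a → a < blockEnd i l → ¬ (i < i′)
  blockTop-notInside i (suc k) l a op op′ i′≤a a<d (s≤s i≤k) =
    fresh op′ (trans (same bl k i≤k (≤-<-trans (n≤1+n k) k+1<d)) (sym (same bl (suc k) (m≤n⇒m≤1+n i≤k) k+1<d)))
    where
      bl : Block i l (blockEnd i l)
      bl = BlockTop⇒block op
      k+1<d : suc k < blockEnd i l
      k+1<d = ≤-<-trans i′≤a a<d

  blockRect-overlap : ∀ i l i′ l′ → BlockTop i l → BlockTop i′ l′ → ∀ a b →
                      (a , b) ∈R blockRect i l → (a , b) ∈R blockRect i′ l′ → i ≡ i′ × l ≡ l′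
  blockRect-overlap i l i′ l′ op op′ a b ((i≤a , a<d) , (l≤b , b<r)) ((i′≤a , a<d′) , (l′≤b , b<r′))
    with blockRow i l a op i≤a a<d | blockRow i′ l′ a op′ i′≤a a<d′
  ... | st , eq | st′ , eq′
    with runStart-unique st st′ (runEnd-run a l st) (runEnd-run a l′ st′)
                         l≤b (subst (b <_) (sym eq) b<r) l′≤b (subst (b <_) (sym eq′) b<r′)
  ... | refl with <-cmp i i′
  ...   | tri≈ _ i≡i′ _ = i≡i′ , refl
  ...   | tri< i<i′ _ _ = ⊥-elim (blockTop-notInside i i′ l a op op′ i′≤a a<d i<i′)
  ...   | tri> _ _ i′<i = ⊥-elim (blockTop-notInside i′ i l a op′ op i≤a a<d′ i′<i)

  runStart-leftOf : ∀ a b → cell a b ≡ true →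
                    Σ ℕ λ l → l ≤ b × runStart a l ≡ true × (∀ c → l ≤ c → c ≤ b → cell a c ≡ true)
  runStart-leftOf a zero one = 0 , z≤n , one , λ c _ c≤0 → subst (λ c → cell a c ≡ true) (sym (n≤0⇒n≡0 c≤0)) one
  runStart-leftOf a (suc b) one with cell a b in before
  ... | false = suc b , ≤-refl , runStart-intro a b one before ,
                λ c p q → subst (λ c → cell a c ≡ true) (≤-antisym p q) one
  ... | true with runStart-leftOf a b before
  ... | l , l≤b , st , filled = l , m≤n⇒m≤1+n l≤b , st , filled′
    where
      filled′ : ∀ c → l ≤ c → c ≤ suc b → cell a c ≡ true
      filled′ c p q with m≤n⇒m<n∨m≡n q
      ... | inj₁ c<1+b = filled c p (s≤s⁻¹ c<1+b)
      ... | inj₂ refl = one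

  blockTop-above : ∀ l a → endTable (suc a) l ≢ 0 →
                   Σ ℕ λ i → i ≤ a × BlockTop i l × (∀ a′ → i ≤ a′ → a′ ≤ a → endTable (suc a′) l ≡ endTable (suc a) l)
  blockTop-above l a nz with endTable a l ≟ endTable (suc a) l
  ... | no fresh = a , ≤-refl , record { nonzero = nz ; fresh = fresh } ,
                   λ a′ p q → cong (λ a → endTable (suc a) l) (≤-antisym q p)
  blockTop-above l zero nz | yes eq = ⊥-elim (nz (sym eq))
  blockTop-above l (suc a) nz | yes eq with blockTop-above l a (λ z → nz (trans (sym eq) z))
  ... | i , i≤a , op , same′ = i , m≤n⇒m≤1+n i≤a , op , same″
    where
      same″ : ∀ a′ → i ≤ a′ → a′ ≤ suc a → endTable (suc a′) l ≡ endTable (suc (suc a)) l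
      same″ a′ p q with m≤n⇒m<n∨m≡n q
      ... | inj₁ a′<1+a = trans (same′ a′ p (s≤s⁻¹ a′<1+a)) eq
      ... | inj₂ refl   = refl

  blockRect-covers : ∀ a b → cell a b ≡ true → Σ ℕ λ i → Σ ℕ λ l → BlockTop i l × (a , b) ∈R blockRect i l
  blockRect-covers a b one with runStart-leftOf a b one | cell-inRange a b one
  ... | l , l≤b , st , filled | a<n , b<n with blockTop-above l a (runStart⇒endTable≢0 a l a<n st)
  ... | i , i≤a , op , sameRun = i , l , op , (i≤a , a<d) , (l≤b , b<r)
    where
      rn : Run a l (runEnd a l)
      rn = runEnd-run a l st
      b<end : b < runEnd a l
      b<end with <-cmp b (runEnd a l)
      ... | tri< b<e _ _ = b<e
      ... | tri≈ _ b≡e _ = ⊥-elim (true≢false (trans (sym (filled (runEnd a l) (<⇒≤ (l<r rn)) (≤-reflexive (sym b≡e))))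
                                                     (zeroAt rn (subst (_< n) b≡e b<n))))
      ... | tri> _ _ e<b = ⊥-elim (true≢false (trans (sym (filled (runEnd a l) (<⇒≤ (l<r rn)) (<⇒≤ e<b)))
                                                     (zeroAt rn (<-trans e<b b<n))))
      sameAsTop : endTable (suc i) l ≡ endTable (suc a) l
      sameAsTop = sameRun i ≤-refl i≤a
      b<r : b < endTable (suc i) l
      b<r = subst (b <_) (sym (trans sameAsTop (endTable-row a l a<n))) b<end
      bl : Block i l (blockEnd i l)
      bl = BlockTop⇒block op
      a<d : a < blockEnd i l
      a<d with <-cmp a (blockEnd i l)
      ... | tri< a<d _ _ = a<d
      ... | tri≈ _ a≡d _ = ⊥-elim (differs bl (trans (cong (λ d → endTable (suc d) l) (sym a≡d)) (sym sameAsTop)))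
      ... | tri> _ _ d<a = ⊥-elim (differs bl (trans (sameRun (blockEnd i l) (<⇒≤ (i<d bl)) (<⇒≤ d<a)) (sym sameAsTop)))

  -- Rows are processed bottom-up: greedyRows x holds the rectangles whose top is one of the last
  -- x rows, in the order in which the machine writes them.
  emitted : ℕ → ℕ → List Rect
  emitted x l = if isBlockTop (n ∸ suc x) l then blockRect (n ∸ suc x) l ∷ [] else []

  rowRects : ℕ → ℕ → List Rect
  rowRects x zero    = []
  rowRects x (suc l) = rowRects x l ++ emitted x l

  greedyRows : ℕ → List Rect
  greedyRows zero    = []
  greedyRows (suc x) = greedyRows x ++ rowRects x n

  greedy : List Rect
  greedy = greedyRows n

  ∈-emitted⁻ : ∀ x l {Q} → Q ∈ emitted x l → isBlockTop (n ∸ suc x) l ≡ true × Q ≡ blockRect (n ∸ suc x) l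
  ∈-emitted⁻ x l Q∈ with isBlockTop (n ∸ suc x) l
  ∈-emitted⁻ x l (here refl) | true = refl , refl

  ∈-rowRects⁻ : ∀ x l {Q} → Q ∈ rowRects x l →
                Σ ℕ λ l′ → l′ < l × isBlockTop (n ∸ suc x) l′ ≡ true × Q ≡ blockRect (n ∸ suc x) l′
  ∈-rowRects⁻ x (suc l) Q∈ with ∈-++⁻ (rowRects x l) Q∈
  ... | inj₁ Q∈′ with ∈-rowRects⁻ x l Q∈′
  ...   | l′ , l′<l , op , eq = l′ , m≤n⇒m≤1+n l′<l , op , eq
  ∈-rowRects⁻ x (suc l) Q∈ | inj₂ Q∈′ with ∈-emitted⁻ x l Q∈′
  ...   | op , eq = l , ≤-refl , op , eq

  ∈-greedyRows⁻ : ∀ x {Q} → Q ∈ greedyRows x →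
                  Σ ℕ λ x′ → Σ ℕ λ l → x′ < x × isBlockTop (n ∸ suc x′) l ≡ true × Q ≡ blockRect (n ∸ suc x′) l
  ∈-greedyRows⁻ (suc x) Q∈ with ∈-++⁻ (greedyRows x) Q∈
  ... | inj₁ Q∈′ with ∈-greedyRows⁻ x Q∈′
  ...   | x′ , l , x′<x , op , eq = x′ , l , m≤n⇒m≤1+n x′<x , op , eq
  ∈-greedyRows⁻ (suc x) Q∈ | inj₂ Q∈′ with ∈-rowRects⁻ x n Q∈′
  ...   | l , _ , op , eq = x , l , ≤-refl , op , eq

  ∈-emitted⁺ : ∀ x l → isBlockTop (n ∸ suc x) l ≡ true → blockRect (n ∸ suc x) l ∈ emitted x l
  ∈-emitted⁺ x l op rewrite op = here refl

  ∈-rowRects⁺ : ∀ x l l′ → l′ < l → isBlockTop (n ∸ suc x) l′ ≡ true → blockRect (n ∸ suc x) l′ ∈ rowRects x l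
  ∈-rowRects⁺ x (suc l) l′ l′<1+l op with m≤n⇒m<n∨m≡n (s≤s⁻¹ l′<1+l)
  ... | inj₁ l′<l = ∈-++⁺ˡ (∈-rowRects⁺ x l l′ l′<l op)
  ... | inj₂ refl = ∈-++⁺ʳ (rowRects x l) (∈-emitted⁺ x l op)

  ∈-greedyRows⁺ : ∀ x x′ l → x′ < x → l < n → isBlockTop (n ∸ suc x′) l ≡ true → blockRect (n ∸ suc x′) l ∈ greedyRows x
  ∈-greedyRows⁺ (suc x) x′ l x′<1+x l<n op with m≤n⇒m<n∨m≡n (s≤s⁻¹ x′<1+x)
  ... | inj₁ x′<x = ∈-++⁺ˡ (∈-greedyRows⁺ x x′ l x′<x l<n op)
  ... | inj₂ refl = ∈-++⁺ʳ (greedyRows x) (∈-rowRects⁺ x′ n l l<n op)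

  emitted-unique : ∀ x l → Unique (emitted x l)
  emitted-unique x l with isBlockTop (n ∸ suc x) l
  ... | true  = [] ∷ []
  ... | false = []

  rowRects-unique : ∀ x l → Unique (rowRects x l)
  rowRects-unique x zero    = []
  rowRects-unique x (suc l) = Unique.++⁺ (rowRects-unique x l) (emitted-unique x l) disjoint
    where
      disjoint : ∀ {Q} → ¬ (Q ∈ rowRects x l × Q ∈ emitted x l)
      disjoint (Q∈ , Q∈′) with ∈-rowRects⁻ x l Q∈ | ∈-emitted⁻ x l Q∈′
      ... | _ , l′<l , _ , refl | _ , eq = <-irrefl (cong left eq) l′<l

  greedyRows-unique : ∀ x → x ≤ n → Unique (greedyRows x)
  greedyRows-unique zero    _     = []
  greedyRows-unique (suc x) x<n = Unique.++⁺ (greedyRows-unique x (<⇒≤ x<n)) (rowRects-unique x n) disjoint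
    where
      disjoint : ∀ {Q} → ¬ (Q ∈ greedyRows x × Q ∈ rowRects x n)
      disjoint (Q∈ , Q∈′) with ∈-greedyRows⁻ x Q∈ | ∈-rowRects⁻ x n Q∈′
      ... | _ , _ , x′<x , _ , refl | _ , _ , _ , eq = <-irrefl (sym (cong top eq)) (∸-monoʳ-< (s≤s x′<x) x<n)

  greedy-unique : Unique greedy
  greedy-unique = greedyRows-unique n ≤-refl

  ∈-greedy⁻ : ∀ {Q} → Q ∈ greedy → Σ ℕ λ i → Σ ℕ λ l → BlockTop i l × Q ≡ blockRect i l
  ∈-greedy⁻ Q∈ with ∈-greedyRows⁻ n Q∈
  ... | _ , l , _ , op , eq = _ , l , isBlockTop⇒BlockTop _ l op , eq

  ∈-greedy⁺ : ∀ i l → BlockTop i l → blockRect i l ∈ greedy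
  ∈-greedy⁺ i l op = subst (λ i → blockRect i l ∈ greedy) (∸-suc-inverse (m+[n∸m]≡n i<n))
                       (∈-greedyRows⁺ n (n ∸ suc i) l (∸-monoʳ-< z<s i<n) l<n (BlockTop⇒isBlockTop _ l op′))
    where
      i<n : i < n
      i<n = BlockTop⇒row<n op
      l<n = proj₂ (cell-inRange i l (runStart⇒one i l (BlockTop⇒runStart op)))
      op′ : BlockTop (n ∸ suc (n ∸ suc i)) l
      op′ = subst (λ i → BlockTop i l) (sym (∸-suc-inverse (m+[n∸m]≡n i<n))) op

  greedy-isDecomposition : IsDecomposition M greedy
  greedy-isDecomposition = is1Rect , disjoint , covers
    where
      is1Rect : ∀ p → Is1Rect M (lookup greedy p)
      is1Rect p with ∈-greedy⁻ (∈-lookup p)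
      ... | i , l , op , eq = subst (Is1Rect M) (sym eq) (blockRect-is1Rect i l op)
      disjoint : ∀ p q → p ≢ q → ∀ a b → ¬ ((a , b) ∈R lookup greedy p × (a , b) ∈R lookup greedy q)
      disjoint p q p≢q a b (∈p , ∈q) with ∈-greedy⁻ (∈-lookup p) | ∈-greedy⁻ (∈-lookup q)
      ... | i , l , op , eq | i′ , l′ , op′ , eq′
        with blockRect-overlap i l i′ l′ op op′ a b (subst ((a , b) ∈R_) eq ∈p) (subst ((a , b) ∈R_) eq′ ∈q)
      ... | refl , refl = p≢q (Unique-lookup-injective greedy-unique p q (trans eq (sym eq′)))
      covers : ∀ (i j : Fin n) → (M i j ≡ true) ⇔ (∃[ p ] ((toℕ i , toℕ j) ∈R lookup greedy p))
      covers i j = mk⇔ to from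
        where
          to : M i j ≡ true → ∃[ p ] ((toℕ i , toℕ j) ∈R lookup greedy p)
          to one with blockRect-covers (toℕ i) (toℕ j) (trans (cell-toℕ i j) one)
          ... | i′ , l , op , ∈rect = index ∈greedy , subst ((toℕ i , toℕ j) ∈R_) (lookup-index ∈greedy) ∈rect
            where
              ∈greedy : blockRect i′ l ∈ greedy
              ∈greedy = ∈-greedy⁺ i′ l op
          from : ∃[ p ] ((toℕ i , toℕ j) ∈R lookup greedy p) → M i j ≡ true
          from (p , ∈p) with ∈-greedy⁻ (∈-lookup p)
          ... | i′ , l , op , eq = trans (sym (cell-toℕ i j)) (blockRect-ones i′ l op _ _ (subst ((toℕ i , toℕ j) ∈R_) eq ∈p))

corner : Rect → Fin 4 → ℕ × ℕ
corner r F.zero                         = top r , left r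
corner r (F.suc F.zero)                 = top r , right r
corner r (F.suc (F.suc F.zero))         = bot r , left r
corner r (F.suc (F.suc (F.suc F.zero))) = bot r , right r

-- Grid points are indexed like cells: the point (i , p) is the top-left vertex of cell (i , p).
module LowerBound {n : ℕ} (M : Matrix n) (R : List Rect) (decomp : IsDecomposition M R) where
  open Greedy M

  IsCorner : ℕ → ℕ → Set
  IsCorner i p = Σ (Fin (length R)) λ ρ → Σ (Fin 4) λ τ → corner (lookup R ρ) τ ≡ (i , p)

  R-ones : ∀ ρ a b → (a , b) ∈R lookup R ρ → cell a b ≡ true
  R-ones ρ a b a,b∈ = trans (cell-fromℕ< a b a<n b<n) (proj₂ (proj₂ (proj₁ decomp ρ)) (fromℕ< a<n) (fromℕ< b<n) a,b∈′)
    where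
      a<n : a < n
      a<n = <-≤-trans (proj₂ (proj₁ a,b∈)) (proj₂ (proj₁ (proj₁ decomp ρ)))
      b<n : b < n
      b<n = <-≤-trans (proj₂ (proj₂ a,b∈)) (proj₂ (proj₁ (proj₂ (proj₁ decomp ρ))))
      a,b∈′ : (toℕ (fromℕ< a<n) , toℕ (fromℕ< b<n)) ∈R lookup R ρ
      a,b∈′ = subst₂ (λ x y → (x , y) ∈R lookup R ρ) (sym (toℕ-fromℕ< a<n)) (sym (toℕ-fromℕ< b<n)) a,b∈

  R-avoidsZero : ∀ ρ {a b} → (a , b) ∈R lookup R ρ → cell a b ≡ false → ⊥
  R-avoidsZero ρ {a} {b} a,b∈ off = true≢false (trans (sym (R-ones ρ a b a,b∈)) off)

  R-covers : ∀ a b → cell a b ≡ true → Σ (Fin (length R)) λ ρ → (a , b) ∈R lookup R ρ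
  R-covers a b one with cell-inRange a b one
  ... | a<n , b<n with Equivalence.to (proj₂ (proj₂ decomp) (fromℕ< a<n) (fromℕ< b<n)) (trans (sym (cell-fromℕ< a b a<n b<n)) one)
  ... | ρ , a,b∈ = ρ , subst₂ (λ x y → (x , y) ∈R lookup R ρ) (toℕ-fromℕ< a<n) (toℕ-fromℕ< b<n) a,b∈

  R-unique : ∀ ρ σ {a b} → (a , b) ∈R lookup R ρ → (a , b) ∈R lookup R σ → ρ ≡ σ
  R-unique ρ σ {a} {b} ∈ρ ∈σ with ρ F.≟ σ
  ... | yes ρ≡σ = ρ≡σ
  ... | no ρ≢σ  = ⊥-elim (proj₁ (proj₂ decomp) ρ σ ρ≢σ a b (∈ρ , ∈σ))

  top≡ : ∀ ρ {a b} → (suc a , b) ∈R lookup R ρ → cell a b ≡ false → top (lookup R ρ) ≡ suc a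
  top≡ ρ ((t≤1+a , 1+a<d) , b∈) off =
    ≤∧≮⇒≡ t≤1+a (λ t<1+a → R-avoidsZero ρ ((s≤s⁻¹ t<1+a , <-trans (n<1+n _) 1+a<d) , b∈) off)

  bot≡ : ∀ ρ {a b} → (a , b) ∈R lookup R ρ → cell (suc a) b ≡ false → bot (lookup R ρ) ≡ suc a
  bot≡ ρ ((t≤a , a<d) , b∈) off =
    sym (≤∧≮⇒≡ a<d (λ 1+a<d → R-avoidsZero ρ ((m≤n⇒m≤1+n t≤a , 1+a<d) , b∈) off))

  left≡ : ∀ ρ {a b} → (a , suc b) ∈R lookup R ρ → cell a b ≡ false → left (lookup R ρ) ≡ suc b
  left≡ ρ (a∈ , (l≤1+b , 1+b<r)) off =
    ≤∧≮⇒≡ l≤1+b (λ l<1+b → R-avoidsZero ρ (a∈ , (s≤s⁻¹ l<1+b , <-trans (n<1+n _) 1+b<r)) off)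

  right≡ : ∀ ρ {a b} → (a , b) ∈R lookup R ρ → cell a (suc b) ≡ false → right (lookup R ρ) ≡ suc b
  right≡ ρ (a∈ , (l≤b , b<r)) off =
    sym (≤∧≮⇒≡ b<r (λ 1+b<r → R-avoidsZero ρ (a∈ , (m≤n⇒m≤1+n l≤b , 1+b<r)) off))

  topEnd≡ : ∀ ρ {a b} → (a , b) ∈R lookup R ρ → (∀ a′ → a ≡ suc a′ → cell a′ b ≡ false) → top (lookup R ρ) ≡ a
  topEnd≡ ρ {zero}  ((t≤0 , _) , _) _ = n≤0⇒n≡0 t≤0
  topEnd≡ ρ {suc a} ∈ρ off = top≡ ρ ∈ρ (off a refl)

  leftEnd≡ : ∀ ρ {a b} → (a , b) ∈R lookup R ρ → runStart a b ≡ true → left (lookup R ρ) ≡ b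
  leftEnd≡ ρ {b = zero}      (_ , (l≤0 , _)) _ = n≤0⇒n≡0 l≤0
  leftEnd≡ ρ {a} {b = suc b} ∈ρ st = left≡ ρ ∈ρ (runStart⇒zeroBefore a b st)

  corner-convex : ∀ i p → runStart i p ≡ true → (∀ i′ → i ≡ suc i′ → cell i′ p ≡ false) → IsCorner i p
  corner-convex i p st northZero with R-covers i p (runStart⇒one i p st)
  ... | ρ , ∈ρ = ρ , F.zero , cong₂ _,_ (topEnd≡ ρ ∈ρ northZero) (leftEnd≡ ρ ∈ρ st)

  corner-notchSW : ∀ i p → cell i p ≡ true → cell i (suc p) ≡ true → cell (suc i) p ≡ false →
                   cell (suc i) (suc p) ≡ true → IsCorner (suc i) (suc p)
  corner-notchSW i p nw ne sw se with R-covers (suc i) (suc p) se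
  ... | ρ , ∈ρ@((t≤1+i , 1+i<d) , 1+p∈) with m≤n⇒m<n∨m≡n t≤1+i
  ...   | inj₂ t≡1+i = ρ , F.zero , cong₂ _,_ t≡1+i (left≡ ρ ∈ρ sw)
  ...   | inj₁ t<1+i with R-covers i p nw
  ...     | σ , ∈σ@(i∈σ , (l≤p , p<r)) = σ , F.suc (F.suc (F.suc F.zero)) , cong₂ _,_ (bot≡ σ ∈σ sw) right≡1+p
    where
      right≡1+p : right (lookup R σ) ≡ suc p
      right≡1+p = sym (≤∧≮⇒≡ p<r λ 1+p<r →
        case R-unique ρ σ ((s≤s⁻¹ t<1+i , <-trans (n<1+n i) 1+i<d) , 1+p∈) (i∈σ , (m≤n⇒m≤1+n l≤p , 1+p<r)) of λ
          { refl → <-irrefl (left≡ ρ ∈ρ sw) (s≤s l≤p) })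

  corner-notchNE : ∀ i p → cell i p ≡ true → cell i (suc p) ≡ false → cell (suc i) p ≡ true →
                   cell (suc i) (suc p) ≡ true → IsCorner (suc i) (suc p)
  corner-notchNE i p nw ne sw se with R-covers (suc i) (suc p) se
  ... | ρ , ∈ρ@(1+i∈ , (l≤1+p , 1+p<r)) with m≤n⇒m<n∨m≡n l≤1+p
  ...   | inj₂ l≡1+p = ρ , F.zero , cong₂ _,_ (top≡ ρ ∈ρ ne) l≡1+p
  ...   | inj₁ l<1+p with R-covers i p nw
  ...     | σ , ∈σ@((t≤i , i<d) , p∈σ) = σ , F.suc (F.suc (F.suc F.zero)) , cong₂ _,_ bot≡1+i (right≡ σ ∈σ ne)
    where
      bot≡1+i : bot (lookup R σ) ≡ suc i
      bot≡1+i = sym (≤∧≮⇒≡ i<d λ 1+i<d →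
        case R-unique ρ σ (1+i∈ , (s≤s⁻¹ l<1+p , <-trans (n<1+n p) 1+p<r)) ((m≤n⇒m≤1+n t≤i , 1+i<d) , p∈σ) of λ
          { refl → <-irrefl (top≡ ρ ∈ρ ne) (s≤s t≤i) })

  corner-notchSE : ∀ i p → cell i p ≡ true → cell i (suc p) ≡ true → cell (suc i) p ≡ true →
                   cell (suc i) (suc p) ≡ false → IsCorner (suc i) (suc p)
  corner-notchSE i p nw ne sw se with R-covers (suc i) p sw
  ... | ρ , ∈ρ@((t≤1+i , 1+i<d) , p∈) with m≤n⇒m<n∨m≡n t≤1+i
  ...   | inj₂ t≡1+i = ρ , F.suc F.zero , cong₂ _,_ t≡1+i (right≡ ρ ∈ρ se)
  ...   | inj₁ t<1+i with R-covers i (suc p) ne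
  ...     | σ , ∈σ@(i∈σ , (l≤1+p , 1+p<r)) = σ , F.suc (F.suc F.zero) , cong₂ _,_ (bot≡ σ ∈σ se) left≡1+p
    where
      left≡1+p : left (lookup R σ) ≡ suc p
      left≡1+p = ≤∧≮⇒≡ l≤1+p λ l<1+p →
        case R-unique ρ σ ((s≤s⁻¹ t<1+i , <-trans (n<1+n i) 1+i<d) , p∈) (i∈σ , (s≤s⁻¹ l<1+p , <-trans (n<1+n p) 1+p<r)) of λ
          { refl → <-irrefl (sym (right≡ ρ ∈ρ se)) 1+p<r }

  record InClosedRun (i l r c : ℕ) : Set where
    field
      l≤c     : l ≤ c
      c≤r     : c ≤ r
      one⇒c<r : cell i c ≡ true → c < r
  open InClosedRun

  closedRuns-disjoint : ∀ {i l l′ r r′ c} → runStart i l ≡ true → runStart i l′ ≡ true → Run i l r → Run i l′ r′ →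
                        InClosedRun i l r c → InClosedRun i l′ r′ c → l ≡ l′
  closedRuns-disjoint {i} {c = c} st st′ rn rn′ in₁ in₂ with cell i c in cellOn
  ... | true  = runStart-unique st st′ rn rn′ (l≤c in₁) (one⇒c<r in₁ cellOn) (l≤c in₂) (one⇒c<r in₂ cellOn)
  ... | false = runStart-unique st st′ rn rn′ (<⇒≤pred (afterStart rn in₁)) (pred<≤ (afterStart rn in₁) (c≤r in₁))
                                             (<⇒≤pred (afterStart rn′ in₂)) (pred<≤ (afterStart rn′ in₂) (c≤r in₂))
    where
      afterStart : ∀ {l r} → Run i l r → InClosedRun i l r c → l < c
      afterStart rn inRun with m≤n⇒m<n∨m≡n (c≤r inRun)
      ... | inj₂ refl = l<r rn
      ... | inj₁ c<r  = ⊥-elim (true≢false (trans (sym (ones rn c (l≤c inRun) c<r)) cellOn))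
      pred<≤ : ∀ {l c r} → l < c → c ≤ r → pred c < r
      pred<≤ (s≤s _) c≤r = c≤r

  Charge : ℕ → ℕ → ℕ → Set
  Charge i l r = Σ ℕ λ c → InClosedRun i l r c × IsCorner i c

  charge-determinesStart : ∀ {i i′ l l′} → BlockTop i l → BlockTop i′ l′ →
                           (c : Charge i l (endTable (suc i) l)) (c′ : Charge i′ l′ (endTable (suc i′) l′)) →
                           (i , proj₁ c) ≡ (i′ , proj₁ c′) → l ≡ l′
  charge-determinesStart op op′ (_ , inRun , _) (_ , inRun′ , _) refl =
    closedRuns-disjoint (BlockTop⇒runStart op) (BlockTop⇒runStart op′) (BlockTop⇒run op) (BlockTop⇒run op′) inRun inRun′

  charge-atStart : ∀ {i l r} → Run i l r → IsCorner i l → Charge i l r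
  charge-atStart {l = l} rn c = l , record { l≤c = ≤-refl ; c≤r = <⇒≤ (l<r rn) ; one⇒c<r = λ _ → l<r rn } , c

  charge-shorterAbove : ∀ {i l r′ r} → Run i l r′ → Run (suc i) l r → r′ < r → Charge (suc i) l r
  charge-shorterAbove {r′ = zero} above _ _ = ⊥-elim (n≮0 (l<r above))
  charge-shorterAbove {i} {l} {suc p} above cur p+1<r =
    suc p , record { l≤c = <⇒≤ (l<r above) ; c≤r = <⇒≤ p+1<r ; one⇒c<r = λ _ → p+1<r } ,
    corner-notchNE i p (ones above p l≤p ≤-refl) (zeroAt above (<-≤-trans p+1<r (r≤n cur)))
                       (ones cur p l≤p (<-trans (n<1+n p) p+1<r)) (ones cur (suc p) (<⇒≤ (l<r above)) p+1<r)
    where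
      l≤p : l ≤ p
      l≤p = s≤s⁻¹ (l<r above)

  charge-longerAbove : ∀ {i l r′ r} → Run i l r′ → Run (suc i) l r → r < r′ → Charge (suc i) l r
  charge-longerAbove {r = zero} _ cur _ = ⊥-elim (n≮0 (l<r cur))
  charge-longerAbove {i} {l} {r = suc p} above cur p+1<r′ =
    suc p , record { l≤c = <⇒≤ (l<r cur) ; c≤r = ≤-refl ; one⇒c<r = λ one → ⊥-elim (true≢false (trans (sym one) endZero)) } ,
    corner-notchSE i p (ones above p l≤p (<-trans (n<1+n p) p+1<r′)) (ones above (suc p) (<⇒≤ (l<r cur)) p+1<r′)
                       (ones cur p l≤p ≤-refl) endZero
    where
      l≤p : l ≤ p
      l≤p = s≤s⁻¹ (l<r cur)
      endZero : cell (suc i) (suc p) ≡ false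
      endZero = zeroAt cur (<-≤-trans p+1<r′ (r≤n above))
  charge-stacked : ∀ i l → BlockTop (suc i) l → runStart i l ≡ true → Charge (suc i) l (endTable (suc (suc i)) l)
  charge-stacked i l op st with <-cmp (runEnd i l) (endTable (suc (suc i)) l)
  ... | tri≈ _ eq _   = ⊥-elim (fresh op (trans (endTable-row i l (proj₁ (cell-inRange i l (runStart⇒one i l st)))) eq))
  ... | tri< r′<r _ _ = charge-shorterAbove (runEnd-run i l st) (BlockTop⇒run op) r′<r
  ... | tri> _ _ r<r′ = charge-longerAbove (runEnd-run i l st) (BlockTop⇒run op) r<r′

  charge : ∀ i l → BlockTop i l → Charge i l (endTable (suc i) l)
  charge zero l op = charge-atStart (BlockTop⇒run op) (corner-convex zero l (BlockTop⇒runStart op) (λ _ ()))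
  charge (suc i) l op with cell i l in above
  ... | false = charge-atStart (BlockTop⇒run op) (corner-convex (suc i) l (BlockTop⇒runStart op) (λ { _ refl → above }))
  charge (suc i) zero    op | true = charge-stacked i zero op above
  charge (suc i) (suc l) op | true with cell i l in aboveLeft
  ... | true  = charge-atStart (BlockTop⇒run op) (corner-notchSW i l aboveLeft above (runStart⇒zeroBefore (suc i) l st)
                                                                             (runStart⇒one (suc i) (suc l) st))
    where
      st : runStart (suc i) (suc l) ≡ true
      st = BlockTop⇒runStart op
  ... | false = charge-stacked i (suc l) op (runStart-intro i l above aboveLeft)

  module Charged (q : Fin (length greedy)) where
    topRow : ℕ
    topRow = proj₁ (∈-greedy⁻ (∈-lookup q))

    leftCol : ℕ
    leftCol = proj₁ (proj₂ (∈-greedy⁻ (∈-lookup q)))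

    isTop : BlockTop topRow leftCol
    isTop = proj₁ (proj₂ (proj₂ (∈-greedy⁻ (∈-lookup q))))

    isBlock : lookup greedy q ≡ blockRect topRow leftCol
    isBlock = proj₂ (proj₂ (proj₂ (∈-greedy⁻ (∈-lookup q))))

    theCharge : Charge topRow leftCol (endTable (suc topRow) leftCol)
    theCharge = charge topRow leftCol isTop

    chargedRect : Fin (length R)
    chargedRect = proj₁ (proj₂ (proj₂ theCharge))

    chargedCorner : Fin 4
    chargedCorner = proj₁ (proj₂ (proj₂ (proj₂ theCharge)))

    chargedPoint : corner (lookup R chargedRect) chargedCorner ≡ (topRow , proj₁ theCharge)
    chargedPoint = proj₂ (proj₂ (proj₂ (proj₂ theCharge)))
  open Charged

  charged-injective : ∀ {q q′} → combine (chargedRect q) (chargedCorner q) ≡ combine (chargedRect q′) (chargedCorner q′) → q ≡ q′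
  charged-injective {q} {q′} eq with combine-injective _ _ _ _ eq
  ... | ρ≡ , τ≡ = Unique-lookup-injective greedy-unique q q′
                    (trans (isBlock q) (trans (cong₂ blockRect (cong proj₁ samePoint) sameLeft) (sym (isBlock q′))))
    where
      samePoint : (topRow q , proj₁ (theCharge q)) ≡ (topRow q′ , proj₁ (theCharge q′))
      samePoint = trans (sym (chargedPoint q)) (trans (cong₂ (λ ρ τ → corner (lookup R ρ) τ) ρ≡ τ≡) (chargedPoint q′))
      sameLeft : leftCol q ≡ leftCol q′
      sameLeft = charge-determinesStart (isTop q) (isTop q′) (theCharge q) (theCharge q′) samePoint

  greedy-≤-4*length : length greedy ≤ 4 * length R
  greedy-≤-4*length = subst (length greedy ≤_) (*-comm (length R) 4) (injective⇒≤ charged-injective)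

update-same : ∀ m a v → update m a v a ≡ v
update-same m a v rewrite ≡⇒≡ᵇ-true {a} refl = refl

update-other : ∀ m a v x → x ≢ a → update m a v x ≡ m x
update-other m a v x x≢a rewrite ≢⇒≡ᵇ-false x≢a = refl

module Machine (P : Program) (B : ℕ) where

  Bounded : Memory → Set
  Bounded m = ∀ a → m a < B

  bounded-update : ∀ {m} → Bounded m → ∀ r v → v < B → Bounded (update m r v)
  bounded-update b r v v<B x with x ≡ᵇ r
  ... | true  = v<B
  ... | false = b x

  run-halted : ∀ t c → step P c ≡ nothing → run P t c ≡ c
  run-halted zero    c _ = refl
  run-halted (suc t) c h with step P c
  ... | nothing = refl

  run-+ : ∀ s t c → run P (s + t) c ≡ run P t (run P s c)
  run-+ zero    t c = refl
  run-+ (suc s) t c with step P c in eq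
  ... | nothing = sym (run-halted t c eq)
  ... | just c′ = run-+ s t c′

  BoundedRun : Config → Config → ℕ → Set
  BoundedRun c c′ t = run P t c ≡ c′ × (∀ s → s ≤ t → Bounded (mem (run P s c)))

  boundedRun-seq : ∀ {c₁ c₂ c₃ s t} → BoundedRun c₁ c₂ s → BoundedRun c₂ c₃ t → BoundedRun c₁ c₃ (s + t)
  boundedRun-seq {c₁} {s = s} {t} (run₁ , bnd₁) (run₂ , bnd₂) = trans (run-+ s t c₁) (trans (cong (run P t) run₁) run₂) , bnd
    where
      bnd : ∀ u → u ≤ s + t → Bounded (mem (run P u c₁))
      bnd u u≤s+t with u ≤? s
      ... | yes u≤s = bnd₁ u u≤s
      ... | no u≰s = subst (λ u → Bounded (mem (run P u c₁))) (m+[n∸m]≡n s≤u)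
                       (subst (λ c → Bounded (mem c)) (sym (trans (run-+ s (u ∸ s) c₁) (cong (run P (u ∸ s)) run₁)))
                              (bnd₂ (u ∸ s) (subst (u ∸ s ≤_) (m+n∸m≡n s t) (∸-monoˡ-≤ s u≤s+t))))
        where
          s≤u : s ≤ u
          s≤u = <⇒≤ (≰⇒> u≰s)

  Reaches : Config → (Config → Set) → ℕ → Set
  Reaches c Q T = Σ Config λ c′ → Σ ℕ λ t → t ≤ T × BoundedRun c c′ t × Q c′

  reach-now : ∀ {c Q} → Bounded (mem c) → Q c → Reaches c Q 0
  reach-now {c} b q = c , 0 , z≤n , (refl , λ { zero _ → b }) , q

  reach-bounded : ∀ {c Q T} → Reaches c Q T → Bounded (mem c)
  reach-bounded (_ , _ , _ , (_ , bnd) , _) = bnd 0 z≤n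

  reach-bind : ∀ {c Q Q′ T T′} → Reaches c Q T → (∀ c′ → Bounded (mem c′) → Q c′ → Reaches c′ Q′ T′) → Reaches c Q′ (T + T′)
  reach-bind (c₁ , t₁ , t₁≤T , r₁ , q₁) k with k c₁ (subst (λ c → Bounded (mem c)) (proj₁ r₁) (proj₂ r₁ t₁ ≤-refl)) q₁
  ... | c₂ , t₂ , t₂≤T′ , r₂ , q₂ = c₂ , t₁ + t₂ , +-mono-≤ t₁≤T t₂≤T′ , boundedRun-seq r₁ r₂ , q₂

  reach-mono : ∀ {c Q T T′} → T ≤ T′ → Reaches c Q T → Reaches c Q T′
  reach-mono T≤T′ (c′ , t , t≤T , r , q) = c′ , t , ≤-trans t≤T T≤T′ , r , q

  reach-map : ∀ {c Q Q′ T} → (∀ c → Q c → Q′ c) → Reaches c Q T → Reaches c Q′ T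
  reach-map f (c′ , t , t≤T , r , q) = c′ , t , t≤T , r , f c′ q

  reach-step : ∀ {c c′ Q T} → Bounded (mem c) → step P c ≡ just c′ → Reaches c′ Q T → Reaches c Q (suc T)
  reach-step {c} {c′} b st r = reach-bind {T = 1} (c′ , 1 , ≤-refl , (run1 , bnd) , refl) (λ _ _ eq → subst (λ c → Reaches c _ _) eq r)
    where
      run1 : run P 1 c ≡ c′
      run1 rewrite st = refl
      bnd : ∀ s → s ≤ 1 → Bounded (mem (run P s c))
      bnd zero          _ = b
      bnd (suc zero)    _ = subst (λ c → Bounded (mem c)) (sym run1) (reach-bounded r)
      bnd (suc (suc s)) (s≤s ())

  At : ℕ → (Memory → Set) → Config → Set
  At h I (config p m) = p ≡ h × I m

  At-map : ∀ {h I J} → (∀ {m} → I m → J m) → ∀ c → At h I c → At h J c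
  At-map f (config _ _) (at , i) = at , f i

  halting⇒RunsWithin : ∀ {n} (M : Matrix n) {h T w} {Good : List Rect → Set} → fetch P h ≡ halt → B ≡ (2 + n) ^ w →
                       Reaches (initConfig M) (At h (λ m → Good (decodeOutput m))) T → RunsWithin P w T M Good
  halting⇒RunsWithin M {h} {Good = Good} halts B≡ (config _ m , t , t≤T , (run≡ , bounded) , (refl , good)) =
    t , t≤T , subst (Halted P) (sym run≡) (cong (λ i → exec i (config h m)) halts) ,
    (λ s s≤t a → subst (_ <_) B≡ (bounded s s≤t a)) , subst (λ c → Good (decodeOutput (mem c))) (sym run≡) good

  arrive : ∀ {h m I} → Bounded m → I m → Reaches (config h m) (At h I) 0
  arrive b i = reach-now b (refl , i)

  thenAt : ∀ {c h I Q T T′} → Reaches c (At h I) T → (∀ m → Bounded m → I m → Reaches (config h m) Q T′) → Reaches c Q (T + T′)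
  thenAt r k = reach-bind r λ { (config _ m) b (refl , i) → k m b i }

  loopAt : ∀ h (Inv : ℕ → Memory → Set) N T →
           (∀ x m → x < N → Bounded m → Inv x m → Reaches (config h m) (At h (Inv (suc x))) T) →
           ∀ m → Bounded m → Inv 0 m → Reaches (config h m) (At h (Inv N)) (N * T)
  loopAt h Inv N T body = iterate N 0 refl
    where
      iterate : ∀ k x → x + k ≡ N → ∀ m → Bounded m → Inv x m → Reaches (config h m) (At h (Inv N)) (k * T)
      iterate zero    x x+0≡N m b inv = arrive b (subst (λ x → Inv x m) (trans (sym (+-identityʳ x)) x+0≡N) inv)
      iterate (suc k) x x+k+1≡N m b inv =
        thenAt (body x m (subst (x <_) x+k+1≡N (m<m+n x z<s)) b inv)
               (iterate k (suc x) (trans (sym (+-suc x k)) x+k+1≡N))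

  stepConst : ∀ {p m r k Q T} → Bounded m → fetch P p ≡ const r k → k < B →
              (Bounded (update m r k) → Reaches (config (suc p) (update m r k)) Q T) → Reaches (config p m) Q (suc T)
  stepConst {p} {m} b f k<B k = reach-step b (cong (λ i → exec i (config p m)) f) (k (bounded-update b _ _ k<B))

  stepAdd : ∀ {p m r a c Q T} v → Bounded m → fetch P p ≡ add r a c → m a + m c ≡ v → v < B →
            (Bounded (update m r v) → Reaches (config (suc p) (update m r v)) Q T) → Reaches (config p m) Q (suc T)
  stepAdd {p} {m} v b f refl v<B k = reach-step b (cong (λ i → exec i (config p m)) f) (k (bounded-update b _ v v<B))

  stepMul : ∀ {p m r a c Q T} v → Bounded m → fetch P p ≡ mul r a c → m a * m c ≡ v → v < B →
            (Bounded (update m r v) → Reaches (config (suc p) (update m r v)) Q T) → Reaches (config p m) Q (suc T)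
  stepMul {p} {m} v b f refl v<B k = reach-step b (cong (λ i → exec i (config p m)) f) (k (bounded-update b _ v v<B))

  stepSub : ∀ {p m r a c Q T} v → Bounded m → fetch P p ≡ sub r a c → m a ∸ m c ≡ v →
            (Bounded (update m r v) → Reaches (config (suc p) (update m r v)) Q T) → Reaches (config p m) Q (suc T)
  stepSub {p} {m} {a = a} {c} v b f refl k =
    reach-step b (cong (λ i → exec i (config p m)) f) (k (bounded-update b _ v (≤-<-trans (m∸n≤m (m a) (m c)) (b a))))

  stepLoad : ∀ {p m r a Q T} v → Bounded m → fetch P p ≡ load r a → m (m a) ≡ v →
             (Bounded (update m r v) → Reaches (config (suc p) (update m r v)) Q T) → Reaches (config p m) Q (suc T)
  stepLoad {p} {m} {a = a} v b f refl k = reach-step b (cong (λ i → exec i (config p m)) f) (k (bounded-update b _ v (b (m a))))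

  stepStore : ∀ {p m a c Q T} ad v → Bounded m → fetch P p ≡ store a c → m a ≡ ad → m c ≡ v →
              (Bounded (update m ad v) → Reaches (config (suc p) (update m ad v)) Q T) → Reaches (config p m) Q (suc T)
  stepStore {p} {m} {c = c} ad v b f refl refl k = reach-step b (cong (λ i → exec i (config p m)) f) (k (bounded-update b _ v (b c)))

  stepJmp : ∀ {p m l Q T} → Bounded m → fetch P p ≡ jmp l → Reaches (config l m) Q T → Reaches (config p m) Q (suc T)
  stepJmp {p} {m} b f = reach-step b (cong (λ i → exec i (config p m)) f)

  stepJltTaken : ∀ {p m a c l Q T} → Bounded m → fetch P p ≡ jlt a c l → m a < m c →
                 Reaches (config l m) Q T → Reaches (config p m) Q (suc T)
  stepJltTaken {p} {m} {l = l} b f lt =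
    reach-step b (trans (cong (λ i → exec i (config p m)) f) (cong (λ t → just (config (if t then l else suc p) m)) (<⇒<ᵇ-true lt)))

  stepJltNotTaken : ∀ {p m a c l Q T} → Bounded m → fetch P p ≡ jlt a c l → ¬ (m a < m c) →
                    Reaches (config (suc p) m) Q T → Reaches (config p m) Q (suc T)
  stepJltNotTaken {p} {m} {l = l} b f nlt =
    reach-step b (trans (cong (λ i → exec i (config p m)) f) (cong (λ t → just (config (if t then l else suc p) m)) (≮⇒<ᵇ-false nlt)))

-- Memory layout, with Z = 16 + (n + 5) ²: registers 0–15, a copy of the input from Z on (entry
-- (i , j) at Z + 1 + i * n + j), endTable r l at 2Z + r * n + l, bottomScan (n ∸ i) l at 3Z + i * n + l,
-- and the output image from 4Z on. Registers 1–15 initially hold input bits: cells 1–5 are packed into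
-- register 1 first, and cells 6 and up are copied before any of them is overwritten.
program : Program
program =
  -- m[1] := m[1] + 2 (m[2] + 2 (m[3] + 2 (m[4] + 2 m[5])))
  (add 5 5 5) ∷ -- 0
  (add 4 4 5) ∷ -- 1
  (add 4 4 4) ∷ -- 2
  (add 3 3 4) ∷ -- 3
  (add 3 3 3) ∷ -- 4
  (add 2 2 3) ∷ -- 5
  (add 2 2 2) ∷ -- 6
  (add 1 1 2) ∷ -- 7
  -- copy input cells 6, 7, … to Z + 6, Z + 7, …
  (const 2 6) ∷ -- 8
  (const 4 5) ∷ -- 9
  (add 3 4 0) ∷ -- 10
  (mul 3 3 3) ∷ -- 11
  (const 4 16) ∷ -- 12
  (add 3 4 3) ∷ -- 13
  (add 3 3 2) ∷ -- 14
  (mul 5 0 0) ∷ -- 15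
  (const 4 1) ∷ -- 16
  (add 5 5 4) ∷ -- 17
  (jlt 2 5 20) ∷ -- 18
  (jmp 26) ∷ -- 19
  (load 4 2) ∷ -- 20
  (store 3 4) ∷ -- 21
  (const 4 1) ∷ -- 22
  (add 2 2 4) ∷ -- 23
  (add 3 3 4) ∷ -- 24
  (jmp 18) ∷ -- 25
  -- unpack register 1 into Z + 1, …, Z + 5
  (const 6 5) ∷ -- 26
  (add 7 6 0) ∷ -- 27
  (mul 7 7 7) ∷ -- 28
  (const 6 16) ∷ -- 29
  (add 7 6 7) ∷ -- 30
  (const 8 1) ∷ -- 31
  (const 6 16) ∷ -- 32
  (jlt 1 6 38) ∷ -- 33
  (const 9 5) ∷ -- 34
  (add 9 7 9) ∷ -- 35
  (store 9 8) ∷ -- 36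
  (sub 1 1 6) ∷ -- 37
  (const 6 8) ∷ -- 38
  (jlt 1 6 44) ∷ -- 39
  (const 9 4) ∷ -- 40
  (add 9 7 9) ∷ -- 41
  (store 9 8) ∷ -- 42
  (sub 1 1 6) ∷ -- 43
  (const 6 4) ∷ -- 44
  (jlt 1 6 50) ∷ -- 45
  (const 9 3) ∷ -- 46
  (add 9 7 9) ∷ -- 47
  (store 9 8) ∷ -- 48
  (sub 1 1 6) ∷ -- 49
  (const 6 2) ∷ -- 50
  (jlt 1 6 56) ∷ -- 51
  (const 9 2) ∷ -- 52
  (add 9 7 9) ∷ -- 53
  (store 9 8) ∷ -- 54
  (sub 1 1 6) ∷ -- 55
  (const 6 1) ∷ -- 56
  (jlt 1 6 62) ∷ -- 57
  (const 9 1) ∷ -- 58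
  (add 9 7 9) ∷ -- 59
  (store 9 8) ∷ -- 60
  (sub 1 1 6) ∷ -- 61
  -- fill endTable, scanning each row from right to left
  (const 1 0) ∷ -- 62
  (const 2 1) ∷ -- 63
  (const 3 5) ∷ -- 64
  (add 3 3 0) ∷ -- 65
  (mul 3 3 3) ∷ -- 66
  (const 9 16) ∷ -- 67
  (add 3 9 3) ∷ -- 68
  (const 4 0) ∷ -- 69
  (add 5 3 2) ∷ -- 70
  (add 6 3 3) ∷ -- 71
  (add 6 6 0) ∷ -- 72
  (jlt 4 0 75) ∷ -- 73
  (jmp 101) ∷ -- 74
  (add 8 0 1) ∷ -- 75
  (add 7 0 1) ∷ -- 76
  (jlt 1 7 79) ∷ -- 77
  (jmp 97) ∷ -- 78
  (sub 7 7 2) ∷ -- 79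
  (add 9 5 7) ∷ -- 80
  (load 9 9) ∷ -- 81
  (jlt 1 9 85) ∷ -- 82
  (add 8 7 1) ∷ -- 83
  (jmp 94) ∷ -- 84
  (jlt 1 7 87) ∷ -- 85
  (jmp 91) ∷ -- 86
  (add 9 5 7) ∷ -- 87
  (sub 9 9 2) ∷ -- 88
  (load 9 9) ∷ -- 89
  (jlt 1 9 94) ∷ -- 90
  (add 9 6 7) ∷ -- 91
  (store 9 8) ∷ -- 92
  (jmp 77) ∷ -- 93
  (add 9 6 7) ∷ -- 94
  (store 9 1) ∷ -- 95
  (jmp 77) ∷ -- 96
  (add 4 4 2) ∷ -- 97
  (add 5 5 0) ∷ -- 98
  (add 6 6 0) ∷ -- 99
  (jmp 73) ∷ -- 100
  -- fill bottomScan bottom-up, emitting a rectangle at every block top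
  (add 4 0 1) ∷ -- 101
  (add 5 3 3) ∷ -- 102
  (mul 9 0 0) ∷ -- 103
  (add 5 5 9) ∷ -- 104
  (add 6 5 3) ∷ -- 105
  (sub 6 6 0) ∷ -- 106
  (add 14 3 3) ∷ -- 107
  (add 14 14 14) ∷ -- 108
  (add 12 14 2) ∷ -- 109
  (const 13 0) ∷ -- 110
  (jlt 1 4 113) ∷ -- 111
  (jmp 153) ∷ -- 112
  (const 7 0) ∷ -- 113
  (jlt 7 0 116) ∷ -- 114
  (jmp 149) ∷ -- 115
  (add 9 5 7) ∷ -- 116
  (load 8 9) ∷ -- 117
  (add 9 9 0) ∷ -- 118
  (load 10 9) ∷ -- 119
  (add 11 6 7) ∷ -- 120
  (jlt 8 10 127) ∷ -- 121
  (jlt 10 8 127) ∷ -- 122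
  (add 9 11 0) ∷ -- 123
  (load 9 9) ∷ -- 124
  (store 11 9) ∷ -- 125
  (jmp 128) ∷ -- 126
  (store 11 4) ∷ -- 127
  (jlt 1 8 130) ∷ -- 128
  (jmp 147) ∷ -- 129
  (sub 9 5 0) ∷ -- 130
  (add 9 9 7) ∷ -- 131
  (load 10 9) ∷ -- 132
  (jlt 10 8 136) ∷ -- 133
  (jlt 8 10 136) ∷ -- 134
  (jmp 147) ∷ -- 135
  (sub 9 4 2) ∷ -- 136
  (store 12 9) ∷ -- 137
  (add 12 12 2) ∷ -- 138
  (load 9 11) ∷ -- 139
  (store 12 9) ∷ -- 140
  (add 12 12 2) ∷ -- 141
  (store 12 7) ∷ -- 142
  (add 12 12 2) ∷ -- 143
  (store 12 8) ∷ -- 144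
  (add 12 12 2) ∷ -- 145
  (add 13 13 2) ∷ -- 146
  (add 7 7 2) ∷ -- 147
  (jmp 114) ∷ -- 148
  (sub 4 4 2) ∷ -- 149
  (sub 5 5 0) ∷ -- 150
  (sub 6 6 0) ∷ -- 151
  (jmp 111) ∷ -- 152
  (store 14 13) ∷ -- 153
  -- copy the output image from 4Z + 16 on down to address 16
  (const 4 16) ∷ -- 154
  (add 5 13 13) ∷ -- 155
  (add 5 5 5) ∷ -- 156
  (add 5 5 2) ∷ -- 157
  (add 6 14 4) ∷ -- 158
  (jlt 4 5 161) ∷ -- 159
  (jmp 166) ∷ -- 160
  (load 7 6) ∷ -- 161
  (store 4 7) ∷ -- 162
  (add 4 4 2) ∷ -- 163
  (add 6 6 2) ∷ -- 164
  (jmp 159) ∷ -- 165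
  -- load registers 0–15 from the first 16 cells of the output image
  (add 0 14 1) ∷ -- 166
  (add 1 14 2) ∷ -- 167
  (const 15 14) ∷ -- 168
  (add 15 15 1) ∷ -- 169
  (const 14 13) ∷ -- 170
  (add 14 14 1) ∷ -- 171
  (const 13 12) ∷ -- 172
  (add 13 13 1) ∷ -- 173
  (const 12 11) ∷ -- 174
  (add 12 12 1) ∷ -- 175
  (const 11 10) ∷ -- 176
  (add 11 11 1) ∷ -- 177
  (const 10 9) ∷ -- 178
  (add 10 10 1) ∷ -- 179
  (const 9 8) ∷ -- 180
  (add 9 9 1) ∷ -- 181
  (const 8 7) ∷ -- 182
  (add 8 8 1) ∷ -- 183
  (const 7 6) ∷ -- 184
  (add 7 7 1) ∷ -- 185
  (const 6 5) ∷ -- 186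
  (add 6 6 1) ∷ -- 187
  (const 5 4) ∷ -- 188
  (add 5 5 1) ∷ -- 189
  (const 4 3) ∷ -- 190
  (add 4 4 1) ∷ -- 191
  (const 3 2) ∷ -- 192
  (add 3 3 1) ∷ -- 193
  (const 2 1) ∷ -- 194
  (add 2 2 1) ∷ -- 195
  (load 0 0) ∷ -- 196
  (load 1 1) ∷ -- 197
  (load 2 2) ∷ -- 198
  (load 3 3) ∷ -- 199
  (load 4 4) ∷ -- 200
  (load 5 5) ∷ -- 201
  (load 6 6) ∷ -- 202
  (load 7 7) ∷ -- 203
  (load 8 8) ∷ -- 204
  (load 9 9) ∷ -- 205
  (load 10 10) ∷ -- 206
  (load 11 11) ∷ -- 207
  (load 12 12) ∷ -- 208
  (load 13 13) ∷ -- 209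
  (load 14 14) ∷ -- 210
  (load 15 15) ∷ -- 211
  halt ∷ -- 212
  []

bit≤1 : ∀ b → bit b ≤ 1
bit≤1 true = ≤-refl
bit≤1 false = z≤n

inputBit : ∀ {n} → Matrix n → ℕ → Bool
inputBit {zero} M a = false
inputBit {suc k} M a = entry M (a / suc k) (a % suc k)

initMemory-input : ∀ {n} (M : Matrix n) a → initMemory M (suc a) ≡ bit (inputBit M a)
initMemory-input {zero} M a = refl
initMemory-input {suc k} M a = refl

entry-outOfRange : ∀ {n} (M : Matrix n) i j → ¬ (i < n) → entry M i j ≡ false
entry-outOfRange {n} M i j ni with i <? n | j <? n
... | yes p | _ = ⊥-elim (ni p)
... | no _ | yes _ = refl
... | no _ | no _ = refl

initMemory-cell : ∀ {n} (M : Matrix n) i j → i < n → j < n → initMemory M (suc (i * n + j)) ≡ bit (entry M i j)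
initMemory-cell {suc k} M i j i<n j<n = cong bit (cong₂ (entry M) e1 e2)
  where
    e1 : (i * suc k + j) / suc k ≡ i
    e1 = trans (+-distrib-/-∣ˡ {i * suc k} j (n∣m*n i)) (trans (cong₂ _+_ (m*n/n≡m i (suc k)) (m<n⇒m/n≡0 j<n)) (+-identityʳ i))
    e2 : (i * suc k + j) % suc k ≡ j
    e2 = trans (cong (_% suc k) (+-comm (i * suc k) j)) (trans ([m+kn]%n≡m%n j i (suc k)) (m<n⇒m%n≡m j<n))

initMemory-beyondInput : ∀ {n} (M : Matrix n) a → n * n ≤ a → initMemory M (suc a) ≡ 0
initMemory-beyondInput {zero} M a _ = refl
initMemory-beyondInput {suc k} M a le = cong bit (entry-outOfRange M (a / suc k) (a % suc k) nlt)
  where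
    nlt : ¬ (a / suc k < suc k)
    nlt lt = <-irrefl refl (<-≤-trans lt3 le)
      where
        q : ℕ
        q = a / suc k
        lt3 : a < suc k * suc k
        lt3 = begin-strict
            a ≡⟨ m≡m%n+[m/n]*n a (suc k) ⟩
            a % suc k + q * suc k <⟨ +-monoˡ-< (q * suc k) (m%n<n a (suc k)) ⟩
            suc k + q * suc k ≤⟨ +-monoʳ-≤ (suc k) (*-monoˡ-≤ (suc k) (s≤s⁻¹ lt)) ⟩
            suc k + k * suc k ∎
          where open ≤-Reasoning

module Layout {n : ℕ} (M : Matrix n) where
  open Greedy M public

  W : ℕ
  W = (5 + n) * (5 + n)
  Z : ℕ
  Z = 16 + W
  -- Abstract, so that checking the runs of the machine never normalises the word bound.
  abstract
    B : ℕ
    B = (2 + n) ^ 10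
    B-def : B ≡ (2 + n) ^ 10
    B-def = refl

  init : Memory
  init = initMemory M

  open Machine program B public

  -- With k = n + 2: (n + 5) ² ≤ 9 k ² and 16 ≤ 4 k ², so 9 Z ≤ 117 k ² < 2 ^ 8 * k ² ≤ k ^ 10.
  word≤9Z : ∀ v → v ≤ 9 * Z → v < B
  word≤9Z v v≤9Z = subst (v <_) (sym B-def) (≤-<-trans v≤9Z 9Z<k^10)
    where
      k : ℕ
      k = 2 + n
      open ≤-Reasoning
      2≤k : 2 ≤ k
      2≤k = s≤s (s≤s z≤n)
      5+n≤3k : 5 + n ≤ 3 * k
      5+n≤3k = ≤-trans (m≤m+n (5 + n) (1 + 2 * n))
                       (≤-reflexive (solve 1 (λ n → (con 5 :+ n) :+ (con 1 :+ con 2 :* n) := con 3 :* (con 2 :+ n)) refl n))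
      W≤9k² : W ≤ 9 * (k * k)
      W≤9k² = begin
          (5 + n) * (5 + n)  ≤⟨ *-mono-≤ 5+n≤3k 5+n≤3k ⟩
          (3 * k) * (3 * k)  ≡⟨ solve 1 (λ k → (con 3 :* k) :* (con 3 :* k) := con 9 :* (k :* k)) refl k ⟩
          9 * (k * k)        ∎
      9Z<k^10 : 9 * Z < k ^ 10
      9Z<k^10 = begin-strict
          9 * (16 + W)                ≤⟨ *-monoʳ-≤ 9 (+-mono-≤ (*-monoʳ-≤ 4 (*-mono-≤ 2≤k 2≤k)) W≤9k²) ⟩
          9 * (4 * (k * k) + 9 * (k * k)) ≡⟨ solve 1 (λ a → con 9 :* (con 4 :* a :+ con 9 :* a) := con 117 :* a) refl (k * k) ⟩
          117 * (k * k)              <⟨ *-monoˡ-< (k * k) {117} {256} (s≤s (m≤m+n 117 138)) ⟩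
          256 * (k * k)              ≤⟨ *-monoˡ-≤ (k * k) (^-monoˡ-≤ 8 2≤k) ⟩
          k ^ 8 * (k * k)            ≡⟨ solve 1 (λ k → (k :^ 8) :* (k :* k) := k :^ 10) refl k ⟩
          k ^ 10                     ∎

  word≤kZ : ∀ v k → v ≤ k * Z → k ≤ 9 → v < B
  word≤kZ v k le k9 = word≤9Z v (≤-trans le (*-monoˡ-≤ Z k9))

  16≤Z : 16 ≤ Z
  16≤Z = m≤m+n 16 W

  n≤W : n ≤ W
  n≤W = ≤-trans (m≤n+m n 5) (m≤m*n (5 + n) (5 + n))

  n*n≤W : n * n ≤ W
  n*n≤W = *-mono-≤ (m≤n+m n 5) (m≤n+m n 5)

  n<Z : n < Z
  n<Z = ≤-trans (s≤s n≤W) (+-monoˡ-≤ W {1} {16} (s≤s z≤n))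

  n*n+16≤Z : n * n + 16 ≤ Z
  n*n+16≤Z = ≤-trans (+-monoˡ-≤ 16 n*n≤W) (≤-reflexive (+-comm W 16))

  word≤31 : ∀ v → v ≤ 31 → v < B
  word≤31 v le = word≤kZ v 2 (≤-trans le (≤-trans (m≤m+n 31 1) (*-monoʳ-≤ 2 16≤Z))) (s≤s (s≤s z≤n))

  word≤Z : ∀ {v} → v ≤ Z → v < B
  word≤Z {v} le = word≤kZ v 1 (subst (v ≤_) (sym (+-identityʳ Z)) le) (s≤s z≤n)

  word≤2Z : ∀ {v} → v ≤ Z + Z → v < B
  word≤2Z {v} le = word≤kZ v 2 (subst (v ≤_) (cong (Z +_) (sym (+-identityʳ Z))) le) (s≤s (s≤s z≤n))

  word≤3Z : ∀ {v} → v ≤ Z + (Z + Z) → v < B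
  word≤3Z {v} le = word≤kZ v 3 (subst (v ≤_) (cong (λ z → Z + (Z + z)) (sym (+-identityʳ Z))) le) (s≤s (s≤s (s≤s z≤n)))

  word≤4Z : ∀ {v} → v ≤ Z + (Z + (Z + Z)) → v < B
  word≤4Z {v} le = word≤kZ v 4 (subst (v ≤_) (cong (λ z → Z + (Z + (Z + z))) (sym (+-identityʳ Z))) le) (s≤s (s≤s (s≤s (s≤s z≤n))))

  word≤8Z : ∀ {v} → v ≤ Z + (Z + (Z + (Z + (Z + (Z + (Z + Z)))))) → v < B
  word≤8Z {v} le = word≤kZ v 8 (subst (v ≤_) (cong (λ z → Z + (Z + (Z + (Z + (Z + (Z + (Z + z))))))) (sym (+-identityʳ Z))) le) (s≤s (s≤s (s≤s (s≤s (s≤s (s≤s (s≤s (s≤s z≤n))))))))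

module PackLowBits {n : ℕ} (M : Matrix n) where
  open Layout M public

  init-bit≤1 : ∀ k → init (suc k) ≤ 1
  init-bit≤1 k = subst (_≤ 1) (sym (initMemory-input M k)) (bit≤1 _)

  init-bounded : Bounded init
  init-bounded zero = word≤kZ n 1 (≤-trans (<⇒≤ n<Z) (≤-reflexive (sym (+-identityʳ Z)))) (s≤s z≤n)
  init-bounded (suc a) = word≤31 _ (≤-trans (init-bit≤1 a) (s≤s z≤n))

  c5 c4 c4' c3 c3' c2 c2' packed : ℕ
  c5 = init 5 + init 5
  c4 = init 4 + c5
  c4' = c4 + c4
  c3 = init 3 + c4'
  c3' = c3 + c3
  c2 = init 2 + c3'
  c2' = c2 + c2
  packed = init 1 + c2'

  l5 : c5 ≤ 2
  l5 = +-mono-≤ (init-bit≤1 4) (init-bit≤1 4)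
  l4 : c4 ≤ 3
  l4 = +-mono-≤ (init-bit≤1 3) l5
  l4' : c4' ≤ 6
  l4' = +-mono-≤ l4 l4
  l3 : c3 ≤ 7
  l3 = +-mono-≤ (init-bit≤1 2) l4'
  l3' : c3' ≤ 14
  l3' = +-mono-≤ l3 l3
  l2 : c2 ≤ 15
  l2 = +-mono-≤ (init-bit≤1 1) l3'
  l2' : c2' ≤ 30
  l2' = +-mono-≤ l2 l2
  packed≤31 : packed ≤ 31
  packed≤31 = +-mono-≤ (init-bit≤1 0) l2'

  Packed : Memory → Set
  Packed m = m 0 ≡ n × m 1 ≡ packed × (∀ a → m (6 + a) ≡ init (6 + a))

  pack : Reaches (config 0 init) (At 8 Packed) 8
  pack = stepAdd c5 init-bounded refl refl (word≤31 _ (≤-trans l5 (m≤m+n 2 29))) λ b1 →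
       stepAdd c4 b1 refl refl (word≤31 _ (≤-trans l4 (m≤m+n 3 28))) λ b2 →
       stepAdd c4' b2 refl refl (word≤31 _ (≤-trans l4' (m≤m+n 6 25))) λ b3 →
       stepAdd c3 b3 refl refl (word≤31 _ (≤-trans l3 (m≤m+n 7 24))) λ b4 →
       stepAdd c3' b4 refl refl (word≤31 _ (≤-trans l3' (m≤m+n 14 17))) λ b5 →
       stepAdd c2 b5 refl refl (word≤31 _ (≤-trans l2 (m≤m+n 15 16))) λ b6 →
       stepAdd c2' b6 refl refl (word≤31 _ (≤-trans l2' (m≤m+n 30 1))) λ b7 →
       stepAdd packed b7 refl refl (word≤31 _ packed≤31) λ b8 →
       arrive b8 (refl , refl , λ a → refl)

module CopyInput {n : ℕ} (M : Matrix n) where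
  open PackLowBits M public

  copyCount : ℕ
  copyCount = (n * n + 1) ∸ 6

  -- In the machine invariants a field named by a letter and a number, such as r2, gives the
  -- content of that register.
  record CopyInv (x : ℕ) (m : Memory) : Set where
    field
      r0 : m 0 ≡ n
      r1 : m 1 ≡ packed
      r2 : m 2 ≡ 6 + x
      r3 : m 3 ≡ Z + (6 + x)
      r5 : m 5 ≡ n * n + 1
      input : ∀ a → 6 + a < Z → m (6 + a) ≡ init (6 + a)
      copied : ∀ b → b < x → m (Z + (6 + b)) ≡ init (6 + b)
      lowZero : ∀ a → a < 6 → m (Z + a) ≡ 0
      restZero : ∀ b → x ≤ b → m (Z + (6 + b)) ≡ 0
  open CopyInv

  n*n+1≤Z : n * n + 1 ≤ Z
  n*n+1≤Z = ≤-trans (+-monoʳ-≤ (n * n) (s≤s z≤n)) n*n+16≤Z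

  init-aboveZ : ∀ a → init (Z + a) ≡ 0
  init-aboveZ a = initMemory-beyondInput M (15 + W + a) (≤-trans n*n≤W (≤-trans (m≤n+m W 15) (m≤m+n (15 + W) a)))

  copy-setup : ∀ m → Bounded m → Packed m → Reaches (config 8 m) (At 18 (CopyInv 0)) 10
  copy-setup m b (e0 , e1 , ein) =
    stepConst b refl (word≤31 6 (m≤m+n 6 25)) λ b1 →
    stepConst b1 refl (word≤31 5 (m≤m+n 5 26)) λ b2 →
    stepAdd (5 + n) b2 refl (cong (5 +_) e0) (word≤Z (≤-trans (m≤m*n (5 + n) (5 + n)) (m≤n+m W 16))) λ b3 →
    stepMul W b3 refl refl (word≤Z (m≤n+m W 16)) λ b4 →
    stepConst b4 refl (word≤31 16 (m≤m+n 16 15)) λ b5 →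
    stepAdd Z b5 refl refl (word≤Z ≤-refl) λ b6 →
    stepAdd (Z + 6) b6 refl refl (word≤2Z (+-monoʳ-≤ Z (≤-trans (m≤m+n 6 10) 16≤Z))) λ b7 →
    stepMul (n * n) b7 refl (cong₂ _*_ e0 e0) (word≤Z (≤-trans (m≤m+n (n * n) 1) n*n+1≤Z)) λ b8 →
    stepConst b8 refl (word≤31 1 (m≤m+n 1 30)) λ b9 →
    stepAdd (n * n + 1) b9 refl refl (word≤Z n*n+1≤Z) λ b10 →
    arrive b10 (record
      { r0 = e0 ; r1 = e1 ; r2 = refl ; r3 = refl ; r5 = refl
      ; input = λ a _ → ein a
      ; copied = λ b ()
      ; lowZero = λ a _ → trans (ein (10 + (W + a))) (init-aboveZ a)
      ; restZero = λ b _ → trans (ein (10 + (W + (6 + b)))) (init-aboveZ (6 + b)) })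

  copy-index< : ∀ x → x < copyCount → 6 + x < n * n + 1
  copy-index< x = <∸⇒+< 6

  Z+-≢ : ∀ {a b} → a ≢ b → Z + a ≢ Z + b
  Z+-≢ ne e = ne (+-cancelˡ-≡ Z _ _ e)

  copy-step : ∀ x m → x < copyCount → Bounded m → CopyInv x m → Reaches (config 18 m) (At 18 (CopyInv (suc x))) 7
  copy-step x m lt b I =
    stepJltTaken b refl (subst₂ _<_ (sym (r2 I)) (sym (r5 I)) (copy-index< x lt)) (
    stepLoad (init (6 + x)) b refl (trans (cong m (r2 I)) (input I x lt6)) λ b1 →
    stepStore (Z + (6 + x)) (init (6 + x)) b1 refl (r3 I) refl λ b2 →
    stepConst b2 refl (word≤31 1 (m≤m+n 1 30)) λ b3 →
    stepAdd (6 + suc x) b3 refl (trans (cong (_+ 1) (r2 I)) (cong (6 +_) (+-comm x 1))) (word≤Z (≤-trans (copy-index< x lt) n*n+1≤Z)) λ b4 →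
    stepAdd (Z + (6 + suc x)) b4 refl (trans (cong (_+ 1) (r3 I)) (trans (+-assoc Z (6 + x) 1) (cong (λ z → Z + (6 + z)) (+-comm x 1)))) (word≤2Z (+-monoʳ-≤ Z (≤-trans (copy-index< x lt) n*n+1≤Z))) λ b5 →
    stepJmp b5 refl (arrive b5 (record
      { r0 = r0 I ; r1 = r1 I ; r2 = refl ; r3 = refl ; r5 = r5 I
      ; input = λ a l → trans (update-other m1 (Z + (6 + x)) (init (6 + x)) (6 + a) (<⇒≢ (<-≤-trans l (m≤m+n Z (6 + x))))) (input I a l)
      ; copied = cp'
      ; lowZero = λ a l → trans (update-other m1 (Z + (6 + x)) (init (6 + x)) (Z + a) (Z+-≢ (<⇒≢ (<-≤-trans l (m≤m+n 6 x))))) (lowZero I a l)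
      ; restZero = λ c l → trans (update-other m1 (Z + (6 + x)) (init (6 + x)) (Z + (6 + c)) (Z+-≢ (λ e → <-irrefl (sym (+-cancelˡ-≡ 6 _ _ e)) l))) (restZero I c (<⇒≤ l)) })))
    where
      m1 : Memory
      m1 = update m 4 (init (6 + x))
      lt6 : 6 + x < Z
      lt6 = <-≤-trans (copy-index< x lt) n*n+1≤Z
      cp' : ∀ c → c < suc x → update m1 (Z + (6 + x)) (init (6 + x)) (Z + (6 + c)) ≡ init (6 + c)
      cp' c l with m≤n⇒m<n∨m≡n (s≤s⁻¹ l)
      ... | inj₂ refl = update-same m1 (Z + (6 + x)) (init (6 + x))
      ... | inj₁ l' = trans (update-other m1 (Z + (6 + x)) (init (6 + x)) (Z + (6 + c)) (Z+-≢ (λ e → <-irrefl (+-cancelˡ-≡ 6 _ _ e) l'))) (copied I c l')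

  record Copied (m : Memory) : Set where
    field
      q0 : m 0 ≡ n
      q1 : m 1 ≡ packed
      copyOfInput : ∀ b → 6 + b < Z → m (Z + (6 + b)) ≡ init (6 + b)
      copyLowZero : ∀ a → a < 6 → m (Z + a) ≡ 0
      tableRegionZero : ∀ a → m (Z + (Z + a)) ≡ 0
  open Copied public

  n*n+1≤6+copyCount : n * n + 1 ≤ 6 + copyCount
  n*n+1≤6+copyCount = m≤n+m∸n (n * n + 1) 6

  copy-exit : ∀ m → Bounded m → CopyInv copyCount m → Reaches (config 18 m) (At 26 Copied) 2
  copy-exit m b I = stepJltNotTaken b refl (λ l → <-irrefl refl (<-≤-trans (subst₂ _<_ (r2 I) (r5 I) l) n*n+1≤6+copyCount)) (stepJmp b refl (arrive b (record
    { q0 = r0 I ; q1 = r1 I ; copyOfInput = cpy ; copyLowZero = lowZero I ; tableRegionZero = hi2 })))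
    where
      cpy : ∀ c → 6 + c < Z → m (Z + (6 + c)) ≡ init (6 + c)
      cpy c l with c <? copyCount
      ... | yes p = copied I c p
      ... | no np = trans (restZero I c (≮⇒≥ np)) (sym (initMemory-beyondInput M (5 + c) (s≤s⁻¹ (subst (_≤ 6 + c) (+-comm (n * n) 1) (≤-trans n*n+1≤6+copyCount (+-monoʳ-≤ 6 (≮⇒≥ np)))))))
      hi2 : ∀ a → m (Z + (Z + a)) ≡ 0
      hi2 a = restZero I (10 + (W + a)) (≤-trans (m∸n≤m (n * n + 1) 6) (≤-trans (+-monoʳ-≤ (n * n) (s≤s z≤n)) (≤-trans (+-monoˡ-≤ 1 n*n≤W) (≤-trans (≤-reflexive (+-comm W 1)) (≤-trans (+-monoˡ-≤ W {1} {10} (s≤s z≤n)) (m≤m+n (10 + W) a))))))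

  packAndCopy : Reaches (config 0 init) (At 26 Copied) (8 + (10 + (copyCount * 7 + 2)))
  packAndCopy = thenAt pack λ m b P → thenAt (copy-setup m b P) λ m b I → thenAt (loopAt 18 CopyInv copyCount 7 copy-step m b I) λ m b I → copy-exit m b I

module UnpackLowBits {n : ℕ} (M : Matrix n) where
  open CopyInput M public

  record UnpackInv (k v : ℕ) (m : Memory) : Set where
    field
      u0 : m 0 ≡ n
      u1 : m 1 ≡ v
      u7 : m 7 ≡ Z
      u8 : m 8 ≡ 1
      copyAbove : ∀ b → k < b → b < Z → m (Z + b) ≡ init b
      copyUpToZero : ∀ b → b ≤ k → m (Z + b) ≡ 0
      tableRegionZero′ : ∀ a → m (Z + (Z + a)) ≡ 0
  open UnpackInv public

  unpack-stage : ∀ p k T (β : Bool) r m →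
     fetch program p ≡ const 6 T → fetch program (suc p) ≡ jlt 1 6 (6 + p) → fetch program (2 + p) ≡ const 9 (suc k) →
     fetch program (3 + p) ≡ add 9 7 9 → fetch program (4 + p) ≡ store 9 8 → fetch program (5 + p) ≡ sub 1 1 6 →
     T ≤ 16 → k < 5 → r < T → init (suc k) ≡ bit β →
     Bounded m → UnpackInv (suc k) (r + T * bit β) m → Reaches (config p m) (At (6 + p) (UnpackInv k r)) 6
  unpack-stage p k T false r m f0 f1 f2 f3 f4 f5 T16 k5 rT ib b U =
    stepConst b f0 (word≤31 T (≤-trans T16 (m≤m+n 16 15))) λ b1 →
    reach-mono {T = 1} (s≤s z≤n) (stepJltTaken b1 f1 (subst (_< T) (sym (trans (u1 U) (trans (cong (r +_) (*-zeroʳ T)) (+-identityʳ r)))) rT) (arrive b1 (record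
      { u0 = u0 U ; u1 = trans (u1 U) (trans (cong (r +_) (*-zeroʳ T)) (+-identityʳ r)) ; u7 = u7 U ; u8 = u8 U
      ; copyAbove = cpy ; copyUpToZero = λ c l → copyUpToZero U c (≤-trans l (n≤1+n k)) ; tableRegionZero′ = tableRegionZero′ U })))
    where
      cpy : ∀ c → k < c → c < Z → update m 6 T (Z + c) ≡ init c
      cpy c l lz with m≤n⇒m<n∨m≡n l
      ... | inj₁ l' = copyAbove U c l' lz
      ... | inj₂ refl = trans (copyUpToZero U (suc k) ≤-refl) (sym ib)
  unpack-stage p k T true r m f0 f1 f2 f3 f4 f5 T16 k5 rT ib b U =
    stepConst b f0 (word≤31 T (≤-trans T16 (m≤m+n 16 15))) λ b1 →
    stepJltNotTaken b1 f1 (λ l → <-irrefl refl (≤-<-trans (≤-trans (m≤n+m T r) (≤-reflexive (cong (r +_) (sym (*-identityʳ T))))) (subst (_< T) (u1 U) l))) (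
    stepConst b1 f2 (word≤31 (suc k) (≤-trans k5 (m≤m+n 5 26))) λ b2 →
    stepAdd (Z + suc k) b2 f3 (cong (_+ suc k) (u7 U)) (word≤2Z (+-monoʳ-≤ Z (≤-trans k5 (≤-trans (m≤m+n 5 11) 16≤Z)))) λ b3 →
    stepStore (Z + suc k) 1 b3 f4 refl (u8 U) λ b4 →
    stepSub r b4 f5 (trans (cong (_∸ T) (trans (u1 U) (cong (r +_) (*-identityʳ T)))) (m+n∸n≡m r T)) λ b5 →
    arrive b5 (record
      { u0 = u0 U ; u1 = refl ; u7 = u7 U ; u8 = u8 U
      ; copyAbove = cpy ; copyUpToZero = lo ; tableRegionZero′ = hi })
    )
    where
      m3 : Memory
      m3 = update (update (update m 6 T) 9 (suc k)) 9 (Z + suc k)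
      cpy : ∀ c → k < c → c < Z → update m3 (Z + suc k) 1 (Z + c) ≡ init c
      cpy c l lz with m≤n⇒m<n∨m≡n l
      ... | inj₁ l' = trans (update-other m3 (Z + suc k) 1 (Z + c) (Z+-≢ (>⇒≢ l'))) (copyAbove U c l' lz)
      ... | inj₂ refl = trans (update-same m3 (Z + suc k) 1) (sym ib)
      lo : ∀ c → c ≤ k → update m3 (Z + suc k) 1 (Z + c) ≡ 0
      lo c l = trans (update-other m3 (Z + suc k) 1 (Z + c) (Z+-≢ (<⇒≢ (s≤s l)))) (copyUpToZero U c (≤-trans l (n≤1+n k)))
      hi : ∀ a → update m3 (Z + suc k) 1 (Z + (Z + a)) ≡ 0
      hi a = trans (update-other m3 (Z + suc k) 1 (Z + (Z + a)) (Z+-≢ (>⇒≢ (≤-trans (s≤s k5) (≤-trans (m≤m+n 6 10) (≤-trans 16≤Z (m≤m+n Z a))))))) (tableRegionZero′ U a)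

  β : ℕ → Bool
  β k = inputBit M k

  R0 R1 R2 R3 R4 R5 : ℕ
  R0 = 0
  R1 = R0 + 1 * bit (β 0)
  R2 = R1 + 2 * bit (β 1)
  R3 = R2 + 4 * bit (β 2)
  R4 = R3 + 8 * bit (β 3)
  R5 = R4 + 16 * bit (β 4)

  horner-5bits : ∀ x₁ x₂ x₃ x₄ x₅ →
    x₁ + ((x₂ + ((x₃ + ((x₄ + (x₅ + x₅)) + (x₄ + (x₅ + x₅)))) + (x₃ + ((x₄ + (x₅ + x₅)) + (x₄ + (x₅ + x₅)))))) + (x₂ + ((x₃ + ((x₄ + (x₅ + x₅)) + (x₄ + (x₅ + x₅)))) + (x₃ + ((x₄ + (x₅ + x₅)) + (x₄ + (x₅ + x₅)))))))
    ≡ 0 + 1 * x₁ + 2 * x₂ + 4 * x₃ + 8 * x₄ + 16 * x₅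
  horner-5bits = solve 5 (λ x₁ x₂ x₃ x₄ x₅ →
    x₁ :+ ((x₂ :+ ((x₃ :+ ((x₄ :+ (x₅ :+ x₅)) :+ (x₄ :+ (x₅ :+ x₅)))) :+ (x₃ :+ ((x₄ :+ (x₅ :+ x₅)) :+ (x₄ :+ (x₅ :+ x₅)))))) :+ (x₂ :+ ((x₃ :+ ((x₄ :+ (x₅ :+ x₅)) :+ (x₄ :+ (x₅ :+ x₅)))) :+ (x₃ :+ ((x₄ :+ (x₅ :+ x₅)) :+ (x₄ :+ (x₅ :+ x₅)))))))
    := con 0 :+ con 1 :* x₁ :+ con 2 :* x₂ :+ con 4 :* x₃ :+ con 8 :* x₄ :+ con 16 :* x₅) refl

  packed≡R5 : packed ≡ R5
  packed≡R5 rewrite initMemory-input M 0 | initMemory-input M 1 | initMemory-input M 2 | initMemory-input M 3 | initMemory-input M 4 = horner-5bits (bit (β 0)) (bit (β 1)) (bit (β 2)) (bit (β 3)) (bit (β 4))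

  unpack-bound : ∀ r T b → r < T → r + T * bit b < T + T
  unpack-bound r T b lt = +-mono-<-≤ lt (≤-trans (*-monoʳ-≤ T (bit≤1 b)) (≤-reflexive (*-identityʳ T)))

  R0< : R0 < 1
  R0< = s≤s z≤n
  R1< : R1 < 2
  R1< = unpack-bound R0 1 (β 0) R0<
  R2< : R2 < 4
  R2< = unpack-bound R1 2 (β 1) R1<
  R3< : R3 < 8
  R3< = unpack-bound R2 4 (β 2) R2<
  R4< : R4 < 16
  R4< = unpack-bound R3 8 (β 3) R3<

  unpack-setup : ∀ m → Bounded m → Copied m → Reaches (config 26 m) (At 32 (UnpackInv 5 R5)) 6
  unpack-setup m b P =
    stepConst b refl (word≤31 5 (m≤m+n 5 26)) λ b1 →
    stepAdd (5 + n) b1 refl (cong (5 +_) (q0 P)) (word≤Z (≤-trans (m≤m*n (5 + n) (5 + n)) (m≤n+m W 16))) λ b2 →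
    stepMul W b2 refl refl (word≤Z (m≤n+m W 16)) λ b3 →
    stepConst b3 refl (word≤31 16 (m≤m+n 16 15)) λ b4 →
    stepAdd Z b4 refl refl (word≤Z ≤-refl) λ b5 →
    stepConst b5 refl (word≤31 1 (m≤m+n 1 30)) λ b6 →
    arrive b6 (record
      { u0 = q0 P ; u1 = trans (q1 P) packed≡R5 ; u7 = refl ; u8 = refl
      ; copyAbove = cpy ; copyUpToZero = λ c l → copyLowZero P c (s≤s l) ; tableRegionZero′ = tableRegionZero P })
    where
      cpy : ∀ c → 5 < c → c < Z → m (Z + c) ≡ init c
      cpy c l lz with m+[n∸m]≡n {6} {c} l
      ... | e = subst (λ z → m (Z + z) ≡ init z) e (copyOfInput P (c ∸ 6) (subst (_< Z) (sym e) lz))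

  unpackLowBits : ∀ m → Bounded m → Copied m → Reaches (config 26 m) (At 62 (UnpackInv 0 R0)) (6 + (6 + (6 + (6 + (6 + 6)))))
  unpackLowBits m b P =
    thenAt (unpack-setup m b P) λ m b U →
    thenAt (unpack-stage 32 4 16 (β 4) R4 m refl refl refl refl refl refl ≤-refl (s≤s (s≤s (s≤s (s≤s (s≤s z≤n))))) R4< (initMemory-input M 4) b U) λ m b U →
    thenAt (unpack-stage 38 3 8 (β 3) R3 m refl refl refl refl refl refl (m≤m+n 8 8) (s≤s (s≤s (s≤s (s≤s z≤n)))) R3< (initMemory-input M 3) b U) λ m b U →
    thenAt (unpack-stage 44 2 4 (β 2) R2 m refl refl refl refl refl refl (m≤m+n 4 12) (s≤s (s≤s (s≤s z≤n))) R2< (initMemory-input M 2) b U) λ m b U →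
    thenAt (unpack-stage 50 1 2 (β 1) R1 m refl refl refl refl refl refl (m≤m+n 2 14) (s≤s (s≤s z≤n)) R1< (initMemory-input M 1) b U) λ m b U →
    unpack-stage 56 0 1 (β 0) R0 m refl refl refl refl refl refl (m≤m+n 1 15) (s≤s z≤n) R0< (initMemory-input M 0) b U

module FillEndTable {n : ℕ} (M : Matrix n) where
  open UnpackLowBits M public

  tableAddr : ℕ → ℕ → ℕ
  tableAddr r l = Z + (Z + (r * n + l))

  2Z+-≢ : ∀ {a b} → a ≢ b → Z + (Z + a) ≢ Z + (Z + b)
  2Z+-≢ ne e = ne (+-cancelˡ-≡ Z _ _ (+-cancelˡ-≡ Z _ _ e))

  rowMajor-< : ∀ r r' l l' → r < r' → l < n → r * n + l < r' * n + l'
  rowMajor-< r r' l l' lt ln = ≤-trans (+-monoʳ-< (r * n) ln) (≤-trans (≤-reflexive (+-comm (r * n) n)) (≤-trans (*-monoˡ-≤ n lt) (m≤m+n (r' * n) l')))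

  rowMajor-injective : ∀ r r' l l' → l < n → l' < n → r * n + l ≡ r' * n + l' → r ≡ r' × l ≡ l'
  rowMajor-injective r r' l l' ln ln' e with <-cmp r r'
  ... | tri< lt _ _ = ⊥-elim (<-irrefl e (rowMajor-< r r' l l' lt ln))
  ... | tri> _ _ gt = ⊥-elim (<-irrefl (sym e) (rowMajor-< r' r l' l gt ln'))
  ... | tri≈ _ refl _ = refl , +-cancelˡ-≡ (r * n) _ _ e

  rowMajor≤W : ∀ r l → r ≤ suc n → l ≤ n → r * n + l ≤ W
  rowMajor≤W r l rl ll = begin
      r * n + l ≤⟨ +-mono-≤ (*-monoˡ-≤ n rl) ll ⟩
      suc n * n + n ≡⟨ +-comm (suc n * n) n ⟩
      (2 + n) * n ≤⟨ *-mono-≤ (+-monoˡ-≤ n {2} {5} (s≤s (s≤s z≤n))) (m≤n+m n 5) ⟩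
      W ∎
    where open ≤-Reasoning

  rowMajor<Z : ∀ r l → r ≤ suc n → l ≤ n → r * n + l < Z
  rowMajor<Z r l rl ll = ≤-<-trans (rowMajor≤W r l rl ll) (m<n+m W {16} (s≤s z≤n))

  record TableInv (i : ℕ) (m : Memory) : Set where
    field
      k0 : m 0 ≡ n
      k1 : m 1 ≡ 0
      k2 : m 2 ≡ 1
      k3 : m 3 ≡ Z
      k4 : m 4 ≡ i
      k5 : m 5 ≡ Z + (1 + i * n)
      k6 : m 6 ≡ Z + (Z + suc i * n)
      copyIntact : ∀ b → 0 < b → b < Z → m (Z + b) ≡ init b
      rowsDone : ∀ r l → 0 < r → r ≤ i → l < n → m (tableAddr r l) ≡ endTable r l
      sentinelRow : ∀ l → l < n → m (tableAddr 0 l) ≡ 0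
      beyondTableZero : ∀ a → m (Z + (Z + (suc n * n + a))) ≡ 0
  open TableInv public

  record TableRowInv (i x : ℕ) (m : Memory) : Set where
    field
      tableInv : TableInv i m
      k7 : m 7 ≡ n ∸ x
      k8 : m 8 ≡ zeroScan i x
      rowSuffixDone : ∀ l → n ∸ x ≤ l → l < n → m (tableAddr (suc i) l) ≡ endTable (suc i) l
  open TableRowInv public

  table-setup : ∀ m → Bounded m → UnpackInv 0 R0 m → Reaches (config 62 m) (At 73 (TableInv 0)) 11
  table-setup m b U =
    stepConst b refl (word≤31 0 z≤n) λ b1 →
    stepConst b1 refl (word≤31 1 (m≤m+n 1 30)) λ b2 →
    stepConst b2 refl (word≤31 5 (m≤m+n 5 26)) λ b3 →
    stepAdd (5 + n) b3 refl (cong (5 +_) (u0 U)) (word≤Z (≤-trans (m≤m*n (5 + n) (5 + n)) (m≤n+m W 16))) λ b4 →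
    stepMul W b4 refl refl (word≤Z (m≤n+m W 16)) λ b5 →
    stepConst b5 refl (word≤31 16 (m≤m+n 16 15)) λ b6 →
    stepAdd Z b6 refl refl (word≤Z ≤-refl) λ b7 →
    stepConst b7 refl (word≤31 0 z≤n) λ b8 →
    stepAdd (Z + (1 + 0 * n)) b8 refl refl (word≤2Z (+-monoʳ-≤ Z (≤-trans (m≤m+n 1 15) 16≤Z))) λ b9 →
    stepAdd (Z + Z) b9 refl refl (word≤2Z ≤-refl) λ b10 →
    stepAdd (Z + (Z + 1 * n)) b10 refl (trans (cong (Z + Z +_) (u0 U)) (trans (+-assoc Z Z n) (cong (λ z → Z + (Z + z)) (sym (+-identityʳ n))))) (word≤3Z (+-monoʳ-≤ Z (+-monoʳ-≤ Z (≤-trans (m≤m+n (1 * n) 0) (<⇒≤ (rowMajor<Z 1 0 (s≤s z≤n) z≤n)))))) λ b11 →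
    arrive b11 (record
      { k0 = u0 U ; k1 = refl ; k2 = refl ; k3 = refl ; k4 = refl ; k5 = refl ; k6 = refl
      ; copyIntact = λ c l lz → copyAbove U c l lz
      ; rowsDone = λ r l p q _ → ⊥-elim (<-irrefl refl (<-≤-trans p q))
      ; sentinelRow = λ l _ → tableRegionZero′ U l
      ; beyondTableZero = λ a → tableRegionZero′ U (suc n * n + a) })

  n∸x∸1≡ : ∀ x → n ∸ x ∸ 1 ≡ n ∸ suc x
  n∸x∸1≡ x = trans (∸-+-assoc n x 1) (cong (n ∸_) (+-comm x 1))

  n∸[n∸1+x]≡ : ∀ x → x < n → n ∸ (n ∸ suc x) ≡ suc x
  n∸[n∸1+x]≡ x lt = m∸[m∸n]≡n lt

  cellOffset<Z : ∀ i j → i < n → j < n → 1 + (i * n + j) < Z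
  cellOffset<Z i j il jl = ≤-<-trans (≤-trans (+-monoʳ-< (i * n) jl) (≤-reflexive (trans (+-comm (i * n) n) (sym (+-identityʳ _))))) (rowMajor<Z (suc i) 0 (s≤s (<⇒≤ il)) z≤n)

  copy-cell : ∀ {m : Memory} i j → i < n → j < n → (∀ b → 0 < b → b < Z → m (Z + b) ≡ init b) → m (Z + (1 + (i * n + j))) ≡ bit (cell i j)
  copy-cell {m} i j il jl copy = trans (copy (1 + (i * n + j)) (s≤s z≤n) (cellOffset<Z i j il jl)) (initMemory-cell M i j il jl)

  tableRowInv-after : ∀ {i x j m} mR v → i < n → x < n → n ∸ suc x ≡ j → TableRowInv i x m →
     (∀ b → mR (Z + b) ≡ m (Z + b)) → mR 0 ≡ m 0 → mR 1 ≡ m 1 → mR 2 ≡ m 2 → mR 3 ≡ m 3 → mR 4 ≡ m 4 → mR 5 ≡ m 5 → mR 6 ≡ m 6 →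
     mR 7 ≡ j → mR 8 ≡ zeroScan i (suc x) → v ≡ endTable (suc i) j → TableRowInv i (suc x) (update mR (tableAddr (suc i) j) v)
  tableRowInv-after {i} {x} {j} {m} mR v il xl jx I hZ h0 h1 h2 h3 h4 h5 h6 h7 h8 hv = record
    { tableInv = record
      { k0 = trans h0 (k0 (tableInv I)) ; k1 = trans h1 (k1 (tableInv I)) ; k2 = trans h2 (k2 (tableInv I)) ; k3 = trans h3 (k3 (tableInv I))
      ; k4 = trans h4 (k4 (tableInv I)) ; k5 = trans h5 (k5 (tableInv I)) ; k6 = trans h6 (k6 (tableInv I))
      ; copyIntact = λ b p q → trans (update-other mR W0 v (Z + b) (Z+-≢ (<⇒≢ (<-≤-trans q (m≤m+n Z _))))) (trans (hZ b) (copyIntact (tableInv I) b p q))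
      ; rowsDone = λ r l p q ln → trans (update-other mR W0 v (tableAddr r l) (2Z+-≢ (<⇒≢ (rowMajor-< r (suc i) l j (s≤s q) ln)))) (trans (hZ _) (rowsDone (tableInv I) r l p q ln))
      ; sentinelRow = λ l ln → trans (update-other mR W0 v (tableAddr 0 l) (2Z+-≢ (<⇒≢ (rowMajor-< 0 (suc i) l j (s≤s z≤n) ln)))) (trans (hZ _) (sentinelRow (tableInv I) l ln))
      ; beyondTableZero = λ a → trans (update-other mR W0 v _ (2Z+-≢ (>⇒≢ (≤-trans (rowMajor-< (suc i) (suc n) j a (s≤s il) jn) ≤-refl)))) (trans (hZ _) (beyondTableZero (tableInv I) a)) }
    ; k7 = trans h7 (sym jx)
    ; k8 = h8
    ; rowSuffixDone = cur }
    where
      W0 : ℕ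
      W0 = tableAddr (suc i) j
      jn : j < n
      jn = subst (_< n) jx (∸-monoʳ-< z<s xl)
      cur : ∀ l → n ∸ suc x ≤ l → l < n → update mR W0 v (tableAddr (suc i) l) ≡ endTable (suc i) l
      cur l p q with m≤n⇒m<n∨m≡n (subst (_≤ l) jx p)
      ... | inj₂ refl = trans (update-same mR W0 v) hv
      ... | inj₁ lt = trans (update-other mR W0 v (tableAddr (suc i) l) (2Z+-≢ (λ e → <-irrefl (sym (proj₂ (rowMajor-injective (suc i) (suc i) l j q jn e))) lt)))
                        (trans (hZ _) (rowSuffixDone I l (subst (_≤ l) (trans (sym (cong suc jx)) (sym (+-∸-assoc 1 xl))) lt) q))

  cellAddr-word : ∀ i j → i < n → j < n → Z + (1 + (i * n + j)) < B
  cellAddr-word i j il jl = word≤2Z (+-monoʳ-≤ Z (<⇒≤ (cellOffset<Z i j il jl)))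

  tableAddr-word : ∀ r l → r ≤ suc n → l ≤ n → tableAddr r l < B
  tableAddr-word r l rl ll = word≤3Z (+-monoʳ-≤ Z (+-monoʳ-≤ Z (<⇒≤ (rowMajor<Z r l rl ll))))

  rowBase+j : ∀ {m : Memory} i j → m 6 ≡ Z + (Z + suc i * n) → m 6 + j ≡ tableAddr (suc i) j
  rowBase+j i j e = trans (cong (_+ j) e) (trans (+-assoc Z (Z + suc i * n) j) (cong (Z +_) (+-assoc Z (suc i * n) j)))

  module TableColumnStep (i x : ℕ) (m : Memory) (il : i < n) (xl : x < n) (b : Bounded m) (I : TableRowInv i x m) where
    inv : TableInv i m
    inv = tableInv I

    col<n : ∀ j → n ∸ suc x ≡ j → j < n
    col<n j jx = subst (_< n) jx (∸-monoʳ-< z<s xl)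
    n∸col≡ : ∀ j → n ∸ suc x ≡ j → n ∸ j ≡ suc x
    n∸col≡ j jx = trans (cong (n ∸_) (sym jx)) (n∸[n∸1+x]≡ x xl)
    zeroScan-step : ∀ j → n ∸ suc x ≡ j → zeroScan i (suc x) ≡ (if cell i j then zeroScan i x else j)
    zeroScan-step j jx = cong (λ z → if cell i z then zeroScan i x else z) jx
    reg7∸reg2≡col : ∀ j → n ∸ suc x ≡ j → m 7 ∸ m 2 ≡ j
    reg7∸reg2≡col j jx = trans (cong₂ _∸_ (k7 I) (k2 inv)) (trans (n∸x∸1≡ x) jx)
    reg1<reg7 : m 1 < m 7
    reg1<reg7 = subst₂ _<_ (sym (k1 inv)) (sym (k7 I)) (m<n⇒0<n∸m xl)
    cellAddr≡ : ∀ j → m 5 + j ≡ Z + (1 + (i * n + j))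
    cellAddr≡ j = trans (cong (_+ j) (k5 inv)) (+-assoc Z (1 + i * n) j)
    tableAddr-word₁ : ∀ l → l < n → tableAddr (suc i) l < B
    tableAddr-word₁ l ll = tableAddr-word (suc i) l (s≤s (<⇒≤ il)) (<⇒≤ ll)
    endTable-start : ∀ l → runStart i l ≡ true → endTable (suc i) l ≡ zeroScan i (n ∸ l)
    endTable-start l se = trans (endTable-row i l il) (cong (λ s → if s then zeroScan i (n ∸ l) else 0) se)
    endTable-noStart : ∀ l → runStart i l ≡ false → endTable (suc i) l ≡ 0
    endTable-noStart l se = trans (endTable-row i l il) (cong (λ s → if s then zeroScan i (n ∸ l) else 0) se)

    zeroCell : ∀ j → n ∸ suc x ≡ j → cell i j ≡ false → Reaches (config 77 m) (At 77 (TableRowInv i (suc x))) 13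
    zeroCell j jx ce =
          stepJltTaken b refl reg1<reg7 (
          stepSub j b refl (reg7∸reg2≡col j jx) λ b1 →
          stepAdd (Z + (1 + (i * n + j))) b1 refl (cellAddr≡ j) (cellAddr-word i j il jn) λ b2 →
          stepLoad (bit (cell i j)) b2 refl (copy-cell {m} i j il jn (copyIntact inv)) λ b3 →
          stepJltNotTaken b3 refl (λ l → n≮0 (subst (λ z → m 1 < bit z) ce l)) (
          stepAdd j b3 refl (trans (cong (j +_) (k1 inv)) (+-identityʳ j)) (word≤Z (<⇒≤ (<-trans jn n<Z))) λ b4 →
          reach-mono {T = 4} (s≤s (s≤s (s≤s (s≤s z≤n)))) (stepJmp b4 refl (
          stepAdd (tableAddr (suc i) j) b4 refl (rowBase+j {m} i j (k6 inv)) (tableAddr-word₁ j jn) λ b5 →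
          stepStore (tableAddr (suc i) j) 0 b5 refl refl (k1 inv) λ b6 →
          stepJmp b6 refl (arrive b6 (tableRowInv-after _ 0 il xl jx I (λ _ → refl) refl refl refl refl refl refl refl refl
                (sym (trans (zeroScan-step j jx) (cong (λ c → if c then zeroScan i x else j) ce)))
                (sym (endTable-noStart j (runStart-of-zero i j ce)))))))))
      where
        jn : j < n
        jn = col<n j jx

    runStartAtZero : n ∸ suc x ≡ 0 → cell i 0 ≡ true → Reaches (config 77 m) (At 77 (TableRowInv i (suc x))) 13
    runStartAtZero jx ce = reach-mono {T = 10} (m≤m+n 10 3) (
          stepJltTaken b refl reg1<reg7 (
          stepSub zero b refl (reg7∸reg2≡col zero jx) λ b1 →
          stepAdd (Z + (1 + (i * n + 0))) b1 refl (cellAddr≡ 0) (cellAddr-word i 0 il jn) λ b2 →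
          stepLoad (bit (cell i 0)) b2 refl (copy-cell {m} i 0 il jn (copyIntact inv)) λ b3 →
          stepJltTaken b3 refl (subst (λ z → m 1 < bit z) (sym ce) (subst (_< 1) (sym (k1 inv)) (s≤s z≤n))) (
          stepJltNotTaken b3 refl (λ l → n≮0 l) (
          stepJmp b3 refl (
          stepAdd (tableAddr (suc i) 0) b3 refl (rowBase+j {m} i 0 (k6 inv)) (tableAddr-word₁ 0 jn) λ b4 →
          stepStore (tableAddr (suc i) 0) (zeroScan i x) b4 refl refl (k8 I) λ b5 →
          stepJmp b5 refl (arrive b5 (tableRowInv-after _ (zeroScan i x) il xl jx I (λ _ → refl) refl refl refl refl refl refl refl refl
             (trans (k8 I) (sym evt)) (sym (trans (endTable-start 0 ce) (trans (cong (zeroScan i) (n∸col≡ 0 jx)) evt))))))))))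
      where
        jn : 0 < n
        jn = col<n 0 jx
        evt : zeroScan i (suc x) ≡ zeroScan i x
        evt = trans (zeroScan-step 0 jx) (cong (λ c → if c then zeroScan i x else 0) ce)
    insideRun : ∀ j → n ∸ suc x ≡ suc j → cell i (suc j) ≡ true → cell i j ≡ true → Reaches (config 77 m) (At 77 (TableRowInv i (suc x))) 13
    insideRun j jx ce ce′ =
          stepJltTaken b refl reg1<reg7 (
          stepSub (suc j) b refl (reg7∸reg2≡col (suc j) jx) λ b1 →
          stepAdd (Z + (1 + (i * n + suc j))) b1 refl (cellAddr≡ (suc j)) (cellAddr-word i (suc j) il jn) λ b2 →
          stepLoad (bit (cell i (suc j))) b2 refl (copy-cell {m} i (suc j) il jn (copyIntact inv)) λ b3 →
          stepJltTaken b3 refl (subst (λ z → m 1 < bit z) (sym ce) (subst (_< 1) (sym (k1 inv)) (s≤s z≤n))) (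
          stepJltTaken b3 refl (subst (_< suc j) (sym (k1 inv)) (s≤s z≤n)) (
          stepAdd (Z + (1 + (i * n + suc j))) b3 refl (cellAddr≡ (suc j)) (cellAddr-word i (suc j) il jn) λ b4 →
          stepSub (Z + (1 + (i * n + j))) b4 refl eS λ b5 →
          stepLoad (bit (cell i j)) b5 refl (copy-cell {m} i j il jn′ (copyIntact inv)) λ b6 →
          stepJltTaken b6 refl (subst (λ z → m 1 < bit z) (sym ce′) (subst (_< 1) (sym (k1 inv)) (s≤s z≤n))) (
          stepAdd (tableAddr (suc i) (suc j)) b6 refl (rowBase+j {m} i (suc j) (k6 inv)) (tableAddr-word₁ (suc j) jn) λ b7 →
          stepStore (tableAddr (suc i) (suc j)) 0 b7 refl refl (k1 inv) λ b8 →
          stepJmp b8 refl (arrive b8 (tableRowInv-after _ 0 il xl jx I (λ _ → refl) refl refl refl refl refl refl refl refl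
             (trans (k8 I) (sym evt)) (sym (endTable-noStart (suc j) sF))))))))
      where
        jn : suc j < n
        jn = col<n (suc j) jx
        jn′ : j < n
        jn′ = <-trans ≤-refl jn
        evt : zeroScan i (suc x) ≡ zeroScan i x
        evt = trans (zeroScan-step (suc j) jx) (cong (λ c → if c then zeroScan i x else suc j) ce)
        eS : (Z + (1 + (i * n + suc j))) ∸ m 2 ≡ Z + (1 + (i * n + j))
        eS = trans (cong (λ z → (Z + (1 + (i * n + suc j))) ∸ z) (k2 inv)) (cong (_∸ 1) (trans (cong (λ z → Z + (1 + z)) (+-suc (i * n) j)) (+-suc Z (1 + (i * n + j)))))
        sF : runStart i (suc j) ≡ false
        sF = cong₂ (λ a c → a ∧ not c) ce ce′
    runStartAfterZero : ∀ j → n ∸ suc x ≡ suc j → cell i (suc j) ≡ true → cell i j ≡ false → Reaches (config 77 m) (At 77 (TableRowInv i (suc x))) 13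
    runStartAfterZero j jx ce ce′ =
          stepJltTaken b refl reg1<reg7 (
          stepSub (suc j) b refl (reg7∸reg2≡col (suc j) jx) λ b1 →
          stepAdd (Z + (1 + (i * n + suc j))) b1 refl (cellAddr≡ (suc j)) (cellAddr-word i (suc j) il jn) λ b2 →
          stepLoad (bit (cell i (suc j))) b2 refl (copy-cell {m} i (suc j) il jn (copyIntact inv)) λ b3 →
          stepJltTaken b3 refl (subst (λ z → m 1 < bit z) (sym ce) (subst (_< 1) (sym (k1 inv)) (s≤s z≤n))) (
          stepJltTaken b3 refl (subst (_< suc j) (sym (k1 inv)) (s≤s z≤n)) (
          stepAdd (Z + (1 + (i * n + suc j))) b3 refl (cellAddr≡ (suc j)) (cellAddr-word i (suc j) il jn) λ b4 →
          stepSub (Z + (1 + (i * n + j))) b4 refl eS λ b5 →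
          stepLoad (bit (cell i j)) b5 refl (copy-cell {m} i j il jn′ (copyIntact inv)) λ b6 →
          stepJltNotTaken b6 refl (λ l → n≮0 (subst (λ z → m 1 < bit z) ce′ l)) (
          stepAdd (tableAddr (suc i) (suc j)) b6 refl (rowBase+j {m} i (suc j) (k6 inv)) (tableAddr-word₁ (suc j) jn) λ b7 →
          stepStore (tableAddr (suc i) (suc j)) (zeroScan i x) b7 refl refl (k8 I) λ b8 →
          stepJmp b8 refl (arrive b8 (tableRowInv-after _ (zeroScan i x) il xl jx I (λ _ → refl) refl refl refl refl refl refl refl refl
             (trans (k8 I) (sym evt)) (sym (trans (endTable-start (suc j) sT) (trans (cong (zeroScan i) (n∸col≡ (suc j) jx)) evt)))))))))
      where
        jn : suc j < n
        jn = col<n (suc j) jx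
        jn′ : j < n
        jn′ = <-trans ≤-refl jn
        evt : zeroScan i (suc x) ≡ zeroScan i x
        evt = trans (zeroScan-step (suc j) jx) (cong (λ c → if c then zeroScan i x else suc j) ce)
        eS : (Z + (1 + (i * n + suc j))) ∸ m 2 ≡ Z + (1 + (i * n + j))
        eS = trans (cong (λ z → (Z + (1 + (i * n + suc j))) ∸ z) (k2 inv)) (cong (_∸ 1) (trans (cong (λ z → Z + (1 + z)) (+-suc (i * n) j)) (+-suc Z (1 + (i * n + j)))))
        sT : runStart i (suc j) ≡ true
        sT = cong₂ (λ a c → a ∧ not c) ce ce′

    column : ∀ j → n ∸ suc x ≡ j → Reaches (config 77 m) (At 77 (TableRowInv i (suc x))) 13
    column j jx with cell i j in ce
    column j       jx | false = zeroCell j jx ce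
    column zero    jx | true  = runStartAtZero jx ce
    column (suc j) jx | true with cell i j in ce′
    ... | true  = insideRun j jx ce ce′
    ... | false = runStartAfterZero j jx ce ce′

  table-colStep : ∀ i x m → i < n → x < n → Bounded m → TableRowInv i x m → Reaches (config 77 m) (At 77 (TableRowInv i (suc x))) 13
  table-colStep i x m il xl b I = TableColumnStep.column i x m il xl b I (n ∸ suc x) refl

  tableInv-frame : ∀ {i m m'} → (∀ b → m' (Z + b) ≡ m (Z + b)) → m' 0 ≡ m 0 → m' 1 ≡ m 1 → m' 2 ≡ m 2 → m' 3 ≡ m 3 → m' 4 ≡ m 4 → m' 5 ≡ m 5 → m' 6 ≡ m 6 → TableInv i m → TableInv i m'
  tableInv-frame hZ h0 h1 h2 h3 h4 h5 h6 inv = record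
    { k0 = trans h0 (k0 inv) ; k1 = trans h1 (k1 inv) ; k2 = trans h2 (k2 inv) ; k3 = trans h3 (k3 inv) ; k4 = trans h4 (k4 inv)
    ; k5 = trans h5 (k5 inv) ; k6 = trans h6 (k6 inv)
    ; copyIntact = λ b p q → trans (hZ b) (copyIntact inv b p q)
    ; rowsDone = λ r l p q ln → trans (hZ _) (rowsDone inv r l p q ln)
    ; sentinelRow = λ l ln → trans (hZ _) (sentinelRow inv l ln)
    ; beyondTableZero = λ a → trans (hZ _) (beyondTableZero inv a) }

  table-rowStep : ∀ i m → i < n → Bounded m → TableInv i m → Reaches (config 73 m) (At 73 (TableInv (suc i))) (3 + (n * 13 + 6))
  table-rowStep i m il b inv =
    stepJltTaken b refl (subst₂ _<_ (sym (k4 inv)) (sym (k0 inv)) il) (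
    stepAdd n b refl (trans (cong₂ _+_ (k0 inv) (k1 inv)) (+-identityʳ n)) (word≤Z (<⇒≤ n<Z)) λ b1 →
    stepAdd n b1 refl (trans (cong₂ _+_ (k0 inv) (k1 inv)) (+-identityʳ n)) (word≤Z (<⇒≤ n<Z)) λ b2 →
    thenAt (loopAt 77 (TableRowInv i) n 13 (λ x m xl b I → table-colStep i x m il xl b I) _ b2
      (record { tableInv = tableInv-frame (λ _ → refl) refl refl refl refl refl refl refl inv ; k7 = refl ; k8 = refl ; rowSuffixDone = λ l p q → ⊥-elim (<-irrefl refl (<-≤-trans q p)) })) λ m3 b3 I3 →
    stepJltNotTaken b3 refl (λ l → <-irrefl refl (subst₂ _<_ (k1 (tableInv I3)) (trans (k7 I3) (n∸n≡0 n)) l)) (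
    stepJmp b3 refl (
    stepAdd (suc i) b3 refl (trans (cong₂ _+_ (k4 (tableInv I3)) (k2 (tableInv I3))) (+-comm i 1)) (word≤Z (≤-trans il (<⇒≤ n<Z))) λ b4 →
    stepAdd (Z + (1 + suc i * n)) b4 refl (e5 (k5 (tableInv I3)) (k0 (tableInv I3))) (word≤2Z (+-monoʳ-≤ Z b5')) λ b5 →
    stepAdd (Z + (Z + suc (suc i) * n)) b5 refl (e6 (k6 (tableInv I3)) (k0 (tableInv I3))) (word≤3Z (+-monoʳ-≤ Z (+-monoʳ-≤ Z b6'))) λ b6 →
    stepJmp b6 refl (arrive b6 (record
      { k0 = k0 (tableInv I3) ; k1 = k1 (tableInv I3) ; k2 = k2 (tableInv I3) ; k3 = k3 (tableInv I3) ; k4 = refl ; k5 = refl ; k6 = refl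
      ; copyIntact = copyIntact (tableInv I3)
      ; rowsDone = dn I3
      ; sentinelRow = sentinelRow (tableInv I3) ; beyondTableZero = beyondTableZero (tableInv I3) })))))
    where
      b5' : 1 + suc i * n ≤ Z
      b5' = subst (_≤ Z) (cong suc (+-identityʳ _)) (rowMajor<Z (suc i) 0 (s≤s (<⇒≤ il)) z≤n)
      b6' : suc (suc i) * n ≤ Z
      b6' = ≤-trans (m≤m+n _ 0) (<⇒≤ (rowMajor<Z (suc (suc i)) 0 (s≤s il) z≤n))
      e5 : ∀ {a c} → a ≡ Z + (1 + i * n) → c ≡ n → a + c ≡ Z + (1 + suc i * n)
      e5 p q = trans (cong₂ _+_ p q) (trans (+-assoc Z (1 + i * n) n) (cong (λ z → Z + suc z) (+-comm (i * n) n)))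
      e6 : ∀ {a c} → a ≡ Z + (Z + suc i * n) → c ≡ n → a + c ≡ Z + (Z + suc (suc i) * n)
      e6 p q = trans (cong₂ _+_ p q) (trans (+-assoc Z (Z + suc i * n) n) (cong (Z +_) (trans (+-assoc Z (suc i * n) n) (cong (Z +_) (+-comm (suc i * n) n)))))
      dn : ∀ {m} → TableRowInv i n m → ∀ r l → 0 < r → r ≤ suc i → l < n → m (tableAddr r l) ≡ endTable r l
      dn I r l p q ln with m≤n⇒m<n∨m≡n q
      ... | inj₁ lt = rowsDone (tableInv I) r l p (s≤s⁻¹ lt) ln
      ... | inj₂ refl = rowSuffixDone I l (subst (_≤ l) (sym (n∸n≡0 n)) z≤n) ln

  record TableFilled (m : Memory) : Set where
    field
      p0' : m 0 ≡ n
      p1' : m 1 ≡ 0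
      p2' : m 2 ≡ 1
      p3' : m 3 ≡ Z
      table : ∀ r l → r ≤ suc n → l < n → m (tableAddr r l) ≡ endTable r l
      beyondTableZero′ : ∀ a → m (Z + (Z + (suc n * n + a))) ≡ 0
  open TableFilled public

  table-exit : ∀ m → Bounded m → TableInv n m → Reaches (config 73 m) (At 101 TableFilled) 2
  table-exit m b inv = stepJltNotTaken b refl (λ l → <-irrefl refl (subst₂ _<_ (k4 inv) (k0 inv) l)) (stepJmp b refl (arrive b (record
    { p0' = k0 inv ; p1' = k1 inv ; p2' = k2 inv ; p3' = k3 inv ; table = kt ; beyondTableZero′ = beyondTableZero inv })))
    where
      kt : ∀ r l → r ≤ suc n → l < n → m (tableAddr r l) ≡ endTable r l
      kt zero l _ ln = sentinelRow inv l ln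
      kt (suc r) l rl ln with m≤n⇒m<n∨m≡n rl
      ... | inj₁ lt = rowsDone inv (suc r) l (s≤s z≤n) (s≤s⁻¹ lt) ln
      ... | inj₂ refl = trans (beyondTableZero inv l) (sym (endTable-lastSentinel l))

  fillEndTable : ∀ m → Bounded m → UnpackInv 0 R0 m → Reaches (config 62 m) (At 101 TableFilled) (11 + (n * (3 + (n * 13 + 6)) + 2))
  fillEndTable m b U = thenAt (table-setup m b U) λ m b inv → thenAt (loopAt 73 TableInv n (3 + (n * 13 + 6)) (λ i m il b inv → table-rowStep i m il b inv) m b inv) λ m b inv → table-exit m b inv

cong-rect : ∀ {a a′ b b′ c c′ d d′} → a ≡ a′ → b ≡ b′ → c ≡ c′ → d ≡ d′ → rect a b c d ≡ rect a′ b′ c′ d′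
cong-rect refl refl refl refl = refl

nth : List Rect → ℕ → Rect
nth [] _ = rect 0 0 0 0
nth (x ∷ xs) zero = x
nth (x ∷ xs) (suc t) = nth xs t

nth-++ˡ : ∀ L L' t → t < length L → nth (L ++ L') t ≡ nth L t
nth-++ˡ (x ∷ L) L' zero _ = refl
nth-++ˡ (x ∷ L) L' (suc t) (s≤s lt) = nth-++ˡ L L' t lt

nth-snoc : ∀ L r → nth (L ++ r ∷ []) (length L) ≡ r
nth-snoc [] r = refl
nth-snoc (x ∷ L) r = nth-snoc L r

module EmitBlocks {n : ℕ} (M : Matrix n) where
  open FillEndTable M public

  bottomAddr : ℕ → ℕ → ℕ
  bottomAddr r l = Z + (Z + (Z + (r * n + l)))

  outAddr : ℕ → ℕ
  outAddr a = Z + (Z + (Z + (Z + a)))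

  OutputImage : Memory → List Rect → Set
  OutputImage m L = ∀ t → t < length L → decodeRect (λ a → m (outAddr a)) t ≡ nth L t

  outputImage-frame : ∀ m m' L → OutputImage m L → (∀ a → 0 < a → a < 1 + 4 * length L → m' (outAddr a) ≡ m (outAddr a)) → OutputImage m' L
  outputImage-frame m m' L I h t lt = trans (cong-rect (h (1 + 4 * t) (s≤s z≤n) (f 0 z≤n)) (h (2 + 4 * t) (s≤s z≤n) (f 1 (s≤s z≤n))) (h (3 + 4 * t) (s≤s z≤n) (f 2 (s≤s (s≤s z≤n)))) (h (4 + 4 * t) (s≤s z≤n) (f 3 (s≤s (s≤s (s≤s z≤n)))))) (I t lt)
    where
      f : ∀ c → c ≤ 3 → suc c + 4 * t < 1 + 4 * length L
      f c c≤3 = s≤s (≤-trans (+-monoˡ-≤ (4 * t) (s≤s c≤3)) (≤-trans (≤-reflexive (sym (*-suc 4 t))) (*-monoʳ-≤ 4 lt)))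

  outputImage-snoc : ∀ m m' L r → OutputImage m L → (∀ a → 0 < a → a < 1 + 4 * length L → m' (outAddr a) ≡ m (outAddr a)) →
     m' (outAddr (1 + 4 * length L)) ≡ top r → m' (outAddr (2 + 4 * length L)) ≡ bot r →
     m' (outAddr (3 + 4 * length L)) ≡ left r → m' (outAddr (4 + 4 * length L)) ≡ right r → OutputImage m' (L ++ r ∷ [])
  outputImage-snoc m m' L r I h e1 e2 e3 e4 t lt with m≤n⇒m<n∨m≡n (s≤s⁻¹ (subst (t <_) (trans (length-++ L) (+-comm (length L) 1)) lt))
  ... | inj₁ lt' = trans (outputImage-frame m m' L I h t lt') (sym (nth-++ˡ L _ t lt'))
  ... | inj₂ refl = trans (cong-rect e1 e2 e3 e4) (sym (nth-snoc L r))

  3Z+-≢ : ∀ {a b} → a ≢ b → Z + (Z + (Z + a)) ≢ Z + (Z + (Z + b))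
  3Z+-≢ ne e = ne (+-cancelˡ-≡ Z _ _ (+-cancelˡ-≡ Z _ _ (+-cancelˡ-≡ Z _ _ e)))

  tableAddr≢bottomAddr : ∀ a b → a < Z → Z + (Z + a) ≢ Z + (Z + (Z + b))
  tableAddr≢bottomAddr a b lt = 2Z+-≢ (<⇒≢ (<-≤-trans lt (m≤m+n Z b)))

  bottomAddr≢outAddr : ∀ a b → a < Z → Z + (Z + (Z + a)) ≢ outAddr b
  bottomAddr≢outAddr a b lt = 3Z+-≢ (<⇒≢ (<-≤-trans lt (m≤m+n Z b)))

  outAddr-≢ : ∀ {a b} → a ≢ b → outAddr a ≢ outAddr b
  outAddr-≢ ne e = ne (+-cancelˡ-≡ Z _ _ (+-cancelˡ-≡ Z _ _ (+-cancelˡ-≡ Z _ _ (+-cancelˡ-≡ Z _ _ e))))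

  record BlockInv (x : ℕ) (m : Memory) : Set where
    field
      d0 : m 0 ≡ n
      d1 : m 1 ≡ 0
      d2 : m 2 ≡ 1
      d3 : m 3 ≡ Z
      d4 : m 4 ≡ n ∸ x
      d5 : m 5 ≡ Z + (Z + (n ∸ x) * n)
      d6 : m 6 ≡ (Z + (Z + (Z + (n ∸ x) * n))) ∸ n
      d14 : m 14 ≡ outAddr 0
      tableKept : ∀ r l → r ≤ suc n → l < n → m (tableAddr r l) ≡ endTable r l
      bottomsDone : ∀ y l → y ≤ x → l < n → m (bottomAddr (n ∸ y) l) ≡ bottomScan y l
  open BlockInv public

  record OutputSoFar (L : List Rect) (m : Memory) : Set where
    field
      d12 : m 12 ≡ outAddr (1 + 4 * length L)
      d13 : m 13 ≡ length L
      image : OutputImage m L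
  open OutputSoFar public

  record BlockColInv (x l : ℕ) (m : Memory) : Set where
    field
      blockInv : BlockInv x m
      outputSoFar : OutputSoFar (greedyRows x ++ rowRects x l) m
      d7 : m 7 ≡ l
      rowPrefixDone : ∀ l' → l' < l → m (bottomAddr (n ∸ suc x) l') ≡ bottomScan (suc x) l'
  open BlockColInv public

  record BottomStored (x l : ℕ) (m : Memory) : Set where
    field
      blockInv₁ : BlockInv x m
      outputSoFar₁ : OutputSoFar (greedyRows x ++ rowRects x l) m
      m7 : m 7 ≡ l
      m8 : m 8 ≡ endTable (suc (n ∸ suc x)) l
      m11 : m 11 ≡ bottomAddr (n ∸ suc x) l
      rowPrefixDone₁ : ∀ l' → l' ≤ l → m (bottomAddr (n ∸ suc x) l') ≡ bottomScan (suc x) l'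
  open BottomStored public

  record ColumnDone (x l : ℕ) (m : Memory) : Set where
    field
      blockInv₂ : BlockInv x m
      outputSoFar₂ : OutputSoFar ((greedyRows x ++ rowRects x l) ++ emitted x l) m
      e7 : m 7 ≡ l
      rowPrefixDone₂ : ∀ l' → l' ≤ l → m (bottomAddr (n ∸ suc x) l') ≡ bottomScan (suc x) l'
  open ColumnDone public

  tableAddr-nextRow : ∀ r l → tableAddr r l + n ≡ tableAddr (suc r) l
  tableAddr-nextRow r l = solve 4 (λ a b c d → (a :+ (a :+ (b :+ c))) :+ d := a :+ (a :+ ((d :+ b) :+ c))) refl Z (r * n) l n

  bottomAddr-nextRow : ∀ r l → bottomAddr r l + n ≡ bottomAddr (suc r) l
  bottomAddr-nextRow r l = solve 4 (λ a b c d → (a :+ (a :+ (a :+ (b :+ c)))) :+ d := a :+ (a :+ (a :+ ((d :+ b) :+ c)))) refl Z (r * n) l n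

  2Z+[n+c]∸n : ∀ c → (Z + (Z + (n + c))) ∸ n ≡ Z + (Z + c)
  2Z+[n+c]∸n c = trans (cong (_∸ n) (solve 3 (λ a b d → a :+ (a :+ (d :+ b)) := d :+ (a :+ (a :+ b))) refl Z c n)) (m+n∸m≡n n (Z + (Z + c)))

  3Z+[n+c]∸n : ∀ c → (Z + (Z + (Z + (n + c)))) ∸ n ≡ Z + (Z + (Z + c))
  3Z+[n+c]∸n c = trans (cong (_∸ n) (solve 3 (λ a b d → a :+ (a :+ (a :+ (d :+ b))) := d :+ (a :+ (a :+ (a :+ b)))) refl Z c n)) (m+n∸m≡n n (Z + (Z + (Z + c))))

  rowBase+l : ∀ {m : Memory} r l → m 5 ≡ Z + (Z + r * n) → m 5 + l ≡ tableAddr r l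
  rowBase+l r l e = trans (cong (_+ l) e) (trans (+-assoc Z (Z + r * n) l) (cong (Z +_) (+-assoc Z (r * n) l)))

  bottomRowBase+l : ∀ {a} r l → a ≡ Z + (Z + (Z + r * n)) → a + l ≡ bottomAddr r l
  bottomRowBase+l r l e = trans (cong (_+ l) e) (solve 4 (λ z b c d → (z :+ (z :+ (z :+ b))) :+ c := z :+ (z :+ (z :+ (b :+ c)))) refl Z (r * n) l 0)

  rl<Z : ∀ r l → r ≤ suc n → l < n → r * n + l < Z
  rl<Z r l rl ll = rowMajor<Z r l rl (<⇒≤ ll)

  tableAddr-word′ : ∀ r l → r ≤ suc n → l < n → tableAddr r l < B
  tableAddr-word′ r l rl ll = tableAddr-word r l rl (<⇒≤ ll)

  bottomAddr-word : ∀ r l → r ≤ suc n → l < n → bottomAddr r l < B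
  bottomAddr-word r l rl ll = word≤4Z (+-monoʳ-≤ Z (+-monoʳ-≤ Z (+-monoʳ-≤ Z (<⇒≤ (rl<Z r l rl ll)))))

  bottomStored-after : ∀ {x l m} mR v → x < n → l < n → BlockColInv x l m → (∀ b → mR (Z + b) ≡ m (Z + b)) →
    mR 0 ≡ m 0 → mR 1 ≡ m 1 → mR 2 ≡ m 2 → mR 3 ≡ m 3 → mR 4 ≡ m 4 → mR 5 ≡ m 5 → mR 6 ≡ m 6 → mR 7 ≡ m 7 →
    mR 12 ≡ m 12 → mR 13 ≡ m 13 → mR 14 ≡ m 14 →
    mR 8 ≡ endTable (suc (n ∸ suc x)) l → mR 11 ≡ bottomAddr (n ∸ suc x) l → v ≡ bottomScan (suc x) l →
    BottomStored x l (update mR (bottomAddr (n ∸ suc x) l) v)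
  bottomStored-after {x} {l} {m} mR v xl ll I hZ h0 h1 h2 h3 h4 h5 h6 h7 h12 h13 h14 h8 h11 hv = record
    { blockInv₁ = record
      { d0 = trans h0 (d0 D) ; d1 = trans h1 (d1 D) ; d2 = trans h2 (d2 D) ; d3 = trans h3 (d3 D)
      ; d4 = trans h4 (d4 D) ; d5 = trans h5 (d5 D) ; d6 = trans h6 (d6 D) ; d14 = trans h14 (d14 D)
      ; tableKept = λ r l' rl ll' → trans (update-other mR WA v (tableAddr r l') (tableAddr≢bottomAddr (r * n + l') (i * n + l) (rl<Z r l' rl ll'))) (trans (hZ _) (tableKept D r l' rl ll'))
      ; bottomsDone = λ y l' yx ll' → trans (update-other mR WA v (bottomAddr (n ∸ y) l') (3Z+-≢ (>⇒≢ (rowMajor-< i (n ∸ y) l l' (iy y yx) ll)))) (trans (hZ _) (bottomsDone D y l' yx ll')) }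
    ; outputSoFar₁ = record
      { d12 = trans h12 (d12 (outputSoFar I)) ; d13 = trans h13 (d13 (outputSoFar I))
      ; image = outputImage-frame m (update mR WA v) (greedyRows x ++ rowRects x l) (image (outputSoFar I)) (λ a _ _ → trans (update-other mR WA v (outAddr a) (λ e → bottomAddr≢outAddr (i * n + l) a (rl<Z i l i≤ ll) (sym e))) (hZ _)) }
    ; m7 = trans h7 (d7 I)
    ; m8 = h8
    ; m11 = h11
    ; rowPrefixDone₁ = cur }
    where
      D : BlockInv x m
      D = blockInv I
      i : ℕ
      i = n ∸ suc x
      WA : ℕ
      WA = bottomAddr i l
      i≤ : i ≤ suc n
      i≤ = ≤-trans (m∸n≤m n (suc x)) (n≤1+n n)
      iy : ∀ y → y ≤ x → i < n ∸ y
      iy y yx = <-≤-trans (subst (i <_) (sym (+-∸-assoc 1 xl)) ≤-refl) (∸-monoʳ-≤ n yx)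
      cur : ∀ l' → l' ≤ l → update mR WA v (bottomAddr i l') ≡ bottomScan (suc x) l'
      cur l' le with m≤n⇒m<n∨m≡n le
      ... | inj₂ refl = trans (update-same mR WA v) hv
      ... | inj₁ lt = trans (update-other mR WA v (bottomAddr i l') (3Z+-≢ (λ e → <-irrefl (proj₂ (rowMajor-injective i i l' l (<-trans lt ll) ll e)) lt))) (trans (hZ _) (rowPrefixDone I l' lt))

  module StoreBottom (x l : ℕ) (m : Memory) (xl : x < n) (ll : l < n) (I : BlockColInv x l m) where
    D : BlockInv x m
    D = blockInv I
    i : ℕ
    i = n ∸ suc x
    px : n ∸ x ≡ suc i
    px = +-∸-assoc 1 xl
    e5 : m 5 ≡ Z + (Z + suc i * n)
    e5 = trans (d5 D) (cong (λ z → Z + (Z + z * n)) px)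
    e6 : m 6 ≡ Z + (Z + (Z + i * n))
    e6 = trans (d6 D) (trans (cong (λ z → (Z + (Z + (Z + z * n))) ∸ n) px) (3Z+[n+c]∸n (i * n)))
    i0 : i ≤ suc n
    i0 = ≤-trans (m∸n≤m n (suc x)) (n≤1+n n)
    i1 : suc i ≤ suc n
    i1 = s≤s (<⇒≤ (∸-monoʳ-< z<s xl))
    i2 : suc (suc i) ≤ suc n
    i2 = s≤s (∸-monoʳ-< z<s xl)
    K1 : ℕ
    K1 = endTable (suc i) l
    K2 : ℕ
    K2 = endTable (suc (suc i)) l
    m5 : Memory
    m5 = update (update (update (update (update m 9 (tableAddr (suc i) l)) 8 K1) 9 (tableAddr (suc (suc i)) l)) 10 K2) 11 (bottomAddr i l)
    post : ∀ v → v ≡ bottomScan (suc x) l → BottomStored x l (update m5 (bottomAddr i l) v)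
    post v hv = bottomStored-after m5 v xl ll I (λ _ → refl) refl refl refl refl refl refl refl refl refl refl refl refl refl hv
    e4 : m 4 ≡ suc i
    e4 = trans (d4 D) px
    compareEnds : Bounded m5 → Reaches (config 121 m5) (At 128 (BottomStored x l)) 6
    compareEnds b5 with <-cmp K1 K2
    ... | tri< lt ne _ = reach-mono {T = 2} (s≤s (s≤s z≤n)) (stepJltTaken b5 refl lt (
          stepStore (bottomAddr i l) (suc i) b5 refl refl e4 λ b6 →
          arrive b6 (post (suc i) (sym (cong (λ c → if c then bottomScan x l else suc i) (≢⇒≡ᵇ-false ne))))))
    ... | tri> _ ne gt = reach-mono {T = 3} (s≤s (s≤s (s≤s z≤n))) (stepJltNotTaken b5 refl (λ z → <-asym z gt) (stepJltTaken b5 refl gt (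
          stepStore (bottomAddr i l) (suc i) b5 refl refl e4 λ b6 →
          arrive b6 (post (suc i) (sym (cong (λ c → if c then bottomScan x l else suc i) (≢⇒≡ᵇ-false ne)))))))
    ... | tri≈ nl eq ng = stepJltNotTaken b5 refl nl (stepJltNotTaken b5 refl ng (
          stepAdd (bottomAddr (suc i) l) b5 refl (trans (cong (bottomAddr i l +_) (d0 D)) (bottomAddr-nextRow i l)) (bottomAddr-word (suc i) l i1 ll) λ b6 →
          stepLoad (bottomScan x l) b6 refl (trans (cong (λ z → m (bottomAddr z l)) (sym px)) (bottomsDone D x l ≤-refl ll)) λ b7 →
          stepStore (bottomAddr i l) (bottomScan x l) b7 refl refl refl λ b8 →
          stepJmp b8 refl (arrive b8 (bottomStored-after _ (bottomScan x l) xl ll I (λ _ → refl) refl refl refl refl refl refl refl refl refl refl refl refl refl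
               (sym (cong (λ c → if c then bottomScan x l else suc i) (≡⇒≡ᵇ-true eq)))))))

    fromColumnStart : Bounded m → Reaches (config 114 m) (At 128 (BottomStored x l)) 12
    fromColumnStart b =
      stepJltTaken b refl (subst₂ _<_ (sym (d7 I)) (sym (d0 D)) ll) (
      stepAdd (tableAddr (suc i) l) b refl (trans (cong (m 5 +_) (d7 I)) (rowBase+l {m} (suc i) l e5)) (tableAddr-word′ (suc i) l i1 ll) λ b1 →
      stepLoad K1 b1 refl (tableKept D (suc i) l i1 ll) λ b2 →
      stepAdd (tableAddr (suc (suc i)) l) b2 refl (trans (cong (tableAddr (suc i) l +_) (d0 D)) (tableAddr-nextRow (suc i) l)) (tableAddr-word′ (suc (suc i)) l i2 ll) λ b3 →
      stepLoad K2 b3 refl (tableKept D (suc (suc i)) l i2 ll) λ b4 →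
      stepAdd (bottomAddr i l) b4 refl (trans (cong (m 6 +_) (d7 I)) (bottomRowBase+l i l e6)) (bottomAddr-word i l i0 ll) λ b5 →
      compareEnds b5)

  block-storeBottom : ∀ x l m → x < n → l < n → Bounded m → BlockColInv x l m → Reaches (config 114 m) (At 128 (BottomStored x l)) 12
  block-storeBottom x l m xl ll b I = StoreBottom.fromColumnStart x l m xl ll I b

  blockInv-frame : ∀ {x m m'} → BlockInv x m → (∀ b → m' (Z + b) ≡ m (Z + b)) → m' 0 ≡ m 0 → m' 1 ≡ m 1 → m' 2 ≡ m 2 → m' 3 ≡ m 3 →
        m' 4 ≡ m 4 → m' 5 ≡ m 5 → m' 6 ≡ m 6 → m' 14 ≡ m 14 → BlockInv x m'
  blockInv-frame D hZ h0 h1 h2 h3 h4 h5 h6 h14 = record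
    { d0 = trans h0 (d0 D) ; d1 = trans h1 (d1 D) ; d2 = trans h2 (d2 D) ; d3 = trans h3 (d3 D) ; d4 = trans h4 (d4 D)
    ; d5 = trans h5 (d5 D) ; d6 = trans h6 (d6 D) ; d14 = trans h14 (d14 D)
    ; tableKept = λ r l rl ll → trans (hZ _) (tableKept D r l rl ll) ; bottomsDone = λ y l yx ll → trans (hZ _) (bottomsDone D y l yx ll) }

  outputSoFar-frame : ∀ {L m m'} → OutputSoFar L m → (∀ b → m' (Z + b) ≡ m (Z + b)) → m' 12 ≡ m 12 → m' 13 ≡ m 13 → OutputSoFar L m'
  outputSoFar-frame {L} {m} {m'} S hZ h12 h13 = record { d12 = trans h12 (d12 S) ; d13 = trans h13 (d13 S) ; image = outputImage-frame m m' L (image S) (λ a _ _ → hZ _) }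

  bottomStored-frame : ∀ {x l m m'} → BottomStored x l m → (∀ b → m' (Z + b) ≡ m (Z + b)) → m' 0 ≡ m 0 → m' 1 ≡ m 1 → m' 2 ≡ m 2 → m' 3 ≡ m 3 →
        m' 4 ≡ m 4 → m' 5 ≡ m 5 → m' 6 ≡ m 6 → m' 7 ≡ m 7 → m' 8 ≡ m 8 → m' 11 ≡ m 11 → m' 12 ≡ m 12 → m' 13 ≡ m 13 → m' 14 ≡ m 14 → BottomStored x l m'
  bottomStored-frame P hZ h0 h1 h2 h3 h4 h5 h6 h7 h8 h11 h12 h13 h14 = record
    { blockInv₁ = blockInv-frame (blockInv₁ P) hZ h0 h1 h2 h3 h4 h5 h6 h14 ; outputSoFar₁ = outputSoFar-frame (outputSoFar₁ P) hZ h12 h13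
    ; m7 = trans h7 (m7 P) ; m8 = trans h8 (m8 P) ; m11 = trans h11 (m11 P) ; rowPrefixDone₁ = λ l' le → trans (hZ _) (rowPrefixDone₁ P l' le) }

  outAddr-suc : ∀ a → outAddr a + 1 ≡ outAddr (suc a)
  outAddr-suc a = trans (solve 2 (λ z a → (z :+ (z :+ (z :+ (z :+ a)))) :+ con 1 := z :+ (z :+ (z :+ (z :+ (con 1 :+ a))))) refl Z a) refl

  length-rowRects : ∀ x l → length (rowRects x l) ≤ l
  length-rowRects x zero = z≤n
  length-rowRects x (suc l) = lem (rowRects x l) (emitted x l) (length-rowRects x l) (le1 x l)
    where
      le1 : ∀ x l → length (emitted x l) ≤ 1
      le1 x l with isBlockTop (n ∸ suc x) l
      ... | true = ≤-refl
      ... | false = z≤n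
      lem : ∀ (A C : List Rect) → length A ≤ l → length C ≤ 1 → length (A ++ C) ≤ suc l
      lem A C p q = subst (_≤ suc l) (sym (length-++ A)) (subst (length A + length C ≤_) (+-comm l 1) (+-mono-≤ p q))

  length-greedyRows : ∀ x → length (greedyRows x) ≤ x * n
  length-greedyRows zero = z≤n
  length-greedyRows (suc x) = subst (_≤ suc x * n) (sym (length-++ (greedyRows x))) (subst (length (greedyRows x) + length (rowRects x n) ≤_) (+-comm (x * n) n) (+-mono-≤ (length-greedyRows x) (length-rowRects x n)))

  length-emittedSoFar : ∀ x l → x < n → l ≤ n → length (greedyRows x ++ rowRects x l) ≤ n * n
  length-emittedSoFar x l xl ln = subst (_≤ n * n) (sym (length-++ (greedyRows x))) (≤-trans (+-mono-≤ (length-greedyRows x) (≤-trans (length-rowRects x l) ln)) (≤-trans (≤-reflexive (+-comm (x * n) n)) (*-monoˡ-≤ n xl)))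

  64+4n²≤4Z : 64 + 4 * (n * n) ≤ Z + (Z + (Z + Z))
  64+4n²≤4Z = begin
          64 + 4 * (n * n) ≡⟨ solve 1 (λ a → con 64 :+ con 4 :* a := con 4 :* (a :+ con 16)) refl (n * n) ⟩
          4 * (n * n + 16) ≤⟨ *-monoʳ-≤ 4 n*n+16≤Z ⟩
          4 * Z ≡⟨ cong (λ z → Z + (Z + (Z + z))) (+-identityʳ Z) ⟩
          Z + (Z + (Z + Z)) ∎
    where open ≤-Reasoning

  outAddr-word′ : ∀ a → a ≤ 64 + 4 * (n * n) → outAddr a < B
  outAddr-word′ a le = word≤8Z (+-monoʳ-≤ Z (+-monoʳ-≤ Z (+-monoʳ-≤ Z (+-monoʳ-≤ Z (≤-trans le 64+4n²≤4Z)))))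

  outAddr-word : ∀ c k → c ≤ 5 → k ≤ n * n → outAddr (c + 4 * k) < B
  outAddr-word c k c≤5 k≤n*n = outAddr-word′ (c + 4 * k) (+-mono-≤ (≤-trans c≤5 (m≤m+n 5 59)) (*-monoʳ-≤ 4 k≤n*n))

  module EmitStep (x l : ℕ) (mE : Memory) (xl : x < n) (ll : l < n) (np : BlockTop (n ∸ suc x) l) (P : BottomStored x l mE) where
    D : BlockInv x mE
    D = blockInv₁ P
    S : OutputSoFar (greedyRows x ++ rowRects x l) mE
    S = outputSoFar₁ P
    i : ℕ
    i = n ∸ suc x
    px : n ∸ x ≡ suc i
    px = +-∸-assoc 1 xl
    L : List Rect
    L = greedyRows x ++ rowRects x l
    k : ℕ
    k = length L
    k≤n*n : k ≤ n * n
    k≤n*n = length-emittedSoFar x l xl (<⇒≤ ll)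
    R : Rect
    R = blockRect i l
    eL : emitted x l ≡ R ∷ []
    eL = cong (λ c → if c then blockRect i l ∷ [] else []) (BlockTop⇒isBlockTop i l np)
    kn' : suc k ≤ n * n
    kn' = subst (_≤ n * n) (trans (length-++ L) (+-comm k 1)) (subst (λ z → length (L ++ z) ≤ n * n) eL (subst (λ z → length z ≤ n * n) (sym (++-assoc (greedyRows x) (rowRects x l) (emitted x l))) (length-emittedSoFar x (suc l) xl ll)))
    il' : i * n + l < Z
    il' = rl<Z i l (≤-trans (m∸n≤m n (suc x)) (n≤1+n n)) ll
    K1 : ℕ
    K1 = endTable (suc i) l
    Dv : ℕ
    Dv = bottomScan (suc x) l
    A1 : ℕ
    A1 = outAddr (1 + 4 * k)
    A2 : ℕ
    A2 = outAddr (2 + 4 * k)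
    A3 : ℕ
    A3 = outAddr (3 + 4 * k)
    A4 : ℕ
    A4 = outAddr (4 + 4 * k)
    A5 : ℕ
    A5 = outAddr (1 + 4 * suc k)
    s0 : Memory
    s0 = update mE 9 i
    s1 : Memory
    s1 = update s0 A1 i
    s1' : Memory
    s1' = update s1 12 A2
    s1'' : Memory
    s1'' = update s1' 9 Dv
    s2 : Memory
    s2 = update s1'' A2 Dv
    s2' : Memory
    s2' = update s2 12 A3
    s3 : Memory
    s3 = update s2' A3 l
    s3' : Memory
    s3' = update s3 12 A4
    s4 : Memory
    s4 = update s3' A4 K1
    s4' : Memory
    s4' = update s4 12 A5
    f : Memory
    f = update s4' 13 (suc k)
    peel4 : ∀ b → Z + b ≢ A1 → Z + b ≢ A2 → Z + b ≢ A3 → Z + b ≢ A4 → f (Z + b) ≡ mE (Z + b)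
    peel4 b n1 n2 n3 n4 = trans (update-other s3' A4 K1 (Z + b) n4) (trans (update-other s2' A3 l (Z + b) n3) (trans (update-other s1'' A2 Dv (Z + b) n2) (update-other s0 A1 i (Z + b) n1)))
    kNI : ∀ r l' c → r * n + l' < Z → tableAddr r l' ≢ outAddr (c + 4 * k)
    kNI r l' c lt = 2Z+-≢ (<⇒≢ (<-≤-trans lt (m≤m+n Z _)))
    dNI : ∀ r l' c → r * n + l' < Z → bottomAddr r l' ≢ outAddr (c + 4 * k)
    dNI r l' c lt = bottomAddr≢outAddr (r * n + l') (c + 4 * k) lt
    il'' : ∀ l' → l' ≤ l → i * n + l' < Z
    il'' l' le = rl<Z i l' (≤-trans (m∸n≤m n (suc x)) (n≤1+n n)) (≤-<-trans le ll)
    neo : ∀ c d → c ≢ d → outAddr (c + 4 * k) ≢ outAddr (d + 4 * k)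
    neo c d ne = outAddr-≢ (λ e → ne (+-cancelʳ-≡ (4 * k) c d e))
    iNI : ∀ a c → 1 ≤ c → a < 1 + 4 * k → Z + (Z + (Z + (Z + a))) ≢ outAddr (c + 4 * k)
    iNI a c c1 lt = outAddr-≢ (<⇒≢ (≤-trans lt (+-monoˡ-≤ (4 * k) c1)))
    lenS : length (L ++ R ∷ []) ≡ suc k
    lenS = trans (length-++ L) (+-comm k 1)
    DfEq : Dv ≡ blockEnd i l
    DfEq = cong (λ z → bottomScan z l) (sym (n∸[n∸1+x]≡ x xl))
    lst1 : OutputSoFar (L ++ R ∷ []) f
    lst1 = record
      { d12 = cong (λ z → outAddr (1 + 4 * z)) (sym lenS)
      ; d13 = sym lenS
      ; image = outputImage-snoc mE f L R (image S)
          (λ a _ al → peel4 (Z + (Z + (Z + a))) (iNI a 1 (s≤s z≤n) al) (iNI a 2 (s≤s z≤n) al) (iNI a 3 (s≤s z≤n) al) (iNI a 4 (s≤s z≤n) al))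
          (trans (update-other s3' A4 K1 A1 (neo 1 4 (λ ()))) (trans (update-other s2' A3 l A1 (neo 1 3 (λ ()))) (trans (update-other s1'' A2 Dv A1 (neo 1 2 (λ ()))) (update-same s0 A1 i))))
          (trans (update-other s3' A4 K1 A2 (neo 2 4 (λ ()))) (trans (update-other s2' A3 l A2 (neo 2 3 (λ ()))) (trans (update-same s1'' A2 Dv) DfEq)))
          (trans (update-other s3' A4 K1 A3 (neo 3 4 (λ ()))) (update-same s2' A3 l))
          (update-same s3' A4 K1) }

    final : ColumnDone x l f
    final = record
        { blockInv₂ = record
          { d0 = d0 D ; d1 = d1 D ; d2 = d2 D ; d3 = d3 D ; d4 = d4 D ; d5 = d5 D ; d6 = d6 D ; d14 = d14 D
          ; tableKept = λ r l' rl ll' → trans (peel4 (Z + (r * n + l')) (kNI r l' 1 (rl<Z r l' rl ll')) (kNI r l' 2 (rl<Z r l' rl ll')) (kNI r l' 3 (rl<Z r l' rl ll')) (kNI r l' 4 (rl<Z r l' rl ll'))) (tableKept D r l' rl ll')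
          ; bottomsDone = λ y l' yx ll' → trans (peel4 (Z + (Z + ((n ∸ y) * n + l'))) (dNI (n ∸ y) l' 1 (rl<Z (n ∸ y) l' (≤-trans (m∸n≤m n y) (n≤1+n n)) ll')) (dNI (n ∸ y) l' 2 (rl<Z (n ∸ y) l' (≤-trans (m∸n≤m n y) (n≤1+n n)) ll')) (dNI (n ∸ y) l' 3 (rl<Z (n ∸ y) l' (≤-trans (m∸n≤m n y) (n≤1+n n)) ll')) (dNI (n ∸ y) l' 4 (rl<Z (n ∸ y) l' (≤-trans (m∸n≤m n y) (n≤1+n n)) ll'))) (bottomsDone D y l' yx ll') }
        ; outputSoFar₂ = subst (λ z → OutputSoFar (L ++ z) f) (sym eL) lst1
        ; e7 = m7 P
        ; rowPrefixDone₂ = λ l' le → trans (peel4 (Z + (Z + (i * n + l'))) (dNI i l' 1 (il'' l' le)) (dNI i l' 2 (il'' l' le)) (dNI i l' 3 (il'' l' le)) (dNI i l' 4 (il'' l' le))) (rowPrefixDone₁ P l' le) }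

    emit : Bounded mE → Reaches (config 136 mE) (At 147 (ColumnDone x l)) 11
    emit b =
      stepSub i b refl (trans (cong₂ _∸_ (trans (d4 D) px) (d2 D)) refl) λ b1 →
      stepStore A1 i b1 refl (d12 S) refl λ b2 →
      stepAdd A2 b2 refl (trans (cong₂ _+_ (d12 S) (d2 D)) (outAddr-suc _)) (outAddr-word 2 k (s≤s (s≤s z≤n)) k≤n*n) λ b3 →
      stepLoad Dv b3 refl (trans (cong s1' (m11 P)) (trans (update-other s0 A1 i (bottomAddr i l) (bottomAddr≢outAddr (i * n + l) (1 + 4 * k) il')) (rowPrefixDone₁ P l ≤-refl))) λ b4 →
      stepStore A2 Dv b4 refl refl refl λ b5 →
      stepAdd A3 b5 refl (trans (cong (A2 +_) (d2 D)) (outAddr-suc _)) (outAddr-word 3 k (s≤s (s≤s (s≤s z≤n))) k≤n*n) λ b6 →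
      stepStore A3 l b6 refl refl (m7 P) λ b7 →
      stepAdd A4 b7 refl (trans (cong (A3 +_) (d2 D)) (outAddr-suc _)) (outAddr-word 4 k (s≤s (s≤s (s≤s (s≤s z≤n)))) k≤n*n) λ b8 →
      stepStore A4 K1 b8 refl refl (m8 P) λ b9 →
      stepAdd A5 b9 refl (trans (cong (A4 +_) (d2 D)) (trans (outAddr-suc _) (cong outAddr (cong suc (sym (*-suc 4 k)))))) (outAddr-word 1 (suc k) (s≤s z≤n) kn') λ b10 →
      stepAdd (suc k) b10 refl (trans (cong₂ _+_ (d13 S) (d2 D)) (+-comm k 1)) (word≤Z (≤-trans kn' (≤-trans (m≤m+n (n * n) 16) n*n+16≤Z))) λ b11 →
      arrive b11 final

  block-emit : ∀ x l mE → x < n → l < n → BlockTop (n ∸ suc x) l → Bounded mE → BottomStored x l mE → Reaches (config 136 mE) (At 147 (ColumnDone x l)) 11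
  block-emit x l mE xl ll np b P = EmitStep.emit x l mE xl ll np P b

  columnDone-noEmit : ∀ {x l m} → BottomStored x l m → isBlockTop (n ∸ suc x) l ≡ false → ColumnDone x l m
  columnDone-noEmit {x} {l} {m} P nf = record
    { blockInv₂ = blockInv₁ P
    ; outputSoFar₂ = subst (λ z → OutputSoFar ((greedyRows x ++ rowRects x l) ++ z) m) (sym eL) (subst (λ z → OutputSoFar z m) (sym (++-identityʳ _)) (outputSoFar₁ P))
    ; e7 = m7 P ; rowPrefixDone₂ = rowPrefixDone₁ P }
    where
      eL : emitted x l ≡ []
      eL = cong (λ c → if c then blockRect (n ∸ suc x) l ∷ [] else []) nf

  block-checkEmit : ∀ x l m → x < n → l < n → Bounded m → BottomStored x l m → Reaches (config 128 m) (At 147 (ColumnDone x l)) 17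
  block-checkEmit x l m xl ll b P with K1 ≟ 0
    where
      K1 : ℕ
      K1 = endTable (suc (n ∸ suc x)) l
  ... | yes z = reach-mono {T = 2} (s≤s (s≤s z≤n)) (stepJltNotTaken b refl (λ q → <-irrefl refl (subst₂ _<_ (d1 (blockInv₁ P)) (trans (m8 P) z) q)) (stepJmp b refl (arrive b (columnDone-noEmit P (endTable≡0⇒¬isBlockTop (n ∸ suc x) l z)))))
  ... | no nz' =
    stepJltTaken b refl (subst₂ _<_ (sym (d1 D)) (sym (m8 P)) (≤∧≢⇒< z≤n (λ e → nz' (sym e)))) (
    stepSub (Z + (Z + i * n)) b refl (trans (cong₂ _∸_ (trans (d5 D) (cong (λ z → Z + (Z + z * n)) px)) (d0 D)) (2Z+[n+c]∸n (i * n))) λ b1 →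
    stepAdd (tableAddr i l) b1 refl (trans (cong ((Z + (Z + i * n)) +_) (m7 P)) (rowBase+l {λ _ → Z + (Z + i * n)} i l refl)) (tableAddr-word′ i l i0 ll) λ b2 →
    stepLoad K0 b2 refl (tableKept D i l i0 ll) λ b3 → br b3)
    where
      D : BlockInv x m
      D = blockInv₁ P
      i : ℕ
      i = n ∸ suc x
      K1 : ℕ
      K1 = endTable (suc i) l
      K0 : ℕ
      K0 = endTable i l
      px : n ∸ x ≡ suc i
      px = +-∸-assoc 1 xl
      i0 : i ≤ suc n
      i0 = ≤-trans (m∸n≤m n (suc x)) (n≤1+n n)
      mE : Memory
      mE = update (update (update m 9 (Z + (Z + i * n))) 9 (tableAddr i l)) 10 K0
      PE : BottomStored x l mE
      PE = bottomStored-frame P (λ _ → refl) refl refl refl refl refl refl refl refl refl refl refl refl refl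
      br : Bounded mE → Reaches (config 133 mE) (At 147 (ColumnDone x l)) 13
      br b3 with <-cmp K0 K1
      ... | tri< lt ne _ = reach-mono {T = 12} (m≤m+n 12 1) (stepJltTaken b3 refl (subst₂ _<_ refl (sym (m8 P)) lt) (block-emit x l mE xl ll (record { nonzero = nz' ; fresh = ne }) b3 PE))
      ... | tri> _ ne gt = stepJltNotTaken b3 refl (λ q → <-asym q (subst (_< K0) (sym (m8 P)) gt)) (stepJltTaken b3 refl (subst (_< K0) (sym (m8 P)) gt) (block-emit x l mE xl ll (record { nonzero = nz' ; fresh = ne }) b3 PE))
      ... | tri≈ nl eq ng = reach-mono {T = 3} (s≤s (s≤s (s≤s z≤n))) (stepJltNotTaken b3 refl (λ q → nl (subst (K0 <_) (m8 P) q)) (stepJltNotTaken b3 refl (λ q → ng (subst (_< K0) (m8 P) q)) (stepJmp b3 refl (arrive b3 (columnDone-noEmit PE (sameAbove⇒¬isBlockTop i l eq))))))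

  block-nextCol : ∀ x l m → l < n → Bounded m → ColumnDone x l m → Reaches (config 147 m) (At 114 (BlockColInv x (suc l))) 2
  block-nextCol x l m ll b E =
    stepAdd (suc l) b refl (trans (cong₂ _+_ (e7 E) (d2 (blockInv₂ E))) (+-comm l 1)) (word≤Z (≤-trans ll (<⇒≤ n<Z))) λ b1 →
    stepJmp b1 refl (arrive b1 (record
      { blockInv = blockInv-frame (blockInv₂ E) (λ _ → refl) refl refl refl refl refl refl refl refl
      ; outputSoFar = outputSoFar-frame (subst (λ z → OutputSoFar z m) (++-assoc (greedyRows x) (rowRects x l) (emitted x l)) (outputSoFar₂ E)) (λ _ → refl) refl refl
      ; d7 = refl
      ; rowPrefixDone = λ l' lt → rowPrefixDone₂ E l' (s≤s⁻¹ lt) }))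

  block-colStep : ∀ x l m → x < n → l < n → Bounded m → BlockColInv x l m → Reaches (config 114 m) (At 114 (BlockColInv x (suc l))) (12 + (17 + 2))
  block-colStep x l m xl ll b I = thenAt (block-storeBottom x l m xl ll b I) λ m b P → thenAt (block-checkEmit x l m xl ll b P) λ m b E → block-nextCol x l m ll b E

  record BlockRowInv (x : ℕ) (m : Memory) : Set where
    field
      blockInv₃ : BlockInv x m
      outputSoFar₃ : OutputSoFar (greedyRows x) m
  open BlockRowInv public

  bottomSentinelAddr : ∀ l → Z + (n * n + l) ≡ suc n * n + ((Z ∸ n) + l)
  bottomSentinelAddr l = trans (cong (_+ (n * n + l)) (sym (m+[n∸m]≡n (<⇒≤ n<Z))))
                  (solve 4 (λ a b c d → (a :+ d) :+ (b :+ c) := (a :+ b) :+ (d :+ c)) refl n (n * n) l (Z ∸ n))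

  block-setup : ∀ m → Bounded m → TableFilled m → Reaches (config 101 m) (At 111 (BlockRowInv 0)) 10
  block-setup m b P =
    stepAdd n b refl (trans (cong₂ _+_ (p0' P) (p1' P)) (+-identityʳ n)) (word≤Z (<⇒≤ n<Z)) λ b1 →
    stepAdd (Z + Z) b1 refl (cong₂ _+_ (p3' P) (p3' P)) (word≤2Z ≤-refl) λ b2 →
    stepMul (n * n) b2 refl (cong₂ _*_ (p0' P) (p0' P)) (word≤Z (≤-trans (m≤m+n (n * n) 16) n*n+16≤Z)) λ b3 →
    stepAdd (Z + (Z + n * n)) b3 refl (+-assoc Z Z (n * n)) (word≤3Z (+-monoʳ-≤ Z (+-monoʳ-≤ Z (≤-trans (m≤m+n (n * n) 16) n*n+16≤Z)))) λ b4 →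
    stepAdd (Z + (Z + (Z + n * n))) b4 refl (trans (cong ((Z + (Z + n * n)) +_) (p3' P)) (solve 2 (λ z a → (z :+ (z :+ a)) :+ z := z :+ (z :+ (z :+ a))) refl Z (n * n))) (word≤4Z (+-monoʳ-≤ Z (+-monoʳ-≤ Z (+-monoʳ-≤ Z (≤-trans (m≤m+n (n * n) 16) n*n+16≤Z))))) λ b5 →
    stepSub ((Z + (Z + (Z + n * n))) ∸ n) b5 refl (cong ((Z + (Z + (Z + n * n))) ∸_) (p0' P)) λ b6 →
    stepAdd (Z + Z) b6 refl (cong₂ _+_ (p3' P) (p3' P)) (word≤2Z ≤-refl) λ b7 →
    stepAdd (outAddr 0) b7 refl (solve 1 (λ z → (z :+ z) :+ (z :+ z) := z :+ (z :+ (z :+ (z :+ con 0)))) refl Z) (outAddr-word 0 0 z≤n z≤n) λ b8 →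
    stepAdd (outAddr 1) b8 refl (trans (cong (outAddr 0 +_) (p2' P)) (outAddr-suc 0)) (outAddr-word 1 0 (s≤s z≤n) z≤n) λ b9 →
    stepConst b9 refl (word≤31 0 z≤n) λ b10 →
    arrive b10 (record
      { blockInv₃ = record
        { d0 = p0' P ; d1 = p1' P ; d2 = p2' P ; d3 = p3' P ; d4 = refl ; d5 = refl ; d6 = refl ; d14 = refl
        ; tableKept = table P
        ; bottomsDone = dd0 }
      ; outputSoFar₃ = record { d12 = refl ; d13 = refl ; image = λ t () } })
    where
      dd0 : ∀ y l → y ≤ 0 → l < n → m (bottomAddr (n ∸ y) l) ≡ bottomScan y l
      dd0 zero l _ _ = trans (cong (λ z → m (Z + (Z + z))) (bottomSentinelAddr l)) (beyondTableZero′ P ((Z ∸ n) + l))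

  block-rowStep : ∀ x m → x < n → Bounded m → BlockRowInv x m → Reaches (config 111 m) (At 111 (BlockRowInv (suc x))) (2 + (n * (12 + (17 + 2)) + 6))
  block-rowStep x m xl b inv =
    stepJltTaken b refl (subst₂ _<_ (sym (d1 D)) (sym (d4 D)) (m<n⇒0<n∸m xl)) (
    stepConst b refl (word≤31 0 z≤n) λ b1 →
    thenAt (loopAt 114 (BlockColInv x) n (12 + (17 + 2)) (λ l m ll b I → block-colStep x l m xl ll b I) _ b1
      (record { blockInv = blockInv-frame D (λ _ → refl) refl refl refl refl refl refl refl refl
              ; outputSoFar = outputSoFar-frame (subst (λ z → OutputSoFar z m) (sym (++-identityʳ (greedyRows x))) (outputSoFar₃ inv)) (λ _ → refl) refl refl
              ; d7 = refl ; rowPrefixDone = λ l' () })) λ m3 b3 I3 →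
    stepJltNotTaken b3 refl (λ q → <-irrefl refl (subst₂ _<_ (d7 I3) (d0 (blockInv I3)) q)) (
    stepJmp b3 refl (
    stepSub (n ∸ suc x) b3 refl (trans (cong₂ _∸_ (d4 (blockInv I3)) (d2 (blockInv I3))) (n∸x∸1≡ x)) λ b4 →
    stepSub (Z + (Z + (n ∸ suc x) * n)) b4 refl (trans (cong₂ _∸_ (trans (d5 (blockInv I3)) (cong (λ z → Z + (Z + z * n)) px)) (d0 (blockInv I3))) (2Z+[n+c]∸n _)) λ b5 →
    stepSub ((Z + (Z + (Z + (n ∸ suc x) * n))) ∸ n) b5 refl (trans (cong₂ _∸_ (trans (d6 (blockInv I3)) (trans (cong (λ z → (Z + (Z + (Z + z * n))) ∸ n) px) (3Z+[n+c]∸n _))) (d0 (blockInv I3))) refl) λ b6 →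
    stepJmp b6 refl (arrive b6 (record
      { blockInv₃ = record
        { d0 = d0 (blockInv I3) ; d1 = d1 (blockInv I3) ; d2 = d2 (blockInv I3) ; d3 = d3 (blockInv I3) ; d4 = refl ; d5 = refl ; d6 = refl ; d14 = d14 (blockInv I3)
        ; tableKept = tableKept (blockInv I3) ; bottomsDone = dd' I3 }
      ; outputSoFar₃ = outputSoFar-frame (outputSoFar I3) (λ _ → refl) refl refl })))))
    where
      D : BlockInv x m
      D = blockInv₃ inv
      px : n ∸ x ≡ suc (n ∸ suc x)
      px = +-∸-assoc 1 xl
      dd' : ∀ {m} → BlockColInv x n m → ∀ y l → y ≤ suc x → l < n → m (bottomAddr (n ∸ y) l) ≡ bottomScan y l
      dd' I y l yx ll with m≤n⇒m<n∨m≡n yx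
      ... | inj₁ lt = bottomsDone (blockInv I) y l (s≤s⁻¹ lt) ll
      ... | inj₂ refl = rowPrefixDone I l ll

  record AllEmitted (m : Memory) : Set where
    field
      f1 : m 1 ≡ 0
      f2 : m 2 ≡ 1
      f13 : m 13 ≡ length greedy
      f14 : m 14 ≡ outAddr 0
      countStored : m (outAddr 0) ≡ length greedy
      imageStored : OutputImage m greedy
  open AllEmitted public

  block-exit : ∀ m → Bounded m → BlockRowInv n m → Reaches (config 111 m) (At 154 AllEmitted) 3
  block-exit m b Od =
    stepJltNotTaken b refl (λ q → <-irrefl refl (subst₂ _<_ (d1 D) (trans (d4 D) (n∸n≡0 n)) q)) (
    stepJmp b refl (
    stepStore (outAddr 0) (length greedy) b refl (d14 D) (d13 (outputSoFar₃ Od)) λ b1 →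
    arrive b1 (record
      { f1 = d1 D ; f2 = d2 D ; f13 = d13 (outputSoFar₃ Od) ; f14 = d14 D ; countStored = update-same m (outAddr 0) (length greedy)
      ; imageStored = outputImage-frame m (update m (outAddr 0) (length greedy)) greedy (image (outputSoFar₃ Od)) (λ a a0 _ → update-other m (outAddr 0) (length greedy) (outAddr a) (outAddr-≢ (>⇒≢ a0))) })))
    where
      D : BlockInv n m
      D = blockInv₃ Od

  emitBlocks : ∀ m → Bounded m → TableFilled m → Reaches (config 101 m) (At 154 AllEmitted) (10 + (n * (2 + (n * (12 + (17 + 2)) + 6)) + 3))
  emitBlocks m b P = thenAt (block-setup m b P) λ m b inv → thenAt (loopAt 111 BlockRowInv n (2 + (n * (12 + (17 + 2)) + 6)) (λ x m xl b inv → block-rowStep x m xl b inv) m b inv) λ m b inv → block-exit m b inv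

agree-below16 : ∀ (g h : ℕ → ℕ) → g 0 ≡ h 0 → g 1 ≡ h 1 → g 2 ≡ h 2 → g 3 ≡ h 3 → g 4 ≡ h 4 → g 5 ≡ h 5 → g 6 ≡ h 6 → g 7 ≡ h 7 →
        g 8 ≡ h 8 → g 9 ≡ h 9 → g 10 ≡ h 10 → g 11 ≡ h 11 → g 12 ≡ h 12 → g 13 ≡ h 13 → g 14 ≡ h 14 → g 15 ≡ h 15 →
        ∀ a → a ≤ 15 → g a ≡ h a
agree-below16 g h e0 e1 e2 e3 e4 e5 e6 e7 e8 e9 e10 e11 e12 e13 e14 e15 a le = go a le
  where
    go : ∀ a → a ≤ 15 → g a ≡ h a
    go 0 _ = e0
    go 1 _ = e1
    go 2 _ = e2
    go 3 _ = e3
    go 4 _ = e4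
    go 5 _ = e5
    go 6 _ = e6
    go 7 _ = e7
    go 8 _ = e8
    go 9 _ = e9
    go 10 _ = e10
    go 11 _ = e11
    go 12 _ = e12
    go 13 _ = e13
    go 14 _ = e14
    go 15 _ = e15
    go (suc (suc (suc (suc (suc (suc (suc (suc (suc (suc (suc (suc (suc (suc (suc (suc a)))))))))))))))) (s≤s (s≤s (s≤s (s≤s (s≤s (s≤s (s≤s (s≤s (s≤s (s≤s (s≤s (s≤s (s≤s (s≤s (s≤s ())))))))))))))))

module WriteOutput {n : ℕ} (M : Matrix n) where
  open EmitBlocks M public

  count : ℕ
  count = length greedy

  outputEnd : ℕ
  outputEnd = (count + count) + (count + count) + 1

  outputCopyCount : ℕ
  outputCopyCount = outputEnd ∸ 16

  count≤n*n : count ≤ n * n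
  count≤n*n = length-greedyRows n

  outputEnd≤ : outputEnd ≤ 64 + 4 * (n * n)
  outputEnd≤ = begin
      (count + count) + (count + count) + 1 ≡⟨ solve 1 (λ a → (a :+ a) :+ (a :+ a) :+ con 1 := con 1 :+ con 4 :* a) refl count ⟩
      1 + 4 * count ≤⟨ +-mono-≤ (m≤m+n 1 63) (*-monoʳ-≤ 4 count≤n*n) ⟩
      64 + 4 * (n * n) ∎
    where open ≤-Reasoning

  ≤15⇒≤64+4n² : ∀ a → a ≤ 15 → a ≤ 64 + 4 * (n * n)
  ≤15⇒≤64+4n² a le = ≤-trans le (≤-trans (m≤m+n 15 49) (m≤m+n 64 _))

  outAddr-shift : ∀ c → c + outAddr 1 ≡ outAddr (suc c)
  outAddr-shift c = solve 2 (λ z c → c :+ (z :+ (z :+ (z :+ (z :+ con 1)))) := z :+ (z :+ (z :+ (z :+ (con 1 :+ c))))) refl Z c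

  record OutputCopyInv (F : ℕ → ℕ) (x : ℕ) (m : Memory) : Set where
    field
      o1 : m 1 ≡ 0
      o2 : m 2 ≡ 1
      o4 : m 4 ≡ 16 + x
      o5 : m 5 ≡ outputEnd
      o6 : m 6 ≡ outAddr (16 + x)
      o14 : m 14 ≡ outAddr 0
      imageKept : ∀ a → m (outAddr a) ≡ F a
      copiedPrefix : ∀ a → a < x → m (16 + a) ≡ F (16 + a)
  open OutputCopyInv public

  outputEnd≤4Z : outputEnd ≤ Z + (Z + (Z + Z))
  outputEnd≤4Z = ≤-trans outputEnd≤ 64+4n²≤4Z

  output-setup : ∀ m → Bounded m → AllEmitted m → Reaches (config 154 m) (At 159 (OutputCopyInv (λ a → m (outAddr a)) 0)) 5
  output-setup m b P =
    stepConst b refl (word≤31 16 (m≤m+n 16 15)) λ b1 →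
    stepAdd (count + count) b1 refl (cong₂ _+_ (f13 P) (f13 P)) (word≤4Z (≤-trans (m≤m+n (count + count) (count + count)) (≤-trans (m≤m+n _ 1) outputEnd≤4Z))) λ b2 →
    stepAdd ((count + count) + (count + count)) b2 refl refl (word≤4Z (≤-trans (m≤m+n _ 1) outputEnd≤4Z)) λ b3 →
    stepAdd outputEnd b3 refl (cong ((count + count) + (count + count) +_) (f2 P)) (word≤4Z outputEnd≤4Z) λ b4 →
    stepAdd (outAddr 16) b4 refl (trans (cong (_+ 16) (f14 P)) (solve 1 (λ z → (z :+ (z :+ (z :+ (z :+ con 0)))) :+ con 16 := z :+ (z :+ (z :+ (z :+ con 16)))) refl Z)) (outAddr-word′ 16 (m≤m+n 16 _)) λ b5 →
    arrive b5 (record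
      { o1 = f1 P ; o2 = f2 P ; o4 = refl ; o5 = refl ; o6 = refl ; o14 = f14 P
      ; imageKept = λ a → refl ; copiedPrefix = λ a () })

  OutputWritten : (ℕ → ℕ) → Memory → Set
  OutputWritten F m = (∀ a → a ≤ 15 → m a ≡ F a) × (∀ a → a < outputCopyCount → m (16 + a) ≡ F (16 + a))

  outputCopy-index< : ∀ x → x < outputCopyCount → 16 + x < outputEnd
  outputCopy-index< x = <∸⇒+< 16

  output-copyStep : ∀ (F : ℕ → ℕ) x m → x < outputCopyCount → Bounded m → OutputCopyInv F x m → Reaches (config 159 m) (At 159 (OutputCopyInv F (suc x))) 6
  output-copyStep F x m xl b C =
    stepJltTaken b refl (subst₂ _<_ (sym (o4 C)) (sym (o5 C)) lt16) (
    stepLoad (F (16 + x)) b refl (trans (cong m (o6 C)) (imageKept C (16 + x))) λ b1 →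
    stepStore (16 + x) (F (16 + x)) b1 refl (o4 C) refl λ b2 →
    stepAdd (16 + suc x) b2 refl (trans (cong₂ _+_ (o4 C) (o2 C)) (cong (16 +_) (+-comm x 1))) (word≤4Z (≤-trans lt16 outputEnd≤4Z)) λ b3 →
    stepAdd (outAddr (16 + suc x)) b3 refl (trans (cong₂ _+_ (o6 C) (o2 C)) (outAddr-suc (16 + x))) (outAddr-word′ (16 + suc x) (≤-trans lt16 outputEnd≤)) λ b4 →
    stepJmp b4 refl (arrive b4 (record
      { o1 = o1 C ; o2 = o2 C ; o4 = refl ; o5 = o5 C ; o6 = refl ; o14 = o14 C
      ; imageKept = λ a → trans (update-other m1 (16 + x) (F (16 + x)) (outAddr a) (>⇒≢ (<-≤-trans lt16 (≤-trans outputEnd≤4Z (Z4≤ a))))) (imageKept C a)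
      ; copiedPrefix = clw })))
    where
      lt16 : 16 + x < outputEnd
      lt16 = outputCopy-index< x xl
      Z4≤ : ∀ a → Z + (Z + (Z + Z)) ≤ outAddr a
      Z4≤ a = +-monoʳ-≤ Z (+-monoʳ-≤ Z (+-monoʳ-≤ Z (m≤m+n Z a)))
      m1 : Memory
      m1 = update m 7 (F (16 + x))
      clw : ∀ a → a < suc x → update m1 (16 + x) (F (16 + x)) (16 + a) ≡ F (16 + a)
      clw a al with m≤n⇒m<n∨m≡n (s≤s⁻¹ al)
      ... | inj₂ refl = update-same m1 (16 + x) (F (16 + x))
      ... | inj₁ lt = trans (update-other m1 (16 + x) (F (16 + x)) (16 + a) (λ e → <-irrefl (+-cancelˡ-≡ 16 _ _ e) lt)) (copiedPrefix C a lt)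

  output-restoreRegisters : ∀ (F : ℕ → ℕ) m → Bounded m → OutputCopyInv F outputCopyCount m → Reaches (config 159 m) (At 212 (OutputWritten F)) (2 + 46)
  output-restoreRegisters F m b C =
    stepJltNotTaken b refl (λ q → <-irrefl refl (<-≤-trans (subst₂ _<_ (o4 C) (o5 C) q) (m≤n+m∸n outputEnd 16))) (
    stepJmp b refl (
    stepAdd (outAddr 0) b refl (trans (cong₂ _+_ (o14 C) (o1 C)) (+-identityʳ _)) (outAddr-word′ 0 z≤n) λ b1 →
    stepAdd (outAddr 1) b1 refl (trans (cong₂ _+_ (o14 C) (o2 C)) (outAddr-suc 0)) (outAddr-word′ 1 (s≤s z≤n)) λ b2 →
    stepConst b2 refl (word≤31 14 (m≤m+n 14 17)) λ b3 →
    stepAdd (outAddr 15) b3 refl (outAddr-shift 14) (outAddr-word′ 15 (≤15⇒≤64+4n² 15 (m≤m+n 15 0))) λ b4 →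
    stepConst b4 refl (word≤31 13 (m≤m+n 13 18)) λ b5 →
    stepAdd (outAddr 14) b5 refl (outAddr-shift 13) (outAddr-word′ 14 (≤15⇒≤64+4n² 14 (m≤m+n 14 1))) λ b6 →
    stepConst b6 refl (word≤31 12 (m≤m+n 12 19)) λ b7 →
    stepAdd (outAddr 13) b7 refl (outAddr-shift 12) (outAddr-word′ 13 (≤15⇒≤64+4n² 13 (m≤m+n 13 2))) λ b8 →
    stepConst b8 refl (word≤31 11 (m≤m+n 11 20)) λ b9 →
    stepAdd (outAddr 12) b9 refl (outAddr-shift 11) (outAddr-word′ 12 (≤15⇒≤64+4n² 12 (m≤m+n 12 3))) λ b10 →
    stepConst b10 refl (word≤31 10 (m≤m+n 10 21)) λ b11 →
    stepAdd (outAddr 11) b11 refl (outAddr-shift 10) (outAddr-word′ 11 (≤15⇒≤64+4n² 11 (m≤m+n 11 4))) λ b12 →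
    stepConst b12 refl (word≤31 9 (m≤m+n 9 22)) λ b13 →
    stepAdd (outAddr 10) b13 refl (outAddr-shift 9) (outAddr-word′ 10 (≤15⇒≤64+4n² 10 (m≤m+n 10 5))) λ b14 →
    stepConst b14 refl (word≤31 8 (m≤m+n 8 23)) λ b15 →
    stepAdd (outAddr 9) b15 refl (outAddr-shift 8) (outAddr-word′ 9 (≤15⇒≤64+4n² 9 (m≤m+n 9 6))) λ b16 →
    stepConst b16 refl (word≤31 7 (m≤m+n 7 24)) λ b17 →
    stepAdd (outAddr 8) b17 refl (outAddr-shift 7) (outAddr-word′ 8 (≤15⇒≤64+4n² 8 (m≤m+n 8 7))) λ b18 →
    stepConst b18 refl (word≤31 6 (m≤m+n 6 25)) λ b19 →
    stepAdd (outAddr 7) b19 refl (outAddr-shift 6) (outAddr-word′ 7 (≤15⇒≤64+4n² 7 (m≤m+n 7 8))) λ b20 →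
    stepConst b20 refl (word≤31 5 (m≤m+n 5 26)) λ b21 →
    stepAdd (outAddr 6) b21 refl (outAddr-shift 5) (outAddr-word′ 6 (≤15⇒≤64+4n² 6 (m≤m+n 6 9))) λ b22 →
    stepConst b22 refl (word≤31 4 (m≤m+n 4 27)) λ b23 →
    stepAdd (outAddr 5) b23 refl (outAddr-shift 4) (outAddr-word′ 5 (≤15⇒≤64+4n² 5 (m≤m+n 5 10))) λ b24 →
    stepConst b24 refl (word≤31 3 (m≤m+n 3 28)) λ b25 →
    stepAdd (outAddr 4) b25 refl (outAddr-shift 3) (outAddr-word′ 4 (≤15⇒≤64+4n² 4 (m≤m+n 4 11))) λ b26 →
    stepConst b26 refl (word≤31 2 (m≤m+n 2 29)) λ b27 →
    stepAdd (outAddr 3) b27 refl (outAddr-shift 2) (outAddr-word′ 3 (≤15⇒≤64+4n² 3 (m≤m+n 3 12))) λ b28 →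
    stepConst b28 refl (word≤31 1 (m≤m+n 1 30)) λ b29 →
    stepAdd (outAddr 2) b29 refl (outAddr-shift 1) (outAddr-word′ 2 (≤15⇒≤64+4n² 2 (m≤m+n 2 13))) λ b30 →
    stepLoad (F 0) b30 refl (imageKept C 0) λ b31 →
    stepLoad (F 1) b31 refl (imageKept C 1) λ b32 →
    stepLoad (F 2) b32 refl (imageKept C 2) λ b33 →
    stepLoad (F 3) b33 refl (imageKept C 3) λ b34 →
    stepLoad (F 4) b34 refl (imageKept C 4) λ b35 →
    stepLoad (F 5) b35 refl (imageKept C 5) λ b36 →
    stepLoad (F 6) b36 refl (imageKept C 6) λ b37 →
    stepLoad (F 7) b37 refl (imageKept C 7) λ b38 →
    stepLoad (F 8) b38 refl (imageKept C 8) λ b39 →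
    stepLoad (F 9) b39 refl (imageKept C 9) λ b40 →
    stepLoad (F 10) b40 refl (imageKept C 10) λ b41 →
    stepLoad (F 11) b41 refl (imageKept C 11) λ b42 →
    stepLoad (F 12) b42 refl (imageKept C 12) λ b43 →
    stepLoad (F 13) b43 refl (imageKept C 13) λ b44 →
    stepLoad (F 14) b44 refl (imageKept C 14) λ b45 →
    stepLoad (F 15) b45 refl (imageKept C 15) λ b46 →
    arrive b46 (agree-below16 _ F refl refl refl refl refl refl refl refl refl refl refl refl refl refl refl refl , λ a al → copiedPrefix C a al)
    ))

  writeOutput : ∀ m → Bounded m → AllEmitted m → Reaches (config 154 m) (At 212 (OutputWritten (λ a → m (outAddr a)))) (5 + (outputCopyCount * 6 + (2 + 46)))
  writeOutput m b P = thenAt (output-setup m b P) λ m' b' C → thenAt (loopAt 159 (OutputCopyInv (λ a → m (outAddr a))) outputCopyCount 6 (λ x m'' xl b'' C'' → output-copyStep (λ a → m (outAddr a)) x m'' xl b'' C'') m' b' C) λ m'' b'' C'' → output-restoreRegisters (λ a → m (outAddr a)) m'' b'' C''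

applyUpTo-nth : ∀ (f : ℕ → Rect) L → (∀ t → t < length L → f t ≡ nth L t) → applyUpTo f (length L) ≡ L
applyUpTo-nth f [] h = refl
applyUpTo-nth f (x ∷ L) h = cong₂ _∷_ (h 0 (s≤s z≤n)) (applyUpTo-nth (λ t → f (suc t)) L (λ t lt → h (suc t) (s≤s lt)))

module Correctness {n : ℕ} (M : Matrix n) where
  open WriteOutput M public

  decode-written : ∀ m → AllEmitted m → ∀ c → At 212 (OutputWritten (λ a → m (outAddr a))) c → At 212 (λ mf → decodeOutput mf ≡ greedy) c
  decode-written m P (config p mf) (refl , (lo , hi)) = refl , res
    where
      F : ℕ → ℕ
      F a = m (outAddr a)
      mfa : ∀ a → a < outputEnd → mf a ≡ F a
      mfa a lt with a ≤? 15
      ... | yes le = lo a le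
      ... | no a≰15 = subst (λ z → mf z ≡ F z) e (hi (a ∸ 16) (∸-monoˡ-< lt (≰⇒> a≰15)))
        where
          e : 16 + (a ∸ 16) ≡ a
          e = m+[n∸m]≡n (≰⇒> a≰15)
      fld : ∀ t c → t < count → c ≤ 3 → suc c + 4 * t < outputEnd
      fld t c tk c3 = begin-strict
          suc c + 4 * t ≤⟨ +-monoˡ-≤ (4 * t) (s≤s c3) ⟩
          4 + 4 * t ≡⟨ sym (*-suc 4 t) ⟩
          4 * suc t ≤⟨ *-monoʳ-≤ 4 tk ⟩
          4 * count <⟨ s≤s ≤-refl ⟩
          suc (4 * count) ≡⟨ solve 1 (λ a → con 1 :+ con 4 :* a := (a :+ a) :+ (a :+ a) :+ con 1) refl count ⟩
          outputEnd ∎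
        where open ≤-Reasoning
      dr : ∀ t → t < length greedy → decodeRect mf t ≡ nth greedy t
      dr t lt = trans (cong-rect (mfa _ (fld t 0 lt z≤n)) (mfa _ (fld t 1 lt (s≤s z≤n))) (mfa _ (fld t 2 lt (s≤s (s≤s z≤n)))) (mfa _ (fld t 3 lt (s≤s (s≤s (s≤s z≤n)))))) (imageStored P t lt)
      m0 : mf 0 ≡ length greedy
      m0 = trans (lo 0 z≤n) (countStored P)
      res : decodeOutput mf ≡ greedy
      res = trans (cong (applyUpTo (decodeRect mf)) m0) (applyUpTo-nth (decodeRect mf) greedy dr)

  totalTime : ℕ
  totalTime = (8 + (10 + (copyCount * 7 + 2))) + ((6 + (6 + (6 + (6 + (6 + 6)))))
       + ((11 + (n * (3 + (n * 13 + 6)) + 2)) + ((10 + (n * (2 + (n * (12 + (17 + 2)) + 6)) + 3)) + (5 + (outputCopyCount * 6 + (2 + 46))))))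

  program-outputs-greedy : Reaches (initConfig M) (At 212 (λ m → decodeOutput m ≡ greedy)) totalTime
  program-outputs-greedy =
    thenAt packAndCopy λ m b P → thenAt (unpackLowBits m b P) λ m b U → thenAt (fillEndTable m b U) λ m b P3 →
    thenAt (emitBlocks m b P3) λ m b P4 → reach-map (decode-written m P4) (writeOutput m b P4)

  copyCount≤ : copyCount ≤ n * n + 1
  copyCount≤ = m∸n≤m (n * n + 1) 6

  outputCopyCount≤ : outputCopyCount ≤ 64 + 4 * (n * n)
  outputCopyCount≤ = ≤-trans (m∸n≤m outputEnd 16) outputEnd≤

  n≤n*n+1 : n ≤ n * n + 1
  n≤n*n+1 = g n
    where
      g : ∀ q → q ≤ q * q + 1
      g zero = z≤n
      g (suc m) = ≤-trans (m≤m*n (suc m) (suc m)) (m≤m+n _ 1)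

  totalTime≤ : totalTime ≤ 600 * (n * n) + 600
  totalTime≤ = begin
      totalTime ≡⟨ solve 3 (λ a b c → (con 8 :+ (con 10 :+ (b :* con 7 :+ con 2))) :+ ((con 6 :+ (con 6 :+ (con 6 :+ (con 6 :+ (con 6 :+ con 6))))) :+ ((con 11 :+ (a :* (con 3 :+ (a :* con 13 :+ con 6))) :+ con 2) :+ ((con 10 :+ (a :* (con 2 :+ (a :* (con 12 :+ (con 17 :+ con 2)) :+ con 6))) :+ con 3) :+ (con 5 :+ (c :* con 6 :+ (con 2 :+ con 46)))))) := con 135 :+ con 17 :* a :+ con 44 :* (a :* a) :+ con 7 :* b :+ con 6 :* c) refl n copyCount outputCopyCount ⟩
      135 + 17 * n + 44 * (n * n) + 7 * copyCount + 6 * outputCopyCount ≤⟨ +-mono-≤ (+-mono-≤ (+-monoˡ-≤ (44 * (n * n)) (+-monoʳ-≤ 135 (*-monoʳ-≤ 17 n≤n*n+1))) (*-monoʳ-≤ 7 copyCount≤)) (*-monoʳ-≤ 6 outputCopyCount≤) ⟩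
      135 + 17 * (n * n + 1) + 44 * (n * n) + 7 * (n * n + 1) + 6 * (64 + 4 * (n * n)) ≡⟨ solve 1 (λ a → con 135 :+ con 17 :* (a :+ con 1) :+ con 44 :* a :+ con 7 :* (a :+ con 1) :+ con 6 :* (con 64 :+ con 4 :* a) := con 92 :* a :+ con 543) refl (n * n) ⟩
      92 * (n * n) + 543 ≤⟨ +-mono-≤ (*-monoˡ-≤ (n * n) (m≤m+n 92 508)) (m≤m+n 543 57) ⟩
      600 * (n * n) + 600 ∎
    where open ≤-Reasoning

  Good : List Rect → Set
  Good R′ = IsDecomposition M R′ × (∀ (R : List Rect) → IsDecomposition M R → length R′ ≤ 4 * length R)

  greedy-good : Good greedy
  greedy-good = greedy-isDecomposition , LowerBound.greedy-≤-4*length M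

lemma3 : ∃[ c ] (0 < c × ∃[ P ] ∃[ C ] ∃[ w ]
    (∀ (n : ℕ) (M : Matrix n) →
    RunsWithin P w (C * (n * n) + C) M
    (λ R′ → IsDecomposition M R′ ×
    (∀ (R : List Rect) → IsDecomposition M R →
    length R′ ≤ c * length R))))
lemma3 = 4 , z<s , program , 600 , 10 , λ n M →
  let open Correctness M in
  halting⇒RunsWithin M {w = 10} {Good = Good} refl B-def
    (reach-mono totalTime≤ (reach-map (At-map (λ output≡greedy → subst Good (sym output≡greedy) greedy-good)) program-outputs-greedy))
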